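{- Set $u=1$. Then: (a) $A_{i,j,k,\ell}$ is the weight generating function for all possible new 1-columns that can be added to the left of a rhombic staircase tableau with $i$ horizontal $\delta$-strips and $k$ horizontal $\alpha/\gamma$-strips so as to obtain a tableau with $j$ horizontal $\delta$-strips and $\ell$ horizontal $\alpha/\gamma$-strips; (b) $D^{(t)}_{i,j,k,\ell}$ is the weight generating function for all possible new 02-columns with an $\alpha$ or $\delta$ in the bottom square that can be added to the left of a rhombic staircase tableau with precisely $t$ 1-columns, $i$ horizontal $\delta$-strips and $k$ horizontal $\alpha/\gamma$-strips, so as to obtain a tableau with $j$ horizontal $\delta$-strips and $\ell$ horizontal $\alpha/\gamma$-strips; (c) the same as (b) holds for $E^{(t)}_{i,j,k,\ell}$, with new 02-columns having a $\beta$ or $\gamma$ in the bottom square.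
   Context: Matrices ($[t]_q=1+q+\dots+q^{t-1}$; entries with negative index are $0$): $D^{(t)}_{i,j,k,\ell}=0$ if $j<i$ or $\ell>k+1$; $=\alpha q^i$ if $k=0,\ell=1,i=j$; $=\delta q^i(q^t+(\alpha+\gamma q^t)[t]_q)$ if $k=\ell=0,j=i+1$; otherwise $=\delta(D^{(t)}+E^{(t)})_{i,j-1,k-1,\ell}+D^{(t)}_{i,j,k-1,\ell-1}$. $E^{(t)}_{i,j,k,\ell}=0$ if $j<i$ or $\ell>k+1$; $=\gamma q^{2t+i}$ if $k=0,\ell=1,i=j$; $=\beta q^i(q^t+(\alpha+\gamma q^t)[t]_q)$ if $k=\ell=0,i=j$; otherwise $=\beta(D^{(t)}+E^{(t)})_{i,j,k-1,\ell}+qE^{(t)}_{i,j,k-1,\ell-1}$. $A_{i,j,k,\ell}=0$ if $\ell>k$ or $j-i>k-\ell$; $=q^{2i}$ if $i=j,k=\ell=0$; otherwise $=\beta A_{i,j,k-1,\ell}+\delta qA_{i,j-1,k-1,\ell}+qA_{i,j,k-1,\ell-1}$. Tableaux: for $\tau\in\{0,1,2\}^N$ ($j$ a 1-position if $\tau_j=1$, else a 02-position), the maximal tiling of $\Gamma(\tau)$ has columns $C_1..C_N$ right to left; a 02-column $C_j$ has squares $s(p,j)$ for 02-positions $p\le j$ ($s(j,j)$, the corner, at the bottom, $s(p,j)$ above $s(p',j)$ if $p<p'$) topped by one short rhombus per 1-position $i<j$; a 1-column $C_j$ has tall rhombi $\rho(p,j)$, one per 02-position $p<j$. Vertical strips: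 the 02-columns (bottom to top). Horizontal strip $H_p$ ($p$ a 02-position): $s(p,p)$ and $s(p,j)$ or $\rho(p,j)$ for $j>p$, right to left. Rhombic staircase tableau: squares empty or $\alpha,\beta,\gamma,\delta$; tall rhombi empty or $\beta u,\delta q$; short rhombi empty or $\alpha u,\gamma q$; lowest square of each vertical strip nonempty; tiles above an $\alpha/\gamma$ (incl. $\alpha u,\gamma q$) in a vertical strip empty; tiles left of a $\beta/\delta$ (incl. $\beta u,\delta q$) in a horizontal strip empty. A horizontal strip is a $\delta$-strip (resp. $\alpha/\gamma$-strip) if its leftmost tile containing a Greek letter contains $\delta$ (resp. $\alpha$ or $\gamma$). Weight of an empty tile ("sees" = closest nonempty tile to the right in its horizontal strip / below in its vertical strip; $\alpha u$ etc. count as $\alpha$ etc.): square seeing $\beta$/$\delta$ right: $u$/$q$; seeing $\alpha/\gamma$ right and $\alpha/\delta$ below: $u$; seeing $\alpha/\gamma$ right and $\beta/\gamma$ below: $q$; tall rhombus seeing $\beta$, $\delta$, $\alpha/\gamma$ right: $u^2,q^2,uq$; short rhombus seeing $\alpha$, $\gamma$, $\beta/\delta$ below: $u^2,q^2,uq$. Adding a new column to the left of a tableau $T$ of type $\sigma\in\{0,1,2\}^n$ means forming a tableau $T'$ of type $\sigma c$ ($c\in\{0,1,2\}$) whose restriction to $C_1..C_n$ is $T$; the weight of the new column is the product of labels and assigned monomials of the tiles of $C_{n+1}$. A 02-column added to a tableau with $t$ 1-columns has $t$ short rhombi. -}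

module Defs where

open import Level using (0ℓ)
open import Data.Bool using (Bool; true; false; if_then_else_; _∧_; _∨_; not)
open import Data.Nat using (ℕ; zero; suc; _∸_; _≡ᵇ_; _<ᵇ_; _≤ᵇ_) renaming (_+_ to _+ℕ_)
open import Data.List using (List; []; _∷_; _++_; map; length; foldr; _∷ʳ_)
open import Data.Vec using (Vec; []; _∷_)
open import Algebra.Bundles using (CommutativeSemiring)

data Ty : Set where
  t0 t1 t2 : Ty

-- Labels of tiles.  For rhombi, the labels βu, δq (tall) and αu, γq
-- (short) are represented by β, δ and α, γ respectively; the extra
-- factor u (=1) or q is put into the weight below.
data Label : Set where
  empty α β γ δ : Label

isEmpty : Label → Bool
isEmpty empty = true
isEmpty _     = false

isAG : Label → Bool
isAG α = true
isAG γ = true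
isAG _ = false

isBD : Label → Bool
isBD β = true
isBD δ = true
isBD _ = false

isAD : Label → Bool
isAD α = true
isAD δ = true
isAD _ = false

isBG : Label → Bool
isBG β = true
isBG γ = true
isBG _ = false

isδ : Label → Bool
isδ δ = true
isδ _ = false

isOne : Ty → Bool
isOne t1 = true
isOne _  = false

filterᵇ : {A : Set} → (A → Bool) → List A → List A
filterᵇ P [] = []
filterᵇ P (x ∷ xs) = if P x then x ∷ filterᵇ P xs else filterᵇ P xs

allᵇ : {A : Set} → (A → Bool) → List A → Bool
allᵇ P [] = true
allᵇ P (x ∷ xs) = P x ∧ allᵇ P xs

countᵇ : {A : Set} → (A → Bool) → List A → ℕ
countᵇ P xs = length (filterᵇ P xs)

before : ℕ → List ℕ → List ℕ
before x [] = []
before x (y ∷ ys) = if y ≡ᵇ x then [] else y ∷ before x ys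

lastNonEmpty : List Label → Label
lastNonEmpty [] = empty
lastNonEmpty (l ∷ ls) with lastNonEmpty ls
... | empty = l
... | l'    = l'

afterEmpty : (Label → Bool) → List Label → Bool
afterEmpty P [] = true
afterEmpty P (l ∷ ls) = if P l then allᵇ isEmpty ls else afterEmpty P ls

up : ℕ → List ℕ
up zero = []
up (suc n) = up n ∷ʳ suc n

down : ℕ → List ℕ
down zero = []
down (suc n) = suc n ∷ down n

-- Type σ = σ_1 … σ_N (a list; σ_j is the j-th entry, 1-based).
-- Column C_j corresponds to position j; C_1 is rightmost.
-- Adding a new column of type c to the left gives type σ ∷ʳ c.

ty : List Ty → ℕ → Ty
ty [] _ = t1
ty (c ∷ σ) zero = t1
ty (c ∷ σ) (suc zero) = c
ty (c ∷ σ) (suc (suc p)) = ty σ (suc p)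

inRange : List Ty → ℕ → Bool
inRange σ p = (1 ≤ᵇ p) ∧ (p ≤ᵇ length σ)

is02 : List Ty → ℕ → Bool
is02 σ p = inRange σ p ∧ not (isOne (ty σ p))

is1 : List Ty → ℕ → Bool
is1 σ p = inRange σ p ∧ isOne (ty σ p)

-- Tiles of column C_j are indexed by a position p ≤ j:
--   square s(p,j)     : p, j 02-positions, p ≤ j
--   short rhombus     : p a 1-position, j a 02-position, p < j
--   tall rhombus ρ(p,j): p a 02-position, j a 1-position, p < j
isSquare : List Ty → ℕ → ℕ → Bool
isSquare σ p j = is02 σ p ∧ is02 σ j ∧ (p ≤ᵇ j)

isShort : List Ty → ℕ → ℕ → Bool
isShort σ p j = is1 σ p ∧ is02 σ j ∧ (p <ᵇ j)

isTall : List Ty → ℕ → ℕ → Bool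
isTall σ p j = is02 σ p ∧ is1 σ j ∧ (p <ᵇ j)

isTile : List Ty → ℕ → ℕ → Bool
isTile σ p j = isSquare σ p j ∨ isShort σ p j ∨ isTall σ p j

-- A filling: T p j is the label of the tile of column C_j indexed by p.
-- (Only the values at tiles and at 1 ≤ p ≤ j ≤ N are ever inspected.)
Tab : Set
Tab = ℕ → ℕ → Label

-- Vertical strip of the 02-column C_j, bottom to top, as list of
-- indices p: corner s(j,j), squares s(p,j) for 02-positions p<j with
-- larger p lower, then the short rhombi (convention: larger p lower).
vstrip : List Ty → ℕ → List ℕ
vstrip σ j = j ∷ (filterᵇ (is02 σ) (down (j ∸ 1)) ++ filterᵇ (is1 σ) (down (j ∸ 1)))

-- Horizontal strip H_p (p a 02-position), right to left, as list of
-- columns j: p, p+1, …, N.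
hstrip : List Ty → ℕ → List ℕ
hstrip σ p = filterᵇ (λ j → p ≤ᵇ j) (up (length σ))

vlabels : List Ty → Tab → ℕ → List Label
vlabels σ T j = map (λ p → T p j) (vstrip σ j)

hlabels : List Ty → Tab → ℕ → List Label
hlabels σ T p = map (λ j → T p j) (hstrip σ p)

seesBelow : List Ty → Tab → ℕ → ℕ → Label
seesBelow σ T p j = lastNonEmpty (map (λ p' → T p' j) (before p (vstrip σ j)))

seesRight : List Ty → Tab → ℕ → ℕ → Label
seesRight σ T p j = lastNonEmpty (map (λ j' → T p j') (before j (hstrip σ p)))

allowed : List Ty → ℕ → ℕ → Label → Bool
allowed σ p j l =
  if isSquare σ p j then true
  else if isTall σ p j then (isEmpty l ∨ isBD l)
  else if isShort σ p j then (isEmpty l ∨ isAG l)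
  else isEmpty l

valid : List Ty → Tab → Bool
valid σ T =
     allᵇ (λ j → allᵇ (λ p → allowed σ p j (T p j)) (up j)) (up (length σ))
  ∧ allᵇ (λ j → not (isEmpty (T j j))) (filterᵇ (is02 σ) (up (length σ)))
  ∧ allᵇ (λ j → afterEmpty isAG (vlabels σ T j)) (filterᵇ (is02 σ) (up (length σ)))
  ∧ allᵇ (λ p → afterEmpty isBD (hlabels σ T p)) (filterᵇ (is02 σ) (up (length σ)))

nDelta : List Ty → Tab → ℕ
nDelta σ T = countᵇ (λ p → isδ (lastNonEmpty (hlabels σ T p))) (filterᵇ (is02 σ) (up (length σ)))

nAG : List Ty → Tab → ℕ
nAG σ T = countᵇ (λ p → isAG (lastNonEmpty (hlabels σ T p))) (filterᵇ (is02 σ) (up (length σ)))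

nOnes : List Ty → ℕ
nOnes σ = countᵇ isOne σ

allVec : (m : ℕ) → List (Vec Label m)
allVec zero = [] ∷ []
allVec (suc m) = foldr (λ l acc → map (l ∷_) (allVec m) ++ acc) [] (empty ∷ α ∷ β ∷ γ ∷ δ ∷ [])

vget : {m : ℕ} → Vec Label m → ℕ → Label
vget [] _ = empty
vget (x ∷ v) zero = empty
vget (x ∷ v) (suc zero) = x
vget (x ∷ v) (suc (suc p)) = vget v (suc p)

extend : ℕ → Tab → {m : ℕ} → Vec Label m → Tab
extend n T v p j = if j ≡ᵇ suc n then vget v p else T p j

-- Weights and generating functions, with u = 1, in an arbitrary
-- commutative semiring R with elements q, a(=α), b(=β), g(=γ), d(=δ).

module Weights (R : CommutativeSemiring 0ℓ 0ℓ)
               (q a b g d : CommutativeSemiring.Carrier R) where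
  open CommutativeSemiring R

  pow : Carrier → ℕ → Carrier
  pow x zero = 1#
  pow x (suc n) = x * pow x n

  qint : ℕ → Carrier
  qint zero = 0#
  qint (suc t) = qint t + pow q t

  prod : List Carrier → Carrier
  prod = foldr _*_ 1#

  sumR : List Carrier → Carrier
  sumR = foldr _+_ 0#

  letter : Label → Carrier
  letter α = a
  letter β = b
  letter γ = g
  letter δ = d
  letter empty = 1#

  tileWeight : List Ty → Tab → ℕ → ℕ → Carrier
  tileWeight σ T p j with isSquare σ p j | isTall σ p j | T p j
  ... | true | _ | empty with seesRight σ T p j
  ...   | β = 1#
  ...   | δ = q
  ...   | α = if isAD (seesBelow σ T p j) then 1# else if isBG (seesBelow σ T p j) then q else 1#
  ...   | γ = if isAD (seesBelow σ T p j) then 1# else if isBG (seesBelow σ T p j) then q else 1#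
  ...   | empty = 1#
  tileWeight σ T p j | true | _ | l = letter l
  tileWeight σ T p j | false | true | empty with seesRight σ T p j
  ...   | β = 1#
  ...   | δ = q * q
  ...   | α = q
  ...   | γ = q
  ...   | empty = 1#
  tileWeight σ T p j | false | true | β = b
  tileWeight σ T p j | false | true | δ = d * q
  tileWeight σ T p j | false | true | l = letter l
  tileWeight σ T p j | false | false | empty with seesBelow σ T p j
  ...   | α = 1#
  ...   | γ = q * q
  ...   | β = q
  ...   | δ = q
  ...   | empty = 1#
  tileWeight σ T p j | false | false | α = a
  tileWeight σ T p j | false | false | γ = g * q
  tileWeight σ T p j | false | false | l = letter l

  colWeight : List Ty → Tab → ℕ → Carrier
  colWeight σ T j = prod (map (λ p → tileWeight σ T p j) (filterᵇ (λ p → isTile σ p j) (up j)))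

  newColGF : Ty → (Label → Bool) → List Ty → Tab → ℕ → ℕ → Carrier
  newColGF c bot σ T j ℓ =
    sumR (map (λ v →
      let σ' = σ ∷ʳ c
          n  = length σ
          T' = extend n T v
      in if valid σ' T' ∧ bot (T' (suc n) (suc n))
            ∧ (nDelta σ' T' ≡ᵇ j) ∧ (nAG σ' T' ≡ᵇ ℓ)
         then colWeight σ' T' (suc n) else 0#)
      (allVec (suc (length σ))))

  -- The matrices D^{(t)}, E^{(t)}, A (negative indices give 0)
  base : ℕ → ℕ → Carrier
  base t i = pow q i * (pow q t + (a + g * pow q t) * qint t)

  mutual
    Dm : ℕ → ℕ → ℕ → ℕ → ℕ → Carrier
    Dm t i j k ℓ =
      if (j <ᵇ i) ∨ (suc k <ᵇ ℓ) then 0# else Dm' t i j k ℓ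

    Dm' : ℕ → ℕ → ℕ → ℕ → ℕ → Carrier
    Dm' t i j zero ℓ =
      if (ℓ ≡ᵇ 1) ∧ (i ≡ᵇ j) then a * pow q i
      else if (ℓ ≡ᵇ 0) ∧ (j ≡ᵇ suc i) then d * base t i
      else 0#
    Dm' t i j (suc k) ℓ =
      d * (DEj t i j k ℓ) + Dℓ t i j k ℓ

    DEj : ℕ → ℕ → ℕ → ℕ → ℕ → Carrier
    DEj t i zero k ℓ = 0#
    DEj t i (suc j) k ℓ = Dm t i j k ℓ + Em t i j k ℓ

    Dℓ : ℕ → ℕ → ℕ → ℕ → ℕ → Carrier
    Dℓ t i j k zero = 0#
    Dℓ t i j k (suc ℓ) = Dm t i j k ℓ

    Em : ℕ → ℕ → ℕ → ℕ → ℕ → Carrier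
    Em t i j k ℓ =
      if (j <ᵇ i) ∨ (suc k <ᵇ ℓ) then 0# else Em' t i j k ℓ

    Em' : ℕ → ℕ → ℕ → ℕ → ℕ → Carrier
    Em' t i j zero ℓ =
      if (ℓ ≡ᵇ 1) ∧ (i ≡ᵇ j) then g * pow q (t +ℕ t +ℕ i)
      else if (ℓ ≡ᵇ 0) ∧ (i ≡ᵇ j) then b * base t i
      else 0#
    Em' t i j (suc k) ℓ =
      b * (Dm t i j k ℓ + Em t i j k ℓ) + q * Eℓ t i j k ℓ

    Eℓ : ℕ → ℕ → ℕ → ℕ → ℕ → Carrier
    Eℓ t i j k zero = 0#
    Eℓ t i j k (suc ℓ) = Em t i j k ℓ

  pred0 : (ℕ → Carrier) → ℕ → Carrier
  pred0 f zero = 0#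
  pred0 f (suc n) = f n

  Am : ℕ → ℕ → ℕ → ℕ → Carrier
  Am i j k ℓ =
    -- ℓ > k  or  j - i > k - ℓ  (i.e. j + ℓ > i + k)
    if (k <ᵇ ℓ) ∨ (i +ℕ k <ᵇ j +ℕ ℓ) then 0# else Am' i j k ℓ
    where
    Am' : ℕ → ℕ → ℕ → ℕ → Carrier
    Am' i j zero ℓ = if (i ≡ᵇ j) ∧ (ℓ ≡ᵇ 0) then pow q (i +ℕ i) else 0#
    Am' i j (suc k) ℓ =
      b * Am i j k ℓ + d * q * pred0 (λ j' → Am i j' k ℓ) j
        + q * pred0 (λ ℓ' → Am i j k ℓ') ℓ

module Submission where

-- Read the new column bottom to top.  Each of its tiles lies in a known
-- horizontal strip of the old tableau, so its constraints and its weight depend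
-- only on (i) the last label of that strip, (ii) the label seen below it in the
-- new column and (iii) its own label.  The column is therefore a run of a small
-- automaton over a list of tile kinds, and its generating function `cellsGF` can
-- be expanded one tile at a time.  Expanding the corner, then the squares of the
-- strips (by induction on the list of strip labels) reproduces exactly the
-- recurrences defining D and E; expanding the tall rhombi of a 1-column
-- reproduces the recurrence of A.

open import Defs
open import Level using (0ℓ)
open import Data.Bool using (Bool; true; false; if_then_else_; _∧_; _∨_; not) renaming (T to IsTrue)
open import Data.Bool.Properties using (∧-assoc; ∧-comm; ∧-identityʳ; ∧-zeroʳ; not-involutive; ∧-commutativeMonoid)
open import Algebra.Solver.CommutativeMonoid ∧-commutativeMonoid using (_⊕_; _⊜_; id) renaming (solve to ∧-solve)
open import Data.Nat using (ℕ; zero; suc; _≤_; _<_; s≤s; z≤n; _≡ᵇ_; _≤ᵇ_; _<ᵇ_; _∸_; _≟_) renaming (_+_ to _+ℕ_)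
open import Data.Nat.Properties using (<ᵇ⇒<; <⇒<ᵇ; ≤⇒≤ᵇ; +-suc; n<1+n; <-trans; ≤-refl; ≤-trans; m≤n⇒m≤1+n; ≤-pred)
import Data.Nat.Properties as ℕₚ
open import Data.List using (List; []; _∷_; _++_; map; length; foldr; _∷ʳ_; replicate)
open import Data.List.Properties using (map-cong-local; map-cong; map-++; map-∘; map-id; length-map)
open import Data.List.Relation.Unary.All as All using (All; []; _∷_)
import Data.List.Relation.Unary.All.Properties as AllP
open import Data.List.Relation.Unary.Any using (here; there)
open import Data.List.Membership.Propositional using (_∈_)
open import Data.List.Membership.Propositional.Properties using (∈-++⁺ʳ; ∈-++⁺ˡ)
open import Data.List.Relation.Binary.Permutation.Propositional using (_↭_; ↭-sym)
  renaming (refl to ↭refl; prep to ↭prep; swap to ↭swap; trans to ↭trans)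
open import Data.List.Relation.Binary.Permutation.Propositional.Properties using (∷↭∷ʳ; shift; map⁺; ↭-length; All-resp-↭)
open import Data.Nat.ListAction using (sum)
open import Data.Nat.ListAction.Properties using (sum-++; sum-↭)
open import Data.Vec using (Vec; []; _∷_)
open import Data.Product using (_×_; _,_; proj₁; proj₂)
open import Data.Sum using (_⊎_; inj₁; inj₂)
open import Data.Unit using (⊤; tt)
open import Data.Empty using (⊥; ⊥-elim)
open import Relation.Nullary using (yes; no)
open import Relation.Binary.PropositionalEquality as P using (_≡_; _≢_)
open import Algebra.Bundles using (CommutativeSemiring)

module CellAutomaton where

  -- The label a reader of a strip "sees" after passing a tile labelled l,
  -- having seen x before: empty tiles are transparent.
  latest : Label → Label → Label
  latest x empty = x
  latest x α = α
  latest x β = β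
  latest x γ = γ
  latest x δ = δ

  -- What a tile of the new column is, read off from the old tableau:
  -- the corner s(N,N) (with a predicate its label must satisfy), a square
  -- or a tall rhombus in a horizontal strip whose last label so far is s,
  -- a short rhombus, or no tile at all (a 1-row of a new 1-column).
  data Kind : Set where
    corner : (Label → Bool) → Kind
    square : Label → Kind
    shortRh : Kind
    tallRh : Label → Kind
    noTile : Kind

  labelOK : Kind → Label → Bool
  labelOK (corner bot) l = not (isEmpty l) ∧ bot l
  labelOK (square s) l = not (isBD s) ∨ isEmpty l
  labelOK shortRh l = isEmpty l ∨ isAG l
  labelOK (tallRh s) l = (isEmpty l ∨ isBD l) ∧ (not (isBD s) ∨ isEmpty l)
  labelOK noTile l = isEmpty l

  -- The α/γ rule inside the vertical strip of a new 02-column, given the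
  -- label x seen below; a new 1-column has no vertical strip.
  verticalOK : Kind → Label → Label → Bool
  verticalOK (corner _) x l = not (isAG x) ∨ isEmpty l
  verticalOK (square _) x l = not (isAG x) ∨ isEmpty l
  verticalOK shortRh x l = not (isAG x) ∨ isEmpty l
  verticalOK (tallRh _) x l = true
  verticalOK noTile x l = true

  cellOK : Kind → Label → Label → Bool
  cellOK k x l = labelOK k l ∧ verticalOK k x l

  δStrip : Kind → Label → Bool
  δStrip (corner _) l = isδ l
  δStrip (square s) l = isδ (latest s l)
  δStrip shortRh l = false
  δStrip (tallRh s) l = isδ (latest s l)
  δStrip noTile l = false

  agStrip : Kind → Label → Bool
  agStrip (corner _) l = isAG l
  agStrip (square s) l = isAG (latest s l)
  agStrip shortRh l = false
  agStrip (tallRh s) l = isAG (latest s l)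
  agStrip noTile l = false

  bit : Bool → ℕ
  bit true = 1
  bit false = 0

module ListFacts where

  open CellAutomaton

  allᵇ-++ : ∀ {A : Set} (Q : A → Bool) xs ys → allᵇ Q (xs ++ ys) ≡ allᵇ Q xs ∧ allᵇ Q ys
  allᵇ-++ Q [] ys = P.refl
  allᵇ-++ Q (x ∷ xs) ys rewrite allᵇ-++ Q xs ys = P.sym (∧-assoc (Q x) _ _)

  filterᵇ-++ : ∀ {A : Set} (Q : A → Bool) xs ys → filterᵇ Q (xs ++ ys) ≡ filterᵇ Q xs ++ filterᵇ Q ys
  filterᵇ-++ Q [] ys = P.refl
  filterᵇ-++ Q (x ∷ xs) ys with Q x
  ... | true = P.cong (x ∷_) (filterᵇ-++ Q xs ys)
  ... | false = filterᵇ-++ Q xs ys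

  allᵇ-congA : ∀ {A : Set} {Q Q' : A → Bool} {xs} → All (λ x → Q x ≡ Q' x) xs → allᵇ Q xs ≡ allᵇ Q' xs
  allᵇ-congA [] = P.refl
  allᵇ-congA (e ∷ es) = P.cong₂ _∧_ e (allᵇ-congA es)

  filterᵇ-congA : ∀ {A : Set} {Q Q' : A → Bool} {xs} → All (λ x → Q x ≡ Q' x) xs → filterᵇ Q xs ≡ filterᵇ Q' xs
  filterᵇ-congA {xs = []} [] = P.refl
  filterᵇ-congA {Q = Q} {Q'} {x ∷ xs} (e ∷ es) rewrite e with Q' x
  ... | true = P.cong (x ∷_) (filterᵇ-congA es)
  ... | false = filterᵇ-congA es

  All-filterᵇ : ∀ {A : Set} {R : A → Set} (Q : A → Bool) {xs} → All R xs → All R (filterᵇ Q xs)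
  All-filterᵇ Q [] = []
  All-filterᵇ Q {x ∷ xs} (r ∷ rs) with Q x
  ... | true = r ∷ All-filterᵇ Q rs
  ... | false = All-filterᵇ Q rs

  filterᵇ-sat : ∀ {A : Set} (Q : A → Bool) xs → All (λ x → Q x ≡ true) (filterᵇ Q xs)
  filterᵇ-sat Q [] = []
  filterᵇ-sat Q (x ∷ xs) with Q x in e
  ... | true = e ∷ filterᵇ-sat Q xs
  ... | false = filterᵇ-sat Q xs

  InRange : ℕ → ℕ → Set
  InRange n p = 1 ≤ p × p ≤ n

  up-inRange : ∀ n → All (InRange n) (up n)
  up-inRange zero = []
  up-inRange (suc n) = AllP.∷ʳ⁺ (All.map (λ { (a , b) → a , m≤n⇒m≤1+n b }) (up-inRange n)) (s≤s z≤n , ≤-refl)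

  down-inRange : ∀ n → All (InRange n) (down n)
  down-inRange zero = []
  down-inRange (suc n) = (s≤s z≤n , ≤-refl) ∷ All.map (λ { (a , b) → a , m≤n⇒m≤1+n b }) (down-inRange n)

  allᵇ-↭ : ∀ {A : Set} (Q : A → Bool) {xs ys} → xs ↭ ys → allᵇ Q xs ≡ allᵇ Q ys
  allᵇ-↭ Q ↭refl = P.refl
  allᵇ-↭ Q (↭prep x p) = P.cong (Q x ∧_) (allᵇ-↭ Q p)
  allᵇ-↭ Q (↭swap x y p) rewrite allᵇ-↭ Q p = P.trans (P.sym (∧-assoc (Q x) (Q y) _)) (P.trans (P.cong (_∧ _) (∧-comm (Q x) (Q y))) (∧-assoc (Q y) (Q x) _))
  allᵇ-↭ Q (↭trans p p') = P.trans (allᵇ-↭ Q p) (allᵇ-↭ Q p')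

  filterᵇ-↭ : ∀ {A : Set} (Q : A → Bool) {xs ys} → xs ↭ ys → filterᵇ Q xs ↭ filterᵇ Q ys
  filterᵇ-↭ Q ↭refl = ↭refl
  filterᵇ-↭ Q (↭prep x p) with Q x
  ... | true = ↭prep x (filterᵇ-↭ Q p)
  ... | false = filterᵇ-↭ Q p
  filterᵇ-↭ Q (↭swap x y p) with Q x | Q y
  ... | true | true = ↭swap x y (filterᵇ-↭ Q p)
  ... | true | false = ↭prep x (filterᵇ-↭ Q p)
  ... | false | true = ↭prep y (filterᵇ-↭ Q p)
  ... | false | false = filterᵇ-↭ Q p
  filterᵇ-↭ Q (↭trans p p') = ↭trans (filterᵇ-↭ Q p) (filterᵇ-↭ Q p')

  down↭up : ∀ n → down n ↭ up n
  down↭up zero = ↭refl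
  down↭up (suc n) = ↭trans (↭prep (suc n) (down↭up n)) (∷↭∷ʳ (suc n) (up n))

  filter-partition : ∀ {A : Set} (Q Q' : A → Bool) xs → All (λ x → Q' x ≡ not (Q x)) xs → filterᵇ Q xs ++ filterᵇ Q' xs ↭ xs
  filter-partition Q Q' [] [] = ↭refl
  filter-partition Q Q' (x ∷ xs) (e ∷ es) with Q x | Q' x
  ... | true | true = ⊥-elim (tf e)
    where tf : true ≡ false → ⊥
          tf ()
  ... | true | false = ↭prep x (filter-partition Q Q' xs es)
  ... | false | true = ↭trans (shift x (filterᵇ Q xs) (filterᵇ Q' xs)) (↭prep x (filter-partition Q Q' xs es))
  ... | false | false = ⊥-elim (tf e)
    where tf : false ≡ true → ⊥
          tf ()

  T→≡ : ∀ {b} → IsTrue b → b ≡ true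
  T→≡ {true} _ = P.refl

  ≡ᵇ-refl : ∀ n → (n ≡ᵇ n) ≡ true
  ≡ᵇ-refl zero = P.refl
  ≡ᵇ-refl (suc n) = ≡ᵇ-refl n

  ≡ᵇ-sym : ∀ m n → (m ≡ᵇ n) ≡ (n ≡ᵇ m)
  ≡ᵇ-sym zero zero = P.refl
  ≡ᵇ-sym zero (suc n) = P.refl
  ≡ᵇ-sym (suc m) zero = P.refl
  ≡ᵇ-sym (suc m) (suc n) = ≡ᵇ-sym m n

  ≤⇒≢ᵇ : ∀ {p n} → p ≤ n → (p ≡ᵇ suc n) ≡ false
  ≤⇒≢ᵇ {zero} {n} z≤n = P.refl
  ≤⇒≢ᵇ {suc p} {suc n} (s≤s le) = ≤⇒≢ᵇ le

  DistinctN : List ℕ → Set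
  DistinctN [] = ⊤
  DistinctN (p ∷ ps) = All (λ p' → (p' ≡ᵇ p) ≡ false) ps × DistinctN ps

  distinct-down : ∀ n → DistinctN (down n)
  distinct-down zero = tt
  distinct-down (suc n) = All.map (λ { (_ , le) → ≤⇒≢ᵇ le }) (down-inRange n) , distinct-down n

  distinct-↭ : ∀ {xs ys} → xs ↭ ys → DistinctN xs → DistinctN ys
  distinct-↭ ↭refl d = d
  distinct-↭ (↭prep x p) (a , d) = All-resp-↭ p a , distinct-↭ p d
  distinct-↭ (↭swap x y p) ((e ∷ a1) , a2 , d) = (P.trans (≡ᵇ-sym x y) e ∷ All-resp-↭ p a2) , All-resp-↭ p a1 , distinct-↭ p d
  distinct-↭ (↭trans p p') d = distinct-↭ p' (distinct-↭ p d)

  count≡sum : ∀ {A : Set} (Q : A → Bool) xs → countᵇ Q xs ≡ sum (map (λ x → bit (Q x)) xs)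
  count≡sum Q [] = P.refl
  count≡sum Q (x ∷ xs) with Q x
  ... | true = P.cong suc (count≡sum Q xs)
  ... | false = count≡sum Q xs

  latest-empty : ∀ x → latest empty x ≡ x
  latest-empty empty = P.refl
  latest-empty α = P.refl
  latest-empty β = P.refl
  latest-empty γ = P.refl
  latest-empty δ = P.refl

  lastSeen : Label → List Label → Label
  lastSeen x [] = x
  lastSeen x (l ∷ ls) = lastSeen (latest x l) ls

  lastSeen≡latest : ∀ x ls → lastSeen x ls ≡ latest x (lastNonEmpty ls)
  lastSeen≡latest x [] = P.refl
  lastSeen≡latest x (l ∷ ls) with lastNonEmpty ls | lastSeen≡latest (latest x l) ls
  ... | empty | e = e
  ... | α | e = e
  ... | β | e = e
  ... | γ | e = e
  ... | δ | e = e

  lastNonEmpty≡lastSeen : ∀ ls → lastNonEmpty ls ≡ lastSeen empty ls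
  lastNonEmpty≡lastSeen ls = P.trans (P.sym (latest-empty _)) (P.sym (lastSeen≡latest empty ls))

  lastSeen-snoc : ∀ x ls l → lastSeen x (ls ∷ʳ l) ≡ latest (lastSeen x ls) l
  lastSeen-snoc x [] l = P.refl
  lastSeen-snoc x (l' ∷ ls) l = lastSeen-snoc (latest x l') ls l

  lastNonEmpty-snoc : ∀ ls l → lastNonEmpty (ls ∷ʳ l) ≡ latest (lastNonEmpty ls) l
  lastNonEmpty-snoc ls l = P.trans (lastNonEmpty≡lastSeen (ls ∷ʳ l)) (P.trans (lastSeen-snoc empty ls l) (P.cong (λ u → latest u l) (P.sym (lastNonEmpty≡lastSeen ls))))

  lastSeen-nonempty : ∀ x ls → isEmpty x ≡ false → isEmpty (lastSeen x ls) ≡ false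
  lastSeen-nonempty x [] e = e
  lastSeen-nonempty x (empty ∷ ls) e = lastSeen-nonempty x ls e
  lastSeen-nonempty x (α ∷ ls) e = lastSeen-nonempty α ls P.refl
  lastSeen-nonempty x (β ∷ ls) e = lastSeen-nonempty β ls P.refl
  lastSeen-nonempty x (γ ∷ ls) e = lastSeen-nonempty γ ls P.refl
  lastSeen-nonempty x (δ ∷ ls) e = lastSeen-nonempty δ ls P.refl

  allᵇ-snoc : ∀ {A : Set} (Q : A → Bool) xs x → allᵇ Q (xs ∷ʳ x) ≡ allᵇ Q xs ∧ (Q x ∧ true)
  allᵇ-snoc Q xs x = allᵇ-++ Q xs (x ∷ [])

  lastSeen-empties : ∀ y ls → allᵇ isEmpty ls ≡ true → lastSeen y ls ≡ y
  lastSeen-empties y [] e = P.refl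
  lastSeen-empties y (empty ∷ ls) e = lastSeen-empties y ls e

  latest-notBD : ∀ x l → isBD x ≡ false → isBD l ≡ false → isBD (latest x l) ≡ false
  latest-notBD x empty e₁ e₂ = e₁
  latest-notBD x α e₁ e₂ = P.refl
  latest-notBD x γ e₁ e₂ = P.refl

  -- The β/δ rule for a horizontal strip extended by the tile of the new column:
  -- the old strip is valid, so only the new tile has to respect the last label.
  afterEmpty-BD-snoc : ∀ x ls → isBD x ≡ false → afterEmpty isBD ls ≡ true → ∀ l →
         afterEmpty isBD (ls ∷ʳ l) ≡ (not (isBD (lastSeen x ls)) ∨ isEmpty l)
  afterEmpty-BD-snoc x [] ex _ l rewrite ex with isBD l
  ... | true = P.refl
  ... | false = P.refl
  afterEmpty-BD-snoc x (l' ∷ ls) ex e l with isBD l' in el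
  ... | true rewrite allᵇ-snoc isEmpty ls l | e | lastSeen-empties (latest x l') ls e = P.trans (∧-identityʳ _) (bd l' el)
    where bd : ∀ l' → isBD l' ≡ true → isEmpty l ≡ (not (isBD (latest x l')) ∨ isEmpty l)
          bd β _ = P.refl
          bd δ _ = P.refl
  ... | false = afterEmpty-BD-snoc (latest x l') ls (latest-notBD x l' ex el) e l

  verticalFold : Label → List Label → Bool
  verticalFold x [] = true
  verticalFold x (l ∷ ls) = (not (isAG x) ∨ isEmpty l) ∧ verticalFold (latest x l) ls

  verticalFold-blocked : ∀ x ls → isAG x ≡ true → verticalFold x ls ≡ allᵇ isEmpty ls
  verticalFold-blocked x [] e = P.refl
  verticalFold-blocked x (empty ∷ ls) e rewrite e = verticalFold-blocked x ls e
  verticalFold-blocked x (α ∷ ls) e rewrite e = P.refl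
  verticalFold-blocked x (β ∷ ls) e rewrite e = P.refl
  verticalFold-blocked x (γ ∷ ls) e rewrite e = P.refl
  verticalFold-blocked x (δ ∷ ls) e rewrite e = P.refl

  verticalFold≡afterEmpty : ∀ x ls → isAG x ≡ false → verticalFold x ls ≡ afterEmpty isAG ls
  verticalFold≡afterEmpty x [] e = P.refl
  verticalFold≡afterEmpty x (empty ∷ ls) e rewrite e = verticalFold≡afterEmpty x ls e
  verticalFold≡afterEmpty x (α ∷ ls) e rewrite e = verticalFold-blocked α ls P.refl
  verticalFold≡afterEmpty x (β ∷ ls) e rewrite e = verticalFold≡afterEmpty β ls P.refl
  verticalFold≡afterEmpty x (γ ∷ ls) e rewrite e = verticalFold-blocked γ ls P.refl
  verticalFold≡afterEmpty x (δ ∷ ls) e rewrite e = verticalFold≡afterEmpty δ ls P.refl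

  before-head : ∀ p ps → before p (p ∷ ps) ≡ []
  before-head p ps = P.cong (λ c → if c then [] else p ∷ before p ps) (≡ᵇ-refl p)

  before-cons : ∀ p' p ps → (p' ≡ᵇ p) ≡ false → before p' (p ∷ ps) ≡ p ∷ before p' ps
  before-cons p' p ps e = P.cong (λ c → if c then [] else p ∷ before p' ps) (P.trans (≡ᵇ-sym p p') e)

  ∨-cases : ∀ {a b : Bool} → (a ∨ b) ≡ true → a ≡ true ⊎ b ≡ true
  ∨-cases {true} e = inj₁ P.refl
  ∨-cases {false} e = inj₂ e

  ∨-inl : ∀ {a} b → a ≡ true → (a ∨ b) ≡ true
  ∨-inl b P.refl = P.refl

  ∨-inr : ∀ a {b} → b ≡ true → (a ∨ b) ≡ true
  ∨-inr true e = P.refl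
  ∨-inr false e = e

  <ᵇ-sound : ∀ m n → (m <ᵇ n) ≡ true → m < n
  <ᵇ-sound m n e = <ᵇ⇒< m n (P.subst IsTrue (P.sym e) tt)

  ≤ᵇ-true : ∀ {m n} → m ≤ n → (m ≤ᵇ n) ≡ true
  ≤ᵇ-true le = T→≡ (≤⇒≤ᵇ le)

  <ᵇ-true : ∀ {m n} → m < n → (m <ᵇ n) ≡ true
  <ᵇ-true le = T→≡ (<⇒<ᵇ le)

  ≤ᵇ-false : ∀ {m n} → n < m → (m ≤ᵇ n) ≡ false
  ≤ᵇ-false {suc m} {zero} _ = P.refl
  ≤ᵇ-false {suc (suc m)} {suc n} (s≤s le) = ≤ᵇ-false {suc m} {n} le

  filter-none : ∀ {A : Set} (Q : A → Bool) xs → All (λ x → Q x ≡ false) xs → filterᵇ Q xs ≡ []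
  filter-none Q [] [] = P.refl
  filter-none Q (x ∷ xs) (e ∷ es) rewrite e = filter-none Q xs es

  ∧-split : ∀ {x y} → (x ∧ y) ≡ true → x ≡ true × y ≡ true
  ∧-split {true} {true} _ = P.refl , P.refl

  allᵇ→All : ∀ {A : Set} (Q : A → Bool) xs → allᵇ Q xs ≡ true → All (λ x → Q x ≡ true) xs
  allᵇ→All Q [] e = []
  allᵇ→All Q (x ∷ xs) e = proj₁ (∧-split e) ∷ allᵇ→All Q xs (proj₂ (∧-split e))

  cong3 : ∀ {A B C D : Set} (h : A → B → C → D) {x x' y y' z z'} → x ≡ x' → y ≡ y' → z ≡ z' → h x y z ≡ h x' y' z'
  cong3 h P.refl P.refl P.refl = P.refl

  allᵇ-map : ∀ {A B : Set} (Q : B → Bool) (h : A → B) xs → allᵇ Q (map h xs) ≡ allᵇ (λ x → Q (h x)) xs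
  allᵇ-map Q h [] = P.refl
  allᵇ-map Q h (x ∷ xs) = P.cong (Q (h x) ∧_) (allᵇ-map Q h xs)

  allᵇ-∧ : ∀ {A : Set} (Q Q' : A → Bool) xs → allᵇ (λ x → Q x ∧ Q' x) xs ≡ allᵇ Q xs ∧ allᵇ Q' xs
  allᵇ-∧ Q Q' [] = P.refl
  allᵇ-∧ Q Q' (x ∷ xs) rewrite allᵇ-∧ Q Q' xs with Q x | Q' x
  ... | true | true = P.refl
  ... | true | false = P.sym (∧-zeroʳ (allᵇ Q xs))
  ... | false | _ = P.refl

  ∧-interchange : ∀ s v A B → ((s ∧ v) ∧ (A ∧ B)) ≡ ((s ∧ A) ∧ (v ∧ B))
  ∧-interchange true true A B = P.refl
  ∧-interchange true false A B = P.sym (∧-zeroʳ A)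
  ∧-interchange false v A B = P.refl

  sum-zeros : ∀ (h : ℕ → ℕ) xs → All (λ x → h x ≡ 0) xs → sum (map h xs) ≡ 0
  sum-zeros h [] [] = P.refl
  sum-zeros h (x ∷ xs) (e ∷ es) rewrite e = sum-zeros h xs es

  map-const : ∀ {A B : Set} (k : B) (xs : List A) → map (λ _ → k) xs ≡ replicate (length xs) k
  map-const k [] = P.refl
  map-const k (x ∷ xs) = P.cong (k ∷_) (map-const k xs)

  count-map : ∀ {A B : Set} (Q : B → Bool) (h : A → B) xs → countᵇ Q (map h xs) ≡ countᵇ (λ x → Q (h x)) xs
  count-map Q h [] = P.refl
  count-map Q h (x ∷ xs) with Q (h x)
  ... | true = P.cong suc (count-map Q h xs)
  ... | false = count-map Q h xs

  count-↭ : ∀ {A : Set} (Q : A → Bool) {xs ys} → xs ↭ ys → countᵇ Q xs ≡ countᵇ Q ys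
  count-↭ Q {xs} {ys} p = P.trans (count≡sum Q xs) (P.trans (sum-↭ (map⁺ (λ x → bit (Q x)) p)) (P.sym (count≡sum Q ys)))

  ∈-up : ∀ n p → 1 ≤ p → p ≤ n → p ∈ up n
  ∈-up zero (suc p) a ()
  ∈-up (suc n) p a b with p ≟ suc n
  ... | yes P.refl = ∈-++⁺ʳ (up n) (here P.refl)
  ... | no ne = ∈-++⁺ˡ (∈-up n p a (ℕₚ.≤-pred (ℕₚ.≤∧≢⇒< b ne)))

  ∈-filter : ∀ {A : Set} (Q : A → Bool) {x} xs → x ∈ xs → Q x ≡ true → x ∈ filterᵇ Q xs
  ∈-filter Q (x ∷ xs) (here P.refl) e rewrite e = here P.refl
  ∈-filter Q (x' ∷ xs) (there m) e with Q x'
  ... | true = there (∈-filter Q xs m e)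
  ... | false = ∈-filter Q xs m e

  filter-map : ∀ {A B : Set} (Q : B → Bool) (h : A → B) xs → filterᵇ Q (map h xs) ≡ map h (filterᵇ (λ x → Q (h x)) xs)
  filter-map Q h [] = P.refl
  filter-map Q h (x ∷ xs) with Q (h x)
  ... | true = P.cong (h x ∷_) (filter-map Q h xs)
  ... | false = filter-map Q h xs

  up-suc : ∀ m → up (suc m) ≡ 1 ∷ map suc (up m)
  up-suc zero = P.refl
  up-suc (suc m) = P.trans (P.cong (_∷ʳ suc (suc m)) (up-suc m)) (P.cong (1 ∷_) (P.sym (map-++ suc (up m) (suc m ∷ []))))

  before-snoc : ∀ N xs → All (λ j → (j ≡ᵇ N) ≡ false) xs → before N (xs ∷ʳ N) ≡ xs
  before-snoc N [] [] = P.cong (λ c → if c then [] else N ∷ before N []) (≡ᵇ-refl N)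
  before-snoc N (x ∷ xs) (e ∷ es) = P.trans (P.cong (λ c → if c then [] else x ∷ before N (xs ∷ʳ N)) e) (P.cong (x ∷_) (before-snoc N xs es))

module Recurrences where

  open CellAutomaton
  open ListFacts

  module MatrixFacts (R : CommutativeSemiring 0ℓ 0ℓ) (q a b g d : CommutativeSemiring.Carrier R) where
    open CommutativeSemiring R
    open Weights R q a b g d
    open import Relation.Binary.Reasoning.Setoid setoid
    open import Algebra.Solver.Ring.NaturalCoefficients.Default R

    guard-inactive : ∀ (c : Bool) (X : Carrier) → (c ≡ true → X ≈ 0#) → (if c then 0# else X) ≈ X
    guard-inactive true X h = sym (h P.refl)
    guard-inactive false X h = refl

    0+0≈0 : 0# + 0# ≈ 0#
    0+0≈0 = solve 0 (con 0 :+ con 0 := con 0) refl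
    ≡⇒≈ : ∀ {x y} → x ≡ y → x ≈ y
    ≡⇒≈ P.refl = refl
    scaled-sum-zero : ∀ {x y} (c : Carrier) → x ≈ 0# → y ≈ 0# → c * x + y ≈ 0#
    scaled-sum-zero {x} {y} c e₁ e₂ = trans (+-cong (*-cong refl e₁) e₂) (solve 1 (λ d → d :* con 0 :+ con 0 := con 0) refl c)

    D-outside : ∀ t i j k ℓ → ((j <ᵇ i) ∨ (suc k <ᵇ ℓ)) ≡ true → Dm t i j k ℓ ≡ 0#
    D-outside t i j k ℓ e = P.cong (λ c → if c then 0# else Dm' t i j k ℓ) e
    E-outside : ∀ t i j k ℓ → ((j <ᵇ i) ∨ (suc k <ᵇ ℓ)) ≡ true → Em t i j k ℓ ≡ 0#
    E-outside t i j k ℓ e = P.cong (λ c → if c then 0# else Em' t i j k ℓ) e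

    outside-j : ∀ i j k ℓ → ((suc j <ᵇ i) ∨ (suc (suc k) <ᵇ ℓ)) ≡ true → ((j <ᵇ i) ∨ (suc k <ᵇ ℓ)) ≡ true
    outside-j i j k ℓ e with ∨-cases {suc j <ᵇ i} e
    ... | inj₁ x = ∨-inl (suc k <ᵇ ℓ) (<ᵇ-true (<-trans (n<1+n _) (<ᵇ-sound (suc j) i x)))
    ... | inj₂ y = ∨-inr (j <ᵇ i) (<ᵇ-true (<-trans (n<1+n _) (<ᵇ-sound (suc (suc k)) ℓ y)))
    outside-k : ∀ i j k ℓ → ((j <ᵇ i) ∨ (suc (suc k) <ᵇ ℓ)) ≡ true → ((j <ᵇ i) ∨ (suc k <ᵇ ℓ)) ≡ true
    outside-k i j k ℓ e with ∨-cases {j <ᵇ i} e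
    ... | inj₁ x = ∨-inl (suc k <ᵇ ℓ) x
    ... | inj₂ y = ∨-inr (j <ᵇ i) (<ᵇ-true (<-trans (n<1+n _) (<ᵇ-sound (suc (suc k)) ℓ y)))
    outside-ℓ : ∀ i j k ℓ → ((j <ᵇ i) ∨ (suc (suc k) <ᵇ suc ℓ)) ≡ true → ((j <ᵇ i) ∨ (suc k <ᵇ ℓ)) ≡ true
    outside-ℓ i j k ℓ e with ∨-cases {j <ᵇ i} e
    ... | inj₁ x = ∨-inl (suc k <ᵇ ℓ) x
    ... | inj₂ y = ∨-inr (j <ᵇ i) y

    -- The defining recurrences of D and E hold unconditionally in k: outside the
    -- support both sides vanish.
    D-recurrence : ∀ t i j k ℓ → Dm t i j (suc k) ℓ ≈ d * DEj t i j k ℓ + Dℓ t i j k ℓ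
    D-recurrence t i j k ℓ = guard-inactive ((j <ᵇ i) ∨ (suc (suc k) <ᵇ ℓ)) _ h
      where
      h : _ → d * DEj t i j k ℓ + Dℓ t i j k ℓ ≈ 0#
      h e = scaled-sum-zero d (h1 j e) (h2 ℓ e)
        where
        h1 : ∀ j → ((j <ᵇ i) ∨ (suc (suc k) <ᵇ ℓ)) ≡ true → DEj t i j k ℓ ≈ 0#
        h1 zero e = refl
        h1 (suc j) e = trans (+-cong (≡⇒≈ (D-outside t i j k ℓ (outside-j i j k ℓ e))) (≡⇒≈ (E-outside t i j k ℓ (outside-j i j k ℓ e)))) 0+0≈0
        h2 : ∀ ℓ → ((j <ᵇ i) ∨ (suc (suc k) <ᵇ ℓ)) ≡ true → Dℓ t i j k ℓ ≈ 0#
        h2 zero e = refl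
        h2 (suc ℓ) e = ≡⇒≈ (D-outside t i j k ℓ (outside-ℓ i j k ℓ e))

    E-recurrence : ∀ t i j k ℓ → Em t i j (suc k) ℓ ≈ b * (Dm t i j k ℓ + Em t i j k ℓ) + q * Eℓ t i j k ℓ
    E-recurrence t i j k ℓ = guard-inactive ((j <ᵇ i) ∨ (suc (suc k) <ᵇ ℓ)) _ h
      where
      h : _ → b * (Dm t i j k ℓ + Em t i j k ℓ) + q * Eℓ t i j k ℓ ≈ 0#
      h e = scaled-sum-zero b (trans (+-cong (≡⇒≈ (D-outside t i j k ℓ (outside-k i j k ℓ e))) (≡⇒≈ (E-outside t i j k ℓ (outside-k i j k ℓ e)))) 0+0≈0) (h2 ℓ e)
        where
        h2 : ∀ ℓ → ((j <ᵇ i) ∨ (suc (suc k) <ᵇ ℓ)) ≡ true → q * Eℓ t i j k ℓ ≈ 0#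
        h2 zero e = zeroʳ q
        h2 (suc ℓ) e = trans (*-cong refl (≡⇒≈ (E-outside t i j k ℓ (outside-ℓ i j k ℓ e)))) (zeroʳ q)

    guard-scale : ∀ (c : Bool) (r X Y : Carrier) → X ≈ r * Y → (if c then 0# else X) ≈ r * (if c then 0# else Y)
    guard-scale true r X Y h = sym (zeroʳ r)
    guard-scale false r X Y h = h

    cases-scale : ∀ (c1 c2 : Bool) (r A A' B B' : Carrier) → A' ≈ r * A → B' ≈ r * B →
           (if c1 then A' else if c2 then B' else 0#) ≈ r * (if c1 then A else if c2 then B else 0#)
    cases-scale true c2 r A A' B B' h1 h2 = h1
    cases-scale false true r A A' B B' h1 h2 = h2
    cases-scale false false r A A' B B' h1 h2 = sym (zeroʳ r)

    mutual

      -- Increasing both δ-counts i and j multiplies D and E by q: every entry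
      -- carries the factor q^i.
      D-shift : ∀ t i j k ℓ → Dm t (suc i) (suc j) k ℓ ≈ q * Dm t i j k ℓ
      D-shift t i j zero ℓ = guard-scale ((j <ᵇ i) ∨ (1 <ᵇ ℓ)) q _ _
        (cases-scale ((ℓ ≡ᵇ 1) ∧ (i ≡ᵇ j)) ((ℓ ≡ᵇ 0) ∧ (j ≡ᵇ suc i)) q _ _ _ _
          (solve 3 (λ a q x → a :* (q :* x) := q :* (a :* x)) refl a q (pow q i))
          (solve 4 (λ d q x y → d :* ((q :* x) :* y) := q :* (d :* (x :* y))) refl d q (pow q i) (pow q t + (a + g * pow q t) * qint t)))
      D-shift t i j (suc k) ℓ = guard-scale ((j <ᵇ i) ∨ (suc (suc k) <ᵇ ℓ)) q _ _
        (trans (+-cong (*-cong refl (DE-shift t i j k ℓ)) (Dℓ-shift t i j k ℓ))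
          (solve 4 (λ q d x y → d :* (q :* x) :+ q :* y := q :* (d :* x :+ y)) refl q d (DEj t i j k ℓ) (Dℓ t i j k ℓ)))

      DE-shift : ∀ t i j k ℓ → DEj t (suc i) (suc j) k ℓ ≈ q * DEj t i j k ℓ
      DE-shift t i zero k ℓ = trans 0+0≈0 (sym (zeroʳ q))
      DE-shift t i (suc j) k ℓ = trans (+-cong (D-shift t i j k ℓ) (E-shift t i j k ℓ)) (sym (distribˡ q _ _))

      Dℓ-shift : ∀ t i j k ℓ → Dℓ t (suc i) (suc j) k ℓ ≈ q * Dℓ t i j k ℓ
      Dℓ-shift t i j k zero = sym (zeroʳ q)
      Dℓ-shift t i j k (suc ℓ) = D-shift t i j k ℓ

      E-shift : ∀ t i j k ℓ → Em t (suc i) (suc j) k ℓ ≈ q * Em t i j k ℓ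
      E-shift t i j zero ℓ = guard-scale ((j <ᵇ i) ∨ (1 <ᵇ ℓ)) q _ _
        (cases-scale ((ℓ ≡ᵇ 1) ∧ (i ≡ᵇ j)) ((ℓ ≡ᵇ 0) ∧ (i ≡ᵇ j)) q _ _ _ _
          (trans (*-cong refl (≡⇒≈ (P.cong (pow q) (+-suc (t +ℕ t) i))))
            (solve 3 (λ g q x → g :* (q :* x) := q :* (g :* x)) refl g q (pow q (t +ℕ t +ℕ i))))
          (solve 4 (λ d q x y → d :* ((q :* x) :* y) := q :* (d :* (x :* y))) refl b q (pow q i) (pow q t + (a + g * pow q t) * qint t)))
      E-shift t i j (suc k) ℓ = guard-scale ((j <ᵇ i) ∨ (suc (suc k) <ᵇ ℓ)) q _ _
        (trans (+-cong (*-cong refl (+-cong (D-shift t i j k ℓ) (E-shift t i j k ℓ))) (*-cong refl (Eℓ-shift t i j k ℓ)))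
          (solve 5 (λ q b x y z → b :* (q :* x :+ q :* y) :+ q :* (q :* z) := q :* (b :* (x :+ y) :+ q :* z)) refl q b (Dm t i j k ℓ) (Em t i j k ℓ) (Eℓ t i j k ℓ)))

      Eℓ-shift : ∀ t i j k ℓ → Eℓ t (suc i) (suc j) k ℓ ≈ q * Eℓ t i j k ℓ
      Eℓ-shift t i j k zero = sym (zeroʳ q)
      Eℓ-shift t i j k (suc ℓ) = E-shift t i j k ℓ

    A-outside : ∀ i j k ℓ → ((k <ᵇ ℓ) ∨ (i +ℕ k <ᵇ j +ℕ ℓ)) ≡ true → Am i j k ℓ ≈ 0#
    A-outside i j k ℓ e = ifz0 _ _ e
      where
      ifz0 : ∀ (c : Bool) X → c ≡ true → (if c then 0# else X) ≈ 0#
      ifz0 c X P.refl = refl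

    guard-zero : ∀ (c : Bool) X → X ≈ 0# → (if c then 0# else X) ≈ 0#
    guard-zero true X h = refl
    guard-zero false X h = h

    A-row0 : ∀ i k ℓ → Am (suc i) 0 k ℓ ≈ 0#
    A-row0 i zero ℓ = guard-zero ((0 <ᵇ ℓ) ∨ (suc i +ℕ 0 <ᵇ 0 +ℕ ℓ)) _ refl
    A-row0 i (suc k) ℓ = guard-zero ((suc k <ᵇ ℓ) ∨ (suc i +ℕ suc k <ᵇ 0 +ℕ ℓ)) _
      (trans (+-cong (+-cong (trans (*-cong refl (A-row0 i k ℓ)) (zeroʳ b)) (zeroʳ (d * q))) (h ℓ))
        (solve 0 (con 0 :+ con 0 :+ con 0 := con 0) refl))
      where
      h : ∀ ℓ → q * pred0 (λ ℓ' → Am (suc i) 0 k ℓ') ℓ ≈ 0#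
      h zero = zeroʳ q
      h (suc ℓ) = trans (*-cong refl (A-row0 i k ℓ)) (zeroʳ q)

    -- Increasing i and j multiplies A by q² (its entries carry q^{2i}).
    A-shift : ∀ i j k ℓ → Am (suc i) (suc j) k ℓ ≈ q * q * Am i j k ℓ
    A-shift i j zero ℓ = guard-scale ((0 <ᵇ ℓ) ∨ (i +ℕ 0 <ᵇ j +ℕ ℓ)) (q * q) _ _ (h ((i ≡ᵇ j) ∧ (ℓ ≡ᵇ 0)))
      where
      h : ∀ c → (if c then pow q (suc i +ℕ suc i) else 0#) ≈ q * q * (if c then pow q (i +ℕ i) else 0#)
      h true = trans (*-cong refl (≡⇒≈ (P.cong (pow q) (+-suc i i))))
        (solve 2 (λ q x → q :* (q :* x) := q :* q :* x) refl q (pow q (i +ℕ i)))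
      h false = sym (zeroʳ _)
    A-shift i j (suc k) ℓ = guard-scale ((suc k <ᵇ ℓ) ∨ (i +ℕ suc k <ᵇ j +ℕ ℓ)) (q * q) _ _
      (trans (+-cong (+-cong (*-cong refl (A-shift i j k ℓ)) (*-cong refl (hj j))) (*-cong refl (hl ℓ)))
        (solve 6 (λ q b d x y z → b :* (q :* q :* x) :+ d :* q :* (q :* q :* y) :+ q :* (q :* q :* z)
                   := q :* q :* (b :* x :+ d :* q :* y :+ q :* z)) refl q b d
           (Am i j k ℓ) (pred0 (λ j' → Am i j' k ℓ) j) (pred0 (λ ℓ' → Am i j k ℓ') ℓ)))
      where
      hj : ∀ j → pred0 (λ j' → Am (suc i) j' k ℓ) (suc j) ≈ q * q * pred0 (λ j' → Am i j' k ℓ) j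
      hj zero = trans (A-row0 i k ℓ) (sym (zeroʳ _))
      hj (suc j) = A-shift i j k ℓ
      hl : ∀ ℓ → pred0 (λ ℓ' → Am (suc i) (suc j) k ℓ') ℓ ≈ q * q * pred0 (λ ℓ' → Am i j k ℓ') ℓ
      hl zero = sym (zeroʳ _)
      hl (suc ℓ) = A-shift i j k ℓ

    A-recurrence : ∀ i j k ℓ → Am i j (suc k) ℓ ≈ b * Am i j k ℓ + d * q * pred0 (λ j' → Am i j' k ℓ) j + q * pred0 (λ ℓ' → Am i j k ℓ') ℓ
    A-recurrence i j k ℓ = guard-inactive ((suc k <ᵇ ℓ) ∨ (i +ℕ suc k <ᵇ j +ℕ ℓ)) _ h
      where
      h : _ → b * Am i j k ℓ + d * q * pred0 (λ j' → Am i j' k ℓ) j + q * pred0 (λ ℓ' → Am i j k ℓ') ℓ ≈ 0#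
      h e = trans (+-cong (+-cong (trans (*-cong refl (A-outside i j k ℓ g0)) (zeroʳ b)) (trans (*-cong refl (hj j e)) (zeroʳ _)))
                  (trans (*-cong refl (hl ℓ e)) (zeroʳ _)))
              (solve 0 (con 0 :+ con 0 :+ con 0 := con 0) refl)
        where
        g0 : ((k <ᵇ ℓ) ∨ (i +ℕ k <ᵇ j +ℕ ℓ)) ≡ true
        g0 with ∨-cases {suc k <ᵇ ℓ} e
        ... | inj₁ x = ∨-inl _ (<ᵇ-true (<-trans (n<1+n _) (<ᵇ-sound (suc k) ℓ x)))
        ... | inj₂ y = ∨-inr (k <ᵇ ℓ) (<ᵇ-true (<-trans (n<1+n _) (P.subst (_< j +ℕ ℓ) (+-suc i k) (<ᵇ-sound (i +ℕ suc k) (j +ℕ ℓ) y))))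
        hj : ∀ j → ((suc k <ᵇ ℓ) ∨ (i +ℕ suc k <ᵇ j +ℕ ℓ)) ≡ true → pred0 (λ j' → Am i j' k ℓ) j ≈ 0#
        hj zero e = refl
        hj (suc j) e with ∨-cases {suc k <ᵇ ℓ} e
        ... | inj₁ x = A-outside i j k ℓ (∨-inl _ (<ᵇ-true (<-trans (n<1+n _) (<ᵇ-sound (suc k) ℓ x))))
        ... | inj₂ y = A-outside i j k ℓ (∨-inr (k <ᵇ ℓ) (<ᵇ-true (≤-pred (P.subst (_< suc j +ℕ ℓ) (+-suc i k) (<ᵇ-sound (i +ℕ suc k) (suc j +ℕ ℓ) y)))))
        hl : ∀ ℓ → ((suc k <ᵇ ℓ) ∨ (i +ℕ suc k <ᵇ j +ℕ ℓ)) ≡ true → pred0 (λ ℓ' → Am i j k ℓ') ℓ ≈ 0#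
        hl zero e = refl
        hl (suc ℓ) e with ∨-cases {suc k <ᵇ suc ℓ} e
        ... | inj₁ x = A-outside i j k ℓ (∨-inl _ x)
        ... | inj₂ y = A-outside i j k ℓ (∨-inr (k <ᵇ ℓ) (<ᵇ-true (≤-pred (P.subst₂ _<_ (+-suc i k) (+-suc j ℓ) (<ᵇ-sound (i +ℕ suc k) (j +ℕ suc ℓ) y)))))

  module Generating (R : CommutativeSemiring 0ℓ 0ℓ) (q a b g d : CommutativeSemiring.Carrier R) where
    open CommutativeSemiring R
    open Weights R q a b g d
    open MatrixFacts R q a b g d public
    open import Relation.Binary.Reasoning.Setoid setoid
    open import Algebra.Solver.Ring.NaturalCoefficients.Default R

    squareSeeing : Label → Label → Carrier
    squareSeeing β _ = 1#
    squareSeeing δ _ = q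
    squareSeeing α bl = if isAD bl then 1# else if isBG bl then q else 1#
    squareSeeing γ bl = if isAD bl then 1# else if isBG bl then q else 1#
    squareSeeing empty _ = 1#

    tallSeeing : Label → Carrier
    tallSeeing β = 1#
    tallSeeing δ = q * q
    tallSeeing α = q
    tallSeeing γ = q
    tallSeeing empty = 1#

    shortSeeing : Label → Carrier
    shortSeeing α = 1#
    shortSeeing γ = q * q
    shortSeeing β = q
    shortSeeing δ = q
    shortSeeing empty = 1#

    tileWeightOf : Bool → Bool → Label → Label → Label → Carrier
    tileWeightOf true _ empty r bl = squareSeeing r bl
    tileWeightOf true _ α r bl = letter α
    tileWeightOf true _ β r bl = letter β
    tileWeightOf true _ γ r bl = letter γ
    tileWeightOf true _ δ r bl = letter δ
    tileWeightOf false true empty r bl = tallSeeing r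
    tileWeightOf false true β r bl = b
    tileWeightOf false true δ r bl = d * q
    tileWeightOf false true α r bl = letter α
    tileWeightOf false true γ r bl = letter γ
    tileWeightOf false false empty r bl = shortSeeing bl
    tileWeightOf false false α r bl = a
    tileWeightOf false false γ r bl = g * q
    tileWeightOf false false β r bl = letter β
    tileWeightOf false false δ r bl = letter δ

    -- Weight of a new tile of the given kind, labelled l, seeing x below; what
    -- it sees to the right is recorded in the kind.
    cellWeight : Kind → Label → Label → Carrier
    cellWeight (corner _) x l = tileWeightOf true false l empty empty
    cellWeight (square s) x l = tileWeightOf true false l s x
    cellWeight shortRh x l = tileWeightOf false false l empty x
    cellWeight (tallRh s) x l = tileWeightOf false true l s x
    cellWeight noTile x l = 1#

    Σℓ : (Label → Carrier) → Carrier
    Σℓ h = h empty + (h α + (h β + (h γ + (h δ + 0#))))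

    -- `shiftIdx D A G j ℓ = G (j ∸ D) (ℓ ∸ A)`, and 0 if that would be negative:
    -- a new δ-strip (D) or α/γ-strip (A) shifts the target counts.
    shiftIdx : Bool → Bool → (ℕ → ℕ → Carrier) → ℕ → ℕ → Carrier
    shiftIdx false false G j ℓ = G j ℓ
    shiftIdx false true G j zero = 0#
    shiftIdx false true G j (suc ℓ) = G j ℓ
    shiftIdx true false G zero ℓ = 0#
    shiftIdx true false G (suc j) ℓ = G j ℓ
    shiftIdx true true G zero ℓ = 0#
    shiftIdx true true G (suc j) zero = 0#
    shiftIdx true true G (suc j) (suc ℓ) = G j ℓ

    origin : ℕ → ℕ → Carrier
    origin zero zero = 1#
    origin _ _ = 0#

    -- Generating function of all labellings of a list of tiles (bottom to top),
    -- starting from the label x seen below, by number of δ-strips j and α/γ-strips ℓ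
    -- among their rows.
    cellsGF : Label → List Kind → ℕ → ℕ → Carrier
    cellsGF x [] j ℓ = origin j ℓ
    cellsGF x (k ∷ ks) j ℓ = Σℓ (λ l → if cellOK k x l then cellWeight k x l * shiftIdx (δStrip k l) (agStrip k l) (cellsGF (latest x l) ks) j ℓ else 0#)

    shiftIdx-cong : ∀ b1 b2 {G H : ℕ → ℕ → Carrier} → (∀ j ℓ → G j ℓ ≈ H j ℓ) → ∀ j ℓ → shiftIdx b1 b2 G j ℓ ≈ shiftIdx b1 b2 H j ℓ
    shiftIdx-cong false false e j ℓ = e j ℓ
    shiftIdx-cong false true e j zero = refl
    shiftIdx-cong false true e j (suc ℓ) = e j ℓ
    shiftIdx-cong true false e zero ℓ = refl
    shiftIdx-cong true false e (suc j) ℓ = e j ℓ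
    shiftIdx-cong true true e zero ℓ = refl
    shiftIdx-cong true true e (suc j) zero = refl
    shiftIdx-cong true true e (suc j) (suc ℓ) = e j ℓ

    drop-zeros : ∀ X → 1# * X + (0# + (0# + (0# + (0# + 0#)))) ≈ X
    drop-zeros = solve 1 (λ X → con 1 :* X :+ (con 0 :+ (con 0 :+ (con 0 :+ (con 0 :+ con 0)))) := X) refl

    GF-noTile : ∀ x ks j ℓ → cellsGF x (noTile ∷ ks) j ℓ ≈ cellsGF x ks j ℓ
    GF-noTile x ks j ℓ = drop-zeros _

    -- A square whose strip ends in β or δ must stay empty: the strip keeps its
    -- last label (so a δ-strip is counted) and the square has weight 1 resp. q.
    GF-square-β : ∀ x → isEmpty x ≡ false → ∀ ks j ℓ → cellsGF x (square β ∷ ks) j ℓ ≈ cellsGF x ks j ℓ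
    GF-square-β α _ ks j ℓ = drop-zeros _
    GF-square-β β _ ks j ℓ = drop-zeros _
    GF-square-β γ _ ks j ℓ = drop-zeros _
    GF-square-β δ _ ks j ℓ = drop-zeros _

    drop-zeros-scaled : ∀ r X → r * X + (0# + (0# + (0# + (0# + 0#)))) ≈ r * X
    drop-zeros-scaled = solve 2 (λ r X → r :* X :+ (con 0 :+ (con 0 :+ (con 0 :+ (con 0 :+ con 0)))) := r :* X) refl

    GF-square-δ : ∀ x → isEmpty x ≡ false → ∀ ks j ℓ → cellsGF x (square δ ∷ ks) j ℓ ≈ q * shiftIdx true false (cellsGF x ks) j ℓ
    GF-square-δ α _ ks j ℓ = drop-zeros-scaled _ _
    GF-square-δ β _ ks j ℓ = drop-zeros-scaled _ _
    GF-square-δ γ _ ks j ℓ = drop-zeros-scaled _ _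
    GF-square-δ δ _ ks j ℓ = drop-zeros-scaled _ _

    -- A square whose strip ends in α/γ, above an α or γ in its vertical strip,
    -- must be empty; it has weight 1 above α and q above γ.
    GF-squareAG-α : ∀ s → isAG s ≡ true → ∀ ks j ℓ → cellsGF α (square s ∷ ks) j ℓ ≈ shiftIdx false true (cellsGF α ks) j ℓ
    GF-squareAG-α α _ ks j ℓ = drop-zeros _
    GF-squareAG-α γ _ ks j ℓ = drop-zeros _

    GF-squareAG-γ : ∀ s → isAG s ≡ true → ∀ ks j ℓ → cellsGF γ (square s ∷ ks) j ℓ ≈ q * shiftIdx false true (cellsGF γ ks) j ℓ
    GF-squareAG-γ α _ ks j ℓ = drop-zeros-scaled _ _
    GF-squareAG-γ γ _ ks j ℓ = drop-zeros-scaled _ _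

    drop-zeros-square : ∀ w a' b' g' d' A B C D' E → w * A + (a' * B + (b' * C + (g' * D' + (d' * E + 0#)))) ≈ w * A + (a' * B + (b' * C + (g' * D' + d' * E)))
    drop-zeros-square = solve 10 (λ w a' b' g' d' A B C D' E → w :* A :+ (a' :* B :+ (b' :* C :+ (g' :* D' :+ (d' :* E :+ con 0))))
                     := w :* A :+ (a' :* B :+ (b' :* C :+ (g' :* D' :+ d' :* E)))) refl

    -- A square whose strip ends in α/γ, above β/δ (or nothing), may carry any
    -- label, which then becomes the strip's last label.
    GF-squareAG-δ : ∀ s → isAG s ≡ true → ∀ ks j ℓ → cellsGF δ (square s ∷ ks) j ℓ ≈
             1# * shiftIdx false true (cellsGF δ ks) j ℓ + (a * shiftIdx false true (cellsGF α ks) j ℓ + (b * cellsGF β ks j ℓ + (g * shiftIdx false true (cellsGF γ ks) j ℓ + d * shiftIdx true false (cellsGF δ ks) j ℓ)))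
    GF-squareAG-δ α _ ks j ℓ = drop-zeros-square _ _ _ _ _ _ _ _ _ _
    GF-squareAG-δ γ _ ks j ℓ = drop-zeros-square _ _ _ _ _ _ _ _ _ _

    GF-squareAG-β : ∀ s → isAG s ≡ true → ∀ ks j ℓ → cellsGF β (square s ∷ ks) j ℓ ≈
             q * shiftIdx false true (cellsGF β ks) j ℓ + (a * shiftIdx false true (cellsGF α ks) j ℓ + (b * cellsGF β ks j ℓ + (g * shiftIdx false true (cellsGF γ ks) j ℓ + d * shiftIdx true false (cellsGF δ ks) j ℓ)))
    GF-squareAG-β α _ ks j ℓ = drop-zeros-square _ _ _ _ _ _ _ _ _ _
    GF-squareAG-β γ _ ks j ℓ = drop-zeros-square _ _ _ _ _ _ _ _ _ _

    -- One short rhombus, above each possible label seen below: it may carry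
    -- α or γq, unless an α or γ is below it.
    GF-short-α : ∀ ks j ℓ → cellsGF α (shortRh ∷ ks) j ℓ ≈ cellsGF α ks j ℓ
    GF-short-α ks j ℓ = drop-zeros _
    GF-short-γ : ∀ ks j ℓ → cellsGF γ (shortRh ∷ ks) j ℓ ≈ q * q * cellsGF γ ks j ℓ
    GF-short-γ ks j ℓ = drop-zeros-scaled _ _
    drop-zeros-short : ∀ w A a' B g' C → w * A + (a' * B + (0# + (g' * C + (0# + 0#)))) ≈ w * A + (a' * B + g' * C)
    drop-zeros-short = solve 6 (λ w A a' B g' C → w :* A :+ (a' :* B :+ (con 0 :+ (g' :* C :+ (con 0 :+ con 0)))) := w :* A :+ (a' :* B :+ g' :* C)) refl
    GF-short-δ : ∀ ks j ℓ → cellsGF δ (shortRh ∷ ks) j ℓ ≈ q * cellsGF δ ks j ℓ + (a * cellsGF α ks j ℓ + g * q * cellsGF γ ks j ℓ)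
    GF-short-δ ks j ℓ = drop-zeros-short _ _ _ _ _ _
    GF-short-β : ∀ ks j ℓ → cellsGF β (shortRh ∷ ks) j ℓ ≈ q * cellsGF β ks j ℓ + (a * cellsGF α ks j ℓ + g * q * cellsGF γ ks j ℓ)
    GF-short-β ks j ℓ = drop-zeros-short _ _ _ _ _ _

    shorts : ℕ → List Kind
    shorts t = replicate t shortRh

    qint-step : ∀ t → qint t + pow q t ≈ q * qint t + 1#
    qint-step zero = solve 1 (λ q → con 0 :+ con 1 := q :* con 0 :+ con 1) refl q
    qint-step (suc t) = begin
      qint t + pow q t + q * pow q t  ≈⟨ +-cong (qint-step t) refl ⟩
      q * qint t + 1# + q * pow q t   ≈⟨ solve 3 (λ q Q P → q :* Q :+ con 1 :+ q :* P := q :* (Q :+ P) :+ con 1) refl q (qint t) (pow q t) ⟩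
      q * (qint t + pow q t) + 1# ∎

    pow-+ : ∀ m n → pow q (m +ℕ n) ≈ pow q m * pow q n
    pow-+ zero n = sym (*-identityˡ _)
    pow-+ (suc m) n = trans (*-cong refl (pow-+ m n)) (sym (*-assoc _ _ _))

    -- The factor q^t + (α + γq^t)[t]_q of the base case of D and E: the weight
    -- of the t short rhombi above a β or δ in the lowest square.
    rhombusSum : ℕ → Carrier
    rhombusSum t = pow q t + (a + g * pow q t) * qint t

    rhombusSum-step : ∀ t → rhombusSum (suc t) ≈ q * rhombusSum t + a + g * q * pow q (t +ℕ t)
    rhombusSum-step t = begin
      q * P + (a + g * (q * P)) * (Q + P)  ≈⟨ solve 5 (λ q P a g Q → q :* P :+ (a :+ g :* (q :* P)) :* (Q :+ P) := q :* P :+ a :* (Q :+ P) :+ g :* q :* P :* Q :+ g :* q :* P :* P) refl q P a g Q ⟩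
      q * P + a * (Q + P) + g * q * P * Q + g * q * P * P ≈⟨ +-cong (+-cong (+-cong refl (*-cong refl (qint-step t))) refl) refl ⟩
      q * P + a * (q * Q + 1#) + g * q * P * Q + g * q * P * P ≈⟨ solve 5 (λ q P a g Q → q :* P :+ a :* (q :* Q :+ con 1) :+ g :* q :* P :* Q :+ g :* q :* P :* P := q :* (P :+ (a :+ g :* P) :* Q) :+ a :+ g :* q :* (P :* P)) refl q P a g Q ⟩
      q * rhombusSum t + a + g * q * (P * P) ≈⟨ +-cong refl (*-cong refl (sym (pow-+ t t))) ⟩
      q * rhombusSum t + a + g * q * pow q (t +ℕ t) ∎
      where P = pow q t
            Q = qint t

    GF-shorts-α : ∀ t j ℓ → cellsGF α (shorts t) j ℓ ≈ origin j ℓ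
    GF-shorts-α zero j ℓ = refl
    GF-shorts-α (suc t) j ℓ = trans (GF-short-α (shorts t) j ℓ) (GF-shorts-α t j ℓ)

    GF-shorts-γ : ∀ t j ℓ → cellsGF γ (shorts t) j ℓ ≈ pow q (t +ℕ t) * origin j ℓ
    GF-shorts-γ zero j ℓ = sym (*-identityˡ _)
    GF-shorts-γ (suc t) j ℓ = begin
      cellsGF γ (shortRh ∷ shorts t) j ℓ ≈⟨ GF-short-γ (shorts t) j ℓ ⟩
      q * q * cellsGF γ (shorts t) j ℓ ≈⟨ *-cong refl (GF-shorts-γ t j ℓ) ⟩
      q * q * (pow q (t +ℕ t) * origin j ℓ) ≈⟨ solve 3 (λ q P I → q :* q :* (P :* I) := q :* (q :* P) :* I) refl q (pow q (t +ℕ t)) (origin j ℓ) ⟩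
      q * (q * pow q (t +ℕ t)) * origin j ℓ ≈⟨ *-cong (*-cong refl (≡⇒≈ (P.cong (pow q) (P.sym (+-suc t t))))) refl ⟩
      pow q (suc t +ℕ suc t) * origin j ℓ ∎

    GF-shorts-step : ∀ t j ℓ X → X ≈ rhombusSum t * origin j ℓ →
             q * X + (a * cellsGF α (shorts t) j ℓ + g * q * cellsGF γ (shorts t) j ℓ) ≈ rhombusSum (suc t) * origin j ℓ
    GF-shorts-step t j ℓ X h = begin
      q * X + (a * cellsGF α (shorts t) j ℓ + g * q * cellsGF γ (shorts t) j ℓ) ≈⟨ +-cong (*-cong refl h) (+-cong (*-cong refl (GF-shorts-α t j ℓ)) (*-cong refl (GF-shorts-γ t j ℓ))) ⟩
      q * (rhombusSum t * I) + (a * I + g * q * (pow q (t +ℕ t) * I)) ≈⟨ solve 6 (λ q S I a g P → q :* (S :* I) :+ (a :* I :+ g :* q :* (P :* I)) := (q :* S :+ a :+ g :* q :* P) :* I) refl q (rhombusSum t) I a g (pow q (t +ℕ t)) ⟩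
      (q * rhombusSum t + a + g * q * pow q (t +ℕ t)) * I ≈⟨ *-cong (sym (rhombusSum-step t)) refl ⟩
      rhombusSum (suc t) * I ∎
      where I = origin j ℓ

    GF-shorts-δ : ∀ t j ℓ → cellsGF δ (shorts t) j ℓ ≈ rhombusSum t * origin j ℓ
    GF-shorts-δ zero j ℓ = sym (trans (*-cong (solve 2 (λ a g → con 1 :+ (a :+ g :* con 1) :* con 0 := con 1) refl a g) refl) (*-identityˡ _))
    GF-shorts-δ (suc t) j ℓ = trans (GF-short-δ (shorts t) j ℓ) (GF-shorts-step t j ℓ _ (GF-shorts-δ t j ℓ))
    GF-shorts-β : ∀ t j ℓ → cellsGF β (shorts t) j ℓ ≈ rhombusSum t * origin j ℓ
    GF-shorts-β zero j ℓ = sym (trans (*-cong (solve 2 (λ a g → con 1 :+ (a :+ g :* con 1) :* con 0 := con 1) refl a g) refl) (*-identityˡ _))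
    GF-shorts-β (suc t) j ℓ = trans (GF-short-β (shorts t) j ℓ) (GF-shorts-step t j ℓ _ (GF-shorts-β t j ℓ))

    -- The new 02-column above its corner: one square per horizontal strip,
    -- labelled by the strip's last label, then t short rhombi.
    squaresThenShorts : List Label → ℕ → List Kind
    squaresThenShorts ss t = map square ss ++ shorts t

    -- The generating functions of new 02-columns whose corner is α/δ, resp. β/γ,
    -- after expanding the corner tile.
    Dcol : ℕ → List Label → ℕ → ℕ → Carrier
    Dcol t ss j ℓ = a * shiftIdx false true (cellsGF α (squaresThenShorts ss t)) j ℓ + d * shiftIdx true false (cellsGF δ (squaresThenShorts ss t)) j ℓ
    Ecol : ℕ → List Label → ℕ → ℕ → Carrier
    Ecol t ss j ℓ = g * shiftIdx false true (cellsGF γ (squaresThenShorts ss t)) j ℓ + b * cellsGF β (squaresThenShorts ss t) j ℓ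

    αδ-combo-zero : ∀ x y → x ≈ 0# → y ≈ 0# → a * x + d * y ≈ 0#
    αδ-combo-zero x y h1 h2 = trans (+-cong (trans (*-cong refl h1) (zeroʳ a)) (trans (*-cong refl h2) (zeroʳ d))) 0+0≈0
    γβ-combo-zero : ∀ x y → x ≈ 0# → y ≈ 0# → g * x + b * y ≈ 0#
    γβ-combo-zero x y h1 h2 = trans (+-cong (trans (*-cong refl h1) (zeroʳ g)) (trans (*-cong refl h2) (zeroʳ b))) 0+0≈0

    origin-offʲ : ∀ (X : Carrier) j ℓ → X * origin (suc j) ℓ ≈ 0#
    origin-offʲ X j ℓ = zeroʳ X
    origin-offˡ : ∀ (X : Carrier) j ℓ → X * origin j (suc ℓ) ≈ 0#
    origin-offˡ X zero ℓ = zeroʳ X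
    origin-offˡ X (suc j) ℓ = zeroʳ X

    D-base : ∀ t j ℓ → Dcol t [] j ℓ ≈ Dm t 0 j 0 ℓ
    D-base t zero zero = αδ-combo-zero _ _ refl refl
    D-base t zero (suc zero) = trans (+-cong (*-cong refl (GF-shorts-α t 0 0)) (zeroʳ d)) (+-identityʳ _)
    D-base t zero (suc (suc ℓ)) = αδ-combo-zero _ _ (GF-shorts-α t 0 (suc ℓ)) refl
    D-base t (suc zero) zero = trans (+-cong (zeroʳ a) (*-cong refl (trans (GF-shorts-δ t 0 0) (*-identityʳ _))))
                              (trans (+-identityˡ _) (*-cong refl (sym (*-identityˡ _))))
    D-base t (suc (suc j)) zero = αδ-combo-zero _ _ refl (trans (GF-shorts-δ t (suc j) 0) (origin-offʲ _ j 0))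
    D-base t (suc j) (suc zero) = αδ-combo-zero _ _ (GF-shorts-α t (suc j) 0) (trans (GF-shorts-δ t j 1) (origin-offˡ _ j 0))
    D-base t (suc j) (suc (suc ℓ)) = αδ-combo-zero _ _ (GF-shorts-α t (suc j) (suc ℓ)) (trans (GF-shorts-δ t j (suc (suc ℓ))) (origin-offˡ _ j (suc ℓ)))

    E-base : ∀ t j ℓ → Ecol t [] j ℓ ≈ Em t 0 j 0 ℓ
    E-base t zero zero = trans (+-cong (zeroʳ g) (*-cong refl (trans (GF-shorts-β t 0 0) (*-identityʳ _))))
                              (trans (+-identityˡ _) (*-cong refl (sym (*-identityˡ _))))
    E-base t zero (suc zero) = trans (+-cong (*-cong refl (trans (GF-shorts-γ t 0 0) (*-identityʳ _))) (*-cong refl (trans (GF-shorts-β t 0 1) (zeroʳ _))))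
                                (trans (+-cong refl (zeroʳ b)) (trans (+-identityʳ _) (*-cong refl (≡⇒≈ (P.cong (pow q) (P.sym (ℕₚ.+-identityʳ (t +ℕ t))))))))
    E-base t zero (suc (suc ℓ)) = γβ-combo-zero _ _ (trans (GF-shorts-γ t 0 (suc ℓ)) (origin-offˡ _ 0 ℓ)) (trans (GF-shorts-β t 0 (suc (suc ℓ))) (origin-offˡ _ 0 (suc ℓ)))
    E-base t (suc j) zero = γβ-combo-zero _ _ refl (trans (GF-shorts-β t (suc j) 0) (origin-offʲ _ j 0))
    E-base t (suc j) (suc zero) = γβ-combo-zero _ _ (trans (GF-shorts-γ t (suc j) 0) (origin-offʲ _ j 0)) (trans (GF-shorts-β t (suc j) 1) (origin-offʲ _ j 1))
    E-base t (suc j) (suc (suc ℓ)) = γβ-combo-zero _ _ (trans (GF-shorts-γ t (suc j) (suc ℓ)) (origin-offʲ _ j (suc ℓ))) (trans (GF-shorts-β t (suc j) (suc (suc ℓ))) (origin-offʲ _ j (suc (suc ℓ))))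

    -- Adding one strip (with last label s, at the bottom of the list) to a column
    -- for which Dcol and Ecol already agree with D and E: each case of s is one
    -- of the defining recurrences.
    module StripStep (t : ℕ) (ss : List Label) (i k : ℕ)
                (IHD : ∀ j ℓ → Dcol t ss j ℓ ≈ Dm t i j k ℓ)
                (IHE : ∀ j ℓ → Ecol t ss j ℓ ≈ Em t i j k ℓ) where
      ks = squaresThenShorts ss t
      Gα = cellsGF α ks
      Gβ = cellsGF β ks
      Gγ = cellsGF γ ks
      Gδ = cellsGF δ ks

      -- A β-strip: its square stays empty with weight 1, nothing changes.
      Dβ : ∀ j ℓ → Dcol t (β ∷ ss) j ℓ ≈ Dm t i j k ℓ
      Dβ j ℓ = trans (+-cong (*-cong refl (shiftIdx-cong false true (GF-square-β α P.refl ks) j ℓ)) (*-cong refl (shiftIdx-cong true false (GF-square-β δ P.refl ks) j ℓ))) (IHD j ℓ)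
      Eβ : ∀ j ℓ → Ecol t (β ∷ ss) j ℓ ≈ Em t i j k ℓ
      Eβ j ℓ = trans (+-cong (*-cong refl (shiftIdx-cong false true (GF-square-β γ P.refl ks) j ℓ)) (*-cong refl (GF-square-β β P.refl ks j ℓ))) (IHE j ℓ)

      -- A δ-strip: its square stays empty with weight q and the strip is a
      -- δ-strip before and after: this is the shift law in (i, j).
      Dδ : ∀ j ℓ → Dcol t (δ ∷ ss) j ℓ ≈ Dm t (suc i) j k ℓ
      Dδ j ℓ = trans (+-cong (*-cong refl (shiftIdx-cong false true (GF-square-δ α P.refl ks) j ℓ)) (*-cong refl (shiftIdx-cong true false (GF-square-δ δ P.refl ks) j ℓ))) (h j ℓ)
        where
        h : ∀ j ℓ → a * shiftIdx false true (λ j ℓ → q * shiftIdx true false Gα j ℓ) j ℓ + d * shiftIdx true false (λ j ℓ → q * shiftIdx true false Gδ j ℓ) j ℓ ≈ Dm t (suc i) j k ℓ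
        h zero zero = αδ-combo-zero _ _ refl refl
        h zero (suc ℓ) = αδ-combo-zero _ _ (zeroʳ q) refl
        h (suc j) zero = trans (trans (+-cong refl (*-cong refl (*-cong refl refl))) (solve 4 (λ a q d Y → a :* con 0 :+ d :* (q :* Y) := q :* (a :* con 0 :+ d :* Y)) refl a q d (shiftIdx true false Gδ j 0)))
                            (trans (*-cong refl (IHD j 0)) (sym (D-shift t i j k 0)))
        h (suc j) (suc ℓ) = trans (solve 5 (λ a q d X Y → a :* (q :* X) :+ d :* (q :* Y) := q :* (a :* X :+ d :* Y)) refl a q d (Gα j ℓ) (shiftIdx true false Gδ j (suc ℓ)))
                            (trans (*-cong refl (IHD j (suc ℓ))) (sym (D-shift t i j k (suc ℓ))))
      Eδ : ∀ j ℓ → Ecol t (δ ∷ ss) j ℓ ≈ Em t (suc i) j k ℓ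
      Eδ j ℓ = trans (+-cong (*-cong refl (shiftIdx-cong false true (GF-square-δ γ P.refl ks) j ℓ)) (*-cong refl (GF-square-δ β P.refl ks j ℓ))) (h j ℓ)
        where
        h : ∀ j ℓ → g * shiftIdx false true (λ j ℓ → q * shiftIdx true false Gγ j ℓ) j ℓ + b * (q * shiftIdx true false Gβ j ℓ) ≈ Em t (suc i) j k ℓ
        h zero zero = γβ-combo-zero _ _ refl (zeroʳ q)
        h zero (suc ℓ) = γβ-combo-zero _ _ (zeroʳ q) (zeroʳ q)
        h (suc j) zero = trans (solve 4 (λ g q b Y → g :* con 0 :+ b :* (q :* Y) := q :* (g :* con 0 :+ b :* Y)) refl g q b (Gβ j 0))
                            (trans (*-cong refl (IHE j 0)) (sym (E-shift t i j k 0)))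
        h (suc j) (suc ℓ) = trans (solve 5 (λ g q b X Y → g :* (q :* X) :+ b :* (q :* Y) := q :* (g :* X :+ b :* Y)) refl g q b (Gγ j ℓ) (Gβ j (suc ℓ)))
                            (trans (*-cong refl (IHE j (suc ℓ))) (sym (E-shift t i j k (suc ℓ))))

      -- An α/γ-strip: its square may carry any letter (or none), which gives
      -- the recurrences of D and E in k.
      DAG : ∀ s → isAG s ≡ true → ∀ j ℓ → Dcol t (s ∷ ss) j ℓ ≈ Dm t i j (suc k) ℓ
      DAG s e zero zero = trans (solve 2 (λ a d → a :* con 0 :+ d :* con 0 := d :* con 0 :+ con 0) refl a d) (sym (D-recurrence t i 0 k 0))
      DAG s e zero (suc l) = begin
        a * cellsGF α (square s ∷ ks) 0 l + d * 0# ≈⟨ +-cong (*-cong refl (GF-squareAG-α s e ks 0 l)) refl ⟩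
        a * shiftIdx false true Gα 0 l + d * 0# ≈⟨ solve 3 (λ a d X → a :* X :+ d :* con 0 := d :* con 0 :+ (a :* X :+ d :* con 0)) refl a d (shiftIdx false true Gα 0 l) ⟩
        d * 0# + Dcol t ss 0 l ≈⟨ +-cong refl (IHD 0 l) ⟩
        d * 0# + Dm t i 0 k l ≈⟨ sym (D-recurrence t i 0 k (suc l)) ⟩
        Dm t i 0 (suc k) (suc l) ∎
      DAG s e (suc m) zero = begin
        a * 0# + d * cellsGF δ (square s ∷ ks) m 0 ≈⟨ +-cong refl (*-cong refl (GF-squareAG-δ s e ks m 0)) ⟩
        a * 0# + d * (1# * 0# + (a * 0# + (b * Gβ m 0 + (g * 0# + d * Y)))) ≈⟨ solve 6 (λ a b g d Y Y' → a :* con 0 :+ d :* (con 1 :* con 0 :+ (a :* con 0 :+ (b :* Y' :+ (g :* con 0 :+ d :* Y))))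
                    := d :* ((a :* con 0 :+ d :* Y) :+ (g :* con 0 :+ b :* Y')) :+ con 0) refl a b g d Y Y' ⟩
        d * (Dcol t ss m 0 + Ecol t ss m 0) + 0# ≈⟨ +-cong (*-cong refl (+-cong (IHD m 0) (IHE m 0))) refl ⟩
        d * DEj t i (suc m) k 0 + Dℓ t i (suc m) k 0 ≈⟨ sym (D-recurrence t i (suc m) k 0) ⟩
        Dm t i (suc m) (suc k) 0 ∎
        where Y = shiftIdx true false Gδ m 0
              Y' = Gβ m 0
      DAG s e (suc m) (suc l) = begin
        a * cellsGF α (square s ∷ ks) (suc m) l + d * cellsGF δ (square s ∷ ks) m (suc l) ≈⟨ +-cong (*-cong refl (GF-squareAG-α s e ks (suc m) l)) (*-cong refl (GF-squareAG-δ s e ks m (suc l))) ⟩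
        a * A1 + d * (1# * A2 + (a * A3 + (b * A4 + (g * A5 + d * A6)))) ≈⟨ solve 10 (λ a b g d A1 A2 A3 A4 A5 A6 →
               a :* A1 :+ d :* (con 1 :* A2 :+ (a :* A3 :+ (b :* A4 :+ (g :* A5 :+ d :* A6))))
               := d :* ((a :* A3 :+ d :* A6) :+ (g :* A5 :+ b :* A4)) :+ (a :* A1 :+ d :* A2)) refl a b g d A1 A2 A3 A4 A5 A6 ⟩
        d * (Dcol t ss m (suc l) + Ecol t ss m (suc l)) + Dcol t ss (suc m) l ≈⟨ +-cong (*-cong refl (+-cong (IHD m (suc l)) (IHE m (suc l)))) (IHD (suc m) l) ⟩
        d * DEj t i (suc m) k (suc l) + Dℓ t i (suc m) k (suc l) ≈⟨ sym (D-recurrence t i (suc m) k (suc l)) ⟩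
        Dm t i (suc m) (suc k) (suc l) ∎
        where A1 = shiftIdx false true Gα (suc m) l
              A2 = Gδ m l
              A3 = Gα m l
              A4 = Gβ m (suc l)
              A5 = Gγ m l
              A6 = shiftIdx true false Gδ m (suc l)

      EAG : ∀ s → isAG s ≡ true → ∀ j ℓ → Ecol t (s ∷ ss) j ℓ ≈ Em t i j (suc k) ℓ
      EAG s e j zero = begin
        g * 0# + b * cellsGF β (square s ∷ ks) j 0 ≈⟨ +-cong refl (*-cong refl (GF-squareAG-β s e ks j 0)) ⟩
        g * 0# + b * (q * 0# + (a * 0# + (b * Y' + (g * 0# + d * Y)))) ≈⟨ solve 7 (λ a b g d q Y Y' → g :* con 0 :+ b :* (q :* con 0 :+ (a :* con 0 :+ (b :* Y' :+ (g :* con 0 :+ d :* Y))))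
                    := b :* ((a :* con 0 :+ d :* Y) :+ (g :* con 0 :+ b :* Y')) :+ q :* con 0) refl a b g d q Y Y' ⟩
        b * (Dcol t ss j 0 + Ecol t ss j 0) + q * 0# ≈⟨ +-cong (*-cong refl (+-cong (IHD j 0) (IHE j 0))) refl ⟩
        b * (Dm t i j k 0 + Em t i j k 0) + q * Eℓ t i j k 0 ≈⟨ sym (E-recurrence t i j k 0) ⟩
        Em t i j (suc k) 0 ∎
        where Y = shiftIdx true false Gδ j 0
              Y' = Gβ j 0
      EAG s e j (suc l) = begin
        g * cellsGF γ (square s ∷ ks) j l + b * cellsGF β (square s ∷ ks) j (suc l) ≈⟨ +-cong (*-cong refl (GF-squareAG-γ s e ks j l)) (*-cong refl (GF-squareAG-β s e ks j (suc l))) ⟩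
        g * (q * C1) + b * (q * C2 + (a * C3 + (b * C4 + (g * C5 + d * C6)))) ≈⟨ solve 11 (λ a b g d q C1 C2 C3 C4 C5 C6 →
               g :* (q :* C1) :+ b :* (q :* C2 :+ (a :* C3 :+ (b :* C4 :+ (g :* C5 :+ d :* C6))))
               := b :* ((a :* C3 :+ d :* C6) :+ (g :* C5 :+ b :* C4)) :+ q :* (g :* C1 :+ b :* C2)) refl a b g d q C1 C2 C3 C4 C5 C6 ⟩
        b * (Dcol t ss j (suc l) + Ecol t ss j (suc l)) + q * Ecol t ss j l ≈⟨ +-cong (*-cong refl (+-cong (IHD j (suc l)) (IHE j (suc l)))) (*-cong refl (IHE j l)) ⟩
        b * (Dm t i j k (suc l) + Em t i j k (suc l)) + q * Eℓ t i j k (suc l) ≈⟨ sym (E-recurrence t i j k (suc l)) ⟩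
        Em t i j (suc k) (suc l) ∎
        where C1 = shiftIdx false true Gγ j l
              C2 = Gβ j l
              C3 = Gα j l
              C4 = Gβ j (suc l)
              C5 = Gγ j l
              C6 = shiftIdx true false Gδ j (suc l)

    DE-theorem : ∀ t ss → All (λ s → isEmpty s ≡ false) ss → ∀ j ℓ →
            (Dcol t ss j ℓ ≈ Dm t (countᵇ isδ ss) j (countᵇ isAG ss) ℓ) × (Ecol t ss j ℓ ≈ Em t (countᵇ isδ ss) j (countᵇ isAG ss) ℓ)
    DE-theorem t [] [] j ℓ = D-base t j ℓ , E-base t j ℓ
    DE-theorem t (s ∷ ss) (e ∷ es) j ℓ = go s e
      where
      IH = DE-theorem t ss es
      open StripStep t ss (countᵇ isδ ss) (countᵇ isAG ss) (λ j ℓ → proj₁ (IH j ℓ)) (λ j ℓ → proj₂ (IH j ℓ))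
      go : ∀ s → isEmpty s ≡ false → (Dcol t (s ∷ ss) j ℓ ≈ Dm t (countᵇ isδ (s ∷ ss)) j (countᵇ isAG (s ∷ ss)) ℓ) × (Ecol t (s ∷ ss) j ℓ ≈ Em t (countᵇ isδ (s ∷ ss)) j (countᵇ isAG (s ∷ ss)) ℓ)
      go α _ = DAG α P.refl j ℓ , EAG α P.refl j ℓ
      go β _ = Dβ j ℓ , Eβ j ℓ
      go γ _ = DAG γ P.refl j ℓ , EAG γ P.refl j ℓ
      go δ _ = Dδ j ℓ , Eδ j ℓ

    -- The new 1-column: one tall rhombus per horizontal strip, then nothing for
    -- the t rows of 1-positions.
    tallsThenNone : List Label → ℕ → List Kind
    tallsThenNone ss t = map tallRh ss ++ replicate t noTile

    pred0-cong : ∀ {f h : ℕ → Carrier} → (∀ n → f n ≈ h n) → ∀ m → pred0 f m ≈ pred0 h m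
    pred0-cong e zero = refl
    pred0-cong e (suc m) = e m

    shiftℓ≈pred0 : ∀ G j ℓ → shiftIdx false true G j ℓ ≈ pred0 (λ ℓ' → G j ℓ') ℓ
    shiftℓ≈pred0 G j zero = refl
    shiftℓ≈pred0 G j (suc ℓ) = refl
    shiftj≈pred0 : ∀ G j ℓ → shiftIdx true false G j ℓ ≈ pred0 (λ j' → G j' ℓ) j
    shiftj≈pred0 G zero ℓ = refl
    shiftj≈pred0 G (suc j) ℓ = refl

    GF-tallAG : ∀ s → isAG s ≡ true → ∀ x ks j ℓ → cellsGF x (tallRh s ∷ ks) j ℓ ≈ q * shiftIdx false true (cellsGF x ks) j ℓ + (b * cellsGF β ks j ℓ + d * q * shiftIdx true false (cellsGF δ ks) j ℓ)
    GF-tallAG α _ x ks j ℓ = e3' _ _ _ _ _ _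
      where e3' : ∀ w A a' B g' C → w * A + (0# + (a' * B + (0# + (g' * C + 0#)))) ≈ w * A + (a' * B + g' * C)
            e3' = solve 6 (λ w A a' B g' C → w :* A :+ (con 0 :+ (a' :* B :+ (con 0 :+ (g' :* C :+ con 0)))) := w :* A :+ (a' :* B :+ g' :* C)) refl
    GF-tallAG γ _ x ks j ℓ = e3' _ _ _ _ _ _
      where e3' : ∀ w A a' B g' C → w * A + (0# + (a' * B + (0# + (g' * C + 0#)))) ≈ w * A + (a' * B + g' * C)
            e3' = solve 6 (λ w A a' B g' C → w :* A :+ (con 0 :+ (a' :* B :+ (con 0 :+ (g' :* C :+ con 0)))) := w :* A :+ (a' :* B :+ g' :* C)) refl

    GF-noTiles : ∀ t x j ℓ → cellsGF x (replicate t noTile) j ℓ ≈ origin j ℓ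
    GF-noTiles zero x j ℓ = refl
    GF-noTiles (suc t) x j ℓ = trans (GF-noTile x (replicate t noTile) j ℓ) (GF-noTiles t x j ℓ)

    A-base : ∀ j ℓ → origin j ℓ ≈ Am 0 j 0 ℓ
    A-base zero zero = refl
    A-base zero (suc ℓ) = refl
    A-base (suc j) zero = refl
    A-base (suc j) (suc ℓ) = refl

    A-theorem : ∀ t ss → All (λ s → isEmpty s ≡ false) ss → ∀ x j ℓ →
           cellsGF x (tallsThenNone ss t) j ℓ ≈ Am (countᵇ isδ ss) j (countᵇ isAG ss) ℓ
    A-theorem t [] [] x j ℓ = trans (GF-noTiles t x j ℓ) (A-base j ℓ)
    A-theorem t (s ∷ ss) (e ∷ es) x j ℓ = go s e
      where
      ks = tallsThenNone ss t
      i = countᵇ isδ ss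
      k = countᵇ isAG ss
      IH = A-theorem t ss es
      ag : ∀ s → isAG s ≡ true → cellsGF x (tallRh s ∷ ks) j ℓ ≈ Am i j (suc k) ℓ
      ag s e' = begin
        cellsGF x (tallRh s ∷ ks) j ℓ ≈⟨ GF-tallAG s e' x ks j ℓ ⟩
        q * shiftIdx false true (cellsGF x ks) j ℓ + (b * cellsGF β ks j ℓ + d * q * shiftIdx true false (cellsGF δ ks) j ℓ)
          ≈⟨ +-cong (*-cong refl (trans (shiftℓ≈pred0 _ j ℓ) (pred0-cong (λ ℓ' → IH x j ℓ') ℓ)))
               (+-cong (*-cong refl (IH β j ℓ)) (*-cong refl (trans (shiftj≈pred0 _ j ℓ) (pred0-cong (λ j' → IH δ j' ℓ) j)))) ⟩
        q * Z + (b * X + d * q * Y) ≈⟨ solve 6 (λ q b d X Y Z → q :* Z :+ (b :* X :+ d :* q :* Y) := b :* X :+ d :* q :* Y :+ q :* Z) refl q b d X Y Z ⟩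
        b * X + d * q * Y + q * Z ≈⟨ sym (A-recurrence i j k ℓ) ⟩
        Am i j (suc k) ℓ ∎
        where X = Am i j k ℓ
              Y = pred0 (λ j' → Am i j' k ℓ) j
              Z = pred0 (λ ℓ' → Am i j k ℓ') ℓ
      dl : ∀ j → cellsGF x (tallRh δ ∷ ks) j ℓ ≈ Am (suc i) j k ℓ
      dl zero = trans (drop-zeros-scaled _ _) (trans (zeroʳ _) (sym (A-row0 i k ℓ)))
      dl (suc j) = trans (drop-zeros-scaled _ _) (trans (*-cong refl (IH x j ℓ)) (sym (A-shift i j k ℓ)))
      go : ∀ s → isEmpty s ≡ false → cellsGF x (tallRh s ∷ ks) j ℓ ≈ Am (countᵇ isδ (s ∷ ss)) j (countᵇ isAG (s ∷ ss)) ℓ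
      go α _ = ag α P.refl
      go β _ = trans (drop-zeros _) (IH x j ℓ)
      go γ _ = ag γ P.refl
      go δ _ = dl j

    GF-corner-AD : ∀ ks j ℓ → cellsGF empty (corner isAD ∷ ks) j ℓ ≈ a * shiftIdx false true (cellsGF α ks) j ℓ + d * shiftIdx true false (cellsGF δ ks) j ℓ
    GF-corner-AD ks j ℓ = solve 4 (λ a d X Y → con 0 :+ (a :* X :+ (con 0 :+ (con 0 :+ (d :* Y :+ con 0)))) := a :* X :+ d :* Y) refl a d _ _
    GF-corner-BG : ∀ ks j ℓ → cellsGF empty (corner isBG ∷ ks) j ℓ ≈ g * shiftIdx false true (cellsGF γ ks) j ℓ + b * cellsGF β ks j ℓ
    GF-corner-BG ks j ℓ = solve 4 (λ g b X Y → con 0 :+ (con 0 :+ (b :* Y :+ (g :* X :+ (con 0 :+ con 0)))) := g :* X :+ b :* Y) refl g b _ _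

module Summation where

  open CellAutomaton
  open ListFacts
  open Recurrences

  update : ℕ → Label → (ℕ → Label) → ℕ → Label
  update p l f x = if x ≡ᵇ p then l else f x

  -- Shifting a filling one position up; `positions m` lists 1..m as `allVec` builds them.
  shiftPos : (ℕ → Label) → ℕ → Label
  shiftPos g zero = empty
  shiftPos g (suc x) = g x

  positions : ℕ → List ℕ
  positions zero = []
  positions (suc m) = 1 ∷ map suc (positions m)

  module Sums (R : CommutativeSemiring 0ℓ 0ℓ) (q a b g d : CommutativeSemiring.Carrier R) where
    open CommutativeSemiring R
    open Weights R q a b g d
    open Generating R q a b g d
    open import Relation.Binary.Reasoning.Setoid setoid
    open import Algebra.Solver.Ring.NaturalCoefficients.Default R

    -- `SumOver ps F` sums F over all fillings that label the positions ps
    -- arbitrarily and leave all other positions empty.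
    SumOver : List ℕ → ((ℕ → Label) → Carrier) → Carrier
    SumOver [] F = F (λ _ → empty)
    SumOver (p ∷ ps) F = Σℓ (λ l → SumOver ps (λ f → F (update p l f)))

    Extensional : ((ℕ → Label) → Carrier) → Set
    Extensional F = ∀ f h → (∀ x → f x ≡ h x) → F f ≈ F h

    Σℓ-cong : ∀ {h h' : Label → Carrier} → (∀ l → h l ≈ h' l) → Σℓ h ≈ Σℓ h'
    Σℓ-cong e = +-cong (e empty) (+-cong (e α) (+-cong (e β) (+-cong (e γ) (+-cong (e δ) refl))))

    SumOver-cong : ∀ ps {F G} → (∀ f → F f ≈ G f) → SumOver ps F ≈ SumOver ps G
    SumOver-cong [] e = e _
    SumOver-cong (p ∷ ps) e = Σℓ-cong (λ l → SumOver-cong ps (λ f → e (update p l f)))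

    update-ext : ∀ p l {f h : ℕ → Label} → (∀ x → f x ≡ h x) → ∀ x → update p l f x ≡ update p l h x
    update-ext p l e x with x ≡ᵇ p
    ... | true = P.refl
    ... | false = e x

    Extensional-update : ∀ {F} p l → Extensional F → Extensional (λ f → F (update p l f))
    Extensional-update p l E f h e = E _ _ (update-ext p l e)

    Σℓ-+ : ∀ (F G : Label → Carrier) → Σℓ (λ l → F l + G l) ≈ Σℓ F + Σℓ G
    Σℓ-+ F G = solve 10 (λ f1 f2 f3 f4 f5 g1 g2 g3 g4 g5 →
        (f1 :+ g1) :+ ((f2 :+ g2) :+ ((f3 :+ g3) :+ ((f4 :+ g4) :+ ((f5 :+ g5) :+ con 0))))
        := (f1 :+ (f2 :+ (f3 :+ (f4 :+ (f5 :+ con 0))))) :+ (g1 :+ (g2 :+ (g3 :+ (g4 :+ (g5 :+ con 0))))))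
      refl (F empty) (F α) (F β) (F γ) (F δ) (G empty) (G α) (G β) (G γ) (G δ)

    Σℓ-zero : Σℓ (λ _ → 0#) ≈ 0#
    Σℓ-zero = solve 0 (con 0 :+ (con 0 :+ (con 0 :+ (con 0 :+ (con 0 :+ con 0)))) := con 0) refl

    Σℓ-swap : ∀ (h : Label → Label → Carrier) → Σℓ (λ l → Σℓ (λ l' → h l l')) ≈ Σℓ (λ l' → Σℓ (λ l → h l l'))
    Σℓ-swap h = rows (empty ∷ α ∷ β ∷ γ ∷ δ ∷ [])
      where
      rows : ∀ ls → Σℓ (λ l → foldr (λ l' acc → h l l' + acc) 0# ls) ≈ foldr (λ l' acc → Σℓ (λ l → h l l') + acc) 0# ls
      rows [] = Σℓ-zero
      rows (l' ∷ ls) = trans (Σℓ-+ (λ l → h l l') (λ l → foldr (λ l'' acc → h l l'' + acc) 0# ls)) (+-cong refl (rows ls))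

    ≡ᵇ-both : ∀ z x y → (z ≡ᵇ x) ≡ true → (z ≡ᵇ y) ≡ true → x ≡ y
    ≡ᵇ-both zero zero zero e₁ e₂ = P.refl
    ≡ᵇ-both (suc z) (suc x) (suc y) e₁ e₂ = P.cong suc (≡ᵇ-both z x y e₁ e₂)

    update-comm : ∀ x y l l' f → (x ≡ y → ⊥) → ∀ z → update x l (update y l' f) z ≡ update y l' (update x l f) z
    update-comm x y l l' f ne z with z ≡ᵇ x in e₁ | z ≡ᵇ y in e₂
    ... | true | true = ⊥-elim (ne (≡ᵇ-both z x y e₁ e₂))
    ... | true | false = P.refl
    ... | false | true = P.refl
    ... | false | false = P.refl

    update-idem : ∀ x l l' f z → update x l (update x l' f) z ≡ update x l f z
    update-idem x l l' f z with z ≡ᵇ x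
    ... | true = P.refl
    ... | false = P.refl

    SumOver-swap : ∀ x y ps F → Extensional F → SumOver (x ∷ y ∷ ps) F ≈ SumOver (y ∷ x ∷ ps) F
    SumOver-swap x y ps F E with x ≟ y
    ... | yes P.refl =
          trans (Σℓ-cong (λ l → Σℓ-cong (λ l' → SumOver-cong ps (λ f → E _ _ (update-idem x l l' f)))))
          (sym (Σℓ-cong (λ l → Σℓ-cong (λ l' → SumOver-cong ps (λ f → E _ _ (update-idem x l l' f))))))
    ... | no ne =
          trans (Σℓ-cong (λ l → Σℓ-cong (λ l' → SumOver-cong ps (λ f → E _ _ (update-comm x y l l' f ne)))))
          (Σℓ-swap (λ l l' → SumOver ps (λ f → F (update y l' (update x l f)))))

    SumOver-↭ : ∀ {ps ps'} → ps ↭ ps' → ∀ F → Extensional F → SumOver ps F ≈ SumOver ps' F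
    SumOver-↭ ↭refl F E = refl
    SumOver-↭ (↭prep x p) F E = Σℓ-cong (λ l → SumOver-↭ p _ (Extensional-update x l E))
    SumOver-↭ {_ ∷ _ ∷ xs} {_ ∷ _ ∷ ys} (↭swap x y p) F E =
      trans (Σℓ-cong (λ l → Σℓ-cong (λ l' → SumOver-↭ p _ (Extensional-update y l' (Extensional-update x l E)))))
            (SumOver-swap x y ys F E)
    SumOver-↭ (↭trans p p') F E = trans (SumOver-↭ p F E) (SumOver-↭ p' F E)

    shiftPos-ext : ∀ {f h : ℕ → Label} → (∀ x → f x ≡ h x) → ∀ x → shiftPos f x ≡ shiftPos h x
    shiftPos-ext e zero = P.refl
    shiftPos-ext e (suc x) = e x

    shiftPos-update : ∀ p l g z → shiftPos (update p l g) z ≡ update (suc p) l (shiftPos g) z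
    shiftPos-update p l g zero = P.refl
    shiftPos-update p l g (suc z) = P.refl

    shiftPos-empty : ∀ z → shiftPos (λ _ → empty) z ≡ empty
    shiftPos-empty zero = P.refl
    shiftPos-empty (suc z) = P.refl

    SumOver-shift : ∀ ps G → Extensional G → SumOver ps (λ h → G (shiftPos h)) ≈ SumOver (map suc ps) G
    SumOver-shift [] G E = E _ _ shiftPos-empty
    SumOver-shift (p ∷ ps) G E = Σℓ-cong (λ l →
       trans (SumOver-cong ps (λ f → E _ _ (shiftPos-update p l f)))
             (SumOver-shift ps (λ f → G (update (suc p) l f)) (Extensional-update (suc p) l E)))

    sumR-++ : ∀ {A : Set} (Φ : A → Carrier) xs ys → sumR (map Φ (xs ++ ys)) ≈ sumR (map Φ xs) + sumR (map Φ ys)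
    sumR-++ Φ [] ys = sym (+-identityˡ _)
    sumR-++ Φ (x ∷ xs) ys = trans (+-cong refl (sumR-++ Φ xs ys)) (sym (+-assoc _ _ _))

    sumR-cong : ∀ {A : Set} {Φ Ψ : A → Carrier} xs → (∀ x → Φ x ≈ Ψ x) → sumR (map Φ xs) ≈ sumR (map Ψ xs)
    sumR-cong [] e = refl
    sumR-cong (x ∷ xs) e = +-cong (e x) (sumR-cong xs e)

    sumR-map : ∀ {A B : Set} (Φ : B → Carrier) (h : A → B) xs → sumR (map Φ (map h xs)) ≈ sumR (map (λ x → Φ (h x)) xs)
    sumR-map Φ h [] = refl
    sumR-map Φ h (x ∷ xs) = +-cong refl (sumR-map Φ h xs)

    vget-cons : ∀ {m} l (v : Vec Label m) z → vget (l ∷ v) z ≡ update 1 l (shiftPos (vget v)) z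
    vget-cons l v zero = P.refl
    vget-cons l v (suc zero) = P.refl
    vget-cons l v (suc (suc z)) = P.refl

    allVec-SumOver : ∀ m F → Extensional F → sumR (map (λ v → F (vget v)) (allVec m)) ≈ SumOver (positions m) F
    allVec-SumOver zero F E = +-identityʳ _
    allVec-SumOver (suc m) F E = begin
      sumR (map Φ (map (empty ∷_) A ++ (map (α ∷_) A ++ (map (β ∷_) A ++ (map (γ ∷_) A ++ (map (δ ∷_) A ++ []))))))
        ≈⟨ trans (sumR-++ Φ (M empty) _) (+-cong refl (trans (sumR-++ Φ (M α) _) (+-cong refl (trans (sumR-++ Φ (M β) _) (+-cong refl (trans (sumR-++ Φ (M γ) _) (+-cong refl (sumR-++ Φ (M δ) [])))))))) ⟩
      Σℓ (λ l → sumR (map Φ (map (l ∷_) A))) ≈⟨ Σℓ-cong (λ l → piece l) ⟩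
      SumOver (positions (suc m)) F ∎
      where
      A = allVec m
      M : Label → List (Vec Label (suc m))
      M l = map (l ∷_) A
      Φ = λ (v : Vec Label (suc m)) → F (vget v)
      piece : ∀ l → sumR (map Φ (map (l ∷_) A)) ≈ SumOver (map suc (positions m)) (λ f → F (update 1 l f))
      piece l = begin
        sumR (map Φ (map (l ∷_) A)) ≈⟨ sumR-map Φ (l ∷_) A ⟩
        sumR (map (λ v → F (vget (l ∷ v))) A) ≈⟨ sumR-cong A (λ v → E _ _ (vget-cons l v)) ⟩
        sumR (map (λ v → F (update 1 l (shiftPos (vget v)))) A) ≈⟨ allVec-SumOver m (λ h → F (update 1 l (shiftPos h))) (λ f h e → E _ _ (update-ext 1 l (shiftPos-ext e))) ⟩
        SumOver (positions m) (λ h → F (update 1 l (shiftPos h))) ≈⟨ SumOver-shift (positions m) (λ f → F (update 1 l f)) (Extensional-update 1 l E) ⟩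
        SumOver (map suc (positions m)) (λ f → F (update 1 l f)) ∎

    -- A tile of the new column: its position and its kind.  The next
    -- definitions run the automaton of `CellAutomaton` along a list of cells
    -- for a fixed filling f.
    Cell : Set
    Cell = ℕ × Kind

    cellsOK : Label → List Cell → (ℕ → Label) → Bool
    cellsOK x [] f = true
    cellsOK x ((p , k) ∷ cs) f = cellOK k x (f p) ∧ cellsOK (latest x (f p)) cs f

    cellsδ : List Cell → (ℕ → Label) → ℕ
    cellsδ [] f = 0
    cellsδ ((p , k) ∷ cs) f = bit (δStrip k (f p)) +ℕ cellsδ cs f

    cellsAG : List Cell → (ℕ → Label) → ℕ
    cellsAG [] f = 0
    cellsAG ((p , k) ∷ cs) f = bit (agStrip k (f p)) +ℕ cellsAG cs f

    cellsWeight : Label → List Cell → (ℕ → Label) → Carrier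
    cellsWeight x [] f = 1#
    cellsWeight x ((p , k) ∷ cs) f = cellWeight k x (f p) * cellsWeight (latest x (f p)) cs f

    cellsTerm : Label → List Cell → (ℕ → Label) → ℕ → ℕ → Carrier
    cellsTerm x cs f j ℓ = if cellsOK x cs f ∧ ((cellsδ cs f ≡ᵇ j) ∧ (cellsAG cs f ≡ᵇ ℓ)) then cellsWeight x cs f else 0#

    NotIn : ℕ → List Cell → Set
    NotIn p cs = All (λ c → (proj₁ c ≡ᵇ p) ≡ false) cs

    Distinct : List Cell → Set
    Distinct [] = ⊤
    Distinct (c ∷ cs) = NotIn (proj₁ c) cs × Distinct cs

    update-other : ∀ p l f p' → (p' ≡ᵇ p) ≡ false → update p l f p' ≡ f p'
    update-other p l f p' e = P.cong (λ c → if c then l else f p') e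

    cellsOK-update : ∀ p l f cs → NotIn p cs → ∀ x → cellsOK x cs (update p l f) ≡ cellsOK x cs f
    cellsOK-update p l f [] [] x = P.refl
    cellsOK-update p l f ((p' , k) ∷ cs) (e ∷ es) x rewrite update-other p l f p' e = P.cong (cellOK k x (f p') ∧_) (cellsOK-update p l f cs es _)
    cellsδ-update : ∀ p l f cs → NotIn p cs → cellsδ cs (update p l f) ≡ cellsδ cs f
    cellsδ-update p l f [] [] = P.refl
    cellsδ-update p l f ((p' , k) ∷ cs) (e ∷ es) rewrite update-other p l f p' e = P.cong (bit (δStrip k (f p')) +ℕ_) (cellsδ-update p l f cs es)
    cellsAG-update : ∀ p l f cs → NotIn p cs → cellsAG cs (update p l f) ≡ cellsAG cs f
    cellsAG-update p l f [] [] = P.refl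
    cellsAG-update p l f ((p' , k) ∷ cs) (e ∷ es) rewrite update-other p l f p' e = P.cong (bit (agStrip k (f p')) +ℕ_) (cellsAG-update p l f cs es)
    cellsWeight-update : ∀ p l f cs → NotIn p cs → ∀ x → cellsWeight x cs (update p l f) ≡ cellsWeight x cs f
    cellsWeight-update p l f [] [] x = P.refl
    cellsWeight-update p l f ((p' , k) ∷ cs) (e ∷ es) x rewrite update-other p l f p' e = P.cong (cellWeight k x (f p') *_) (cellsWeight-update p l f cs es _)

    cellTerm : Kind → Label → Label → Bool → ℕ → ℕ → Carrier → ℕ → ℕ → Carrier
    cellTerm k x l B c c' W j ℓ = if (cellOK k x l ∧ B) ∧ ((bit (δStrip k l) +ℕ c ≡ᵇ j) ∧ (bit (agStrip k l) +ℕ c' ≡ᵇ ℓ)) then cellWeight k x l * W else 0#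

    guard-mul : ∀ X w W → (if X then w * W else 0#) ≈ w * (if X then W else 0#)
    guard-mul true w W = refl
    guard-mul false w W = sym (zeroʳ w)

    guard-false : ∀ X (Y : Carrier) → X ≡ false → (if X then Y else 0#) ≈ 0#
    guard-false X Y P.refl = refl

    cellTerm-shift : ∀ (o D A : Bool) (w : Carrier) B c c' W j ℓ →
         (if (o ∧ B) ∧ ((bit D +ℕ c ≡ᵇ j) ∧ (bit A +ℕ c' ≡ᵇ ℓ)) then w * W else 0#)
         ≈ (if o then w * shiftIdx D A (λ j ℓ → if B ∧ ((c ≡ᵇ j) ∧ (c' ≡ᵇ ℓ)) then W else 0#) j ℓ else 0#)
    cellTerm-shift false D A w B c c' W j ℓ = refl
    cellTerm-shift true false false w B c c' W j ℓ = guard-mul _ w W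
    cellTerm-shift true false true w B c c' W j zero = trans (guard-false _ (w * W) (P.trans (P.cong (B ∧_) (∧-zeroʳ (c ≡ᵇ j))) (∧-zeroʳ B))) (sym (zeroʳ w))
    cellTerm-shift true false true w B c c' W j (suc ℓ) = guard-mul _ w W
    cellTerm-shift true true false w B c c' W zero ℓ = trans (guard-false _ (w * W) (∧-zeroʳ B)) (sym (zeroʳ w))
    cellTerm-shift true true false w B c c' W (suc j) ℓ = guard-mul _ w W
    cellTerm-shift true true true w B c c' W zero ℓ = trans (guard-false _ (w * W) (∧-zeroʳ B)) (sym (zeroʳ w))
    cellTerm-shift true true true w B c c' W (suc j) zero = trans (guard-false _ (w * W) (P.trans (P.cong (B ∧_) (∧-zeroʳ (c ≡ᵇ j))) (∧-zeroʳ B))) (sym (zeroʳ w))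
    cellTerm-shift true true true w B c c' W (suc j) (suc ℓ) = guard-mul _ w W

    SumOver-zero : ∀ ps → SumOver ps (λ _ → 0#) ≈ 0#
    SumOver-zero [] = refl
    SumOver-zero (p ∷ ps) = trans (Σℓ-cong (λ l → SumOver-zero ps)) (solve 0 (con 0 :+ (con 0 :+ (con 0 :+ (con 0 :+ (con 0 :+ con 0)))) := con 0) refl)

    SumOver-scale : ∀ ps w X → SumOver ps (λ f → w * X f) ≈ w * SumOver ps X
    SumOver-scale [] w X = refl
    SumOver-scale (p ∷ ps) w X = trans (Σℓ-cong (λ l → SumOver-scale ps w (λ f → X (update p l f))))
       (solve 6 (λ w a1 a2 a3 a4 a5 → w :* a1 :+ (w :* a2 :+ (w :* a3 :+ (w :* a4 :+ (w :* a5 :+ con 0))))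
                   := w :* (a1 :+ (a2 :+ (a3 :+ (a4 :+ (a5 :+ con 0)))))) refl w _ _ _ _ _)

    SumOver-shiftIdx : ∀ ps D A (H : (ℕ → Label) → ℕ → ℕ → Carrier) j ℓ →
       SumOver ps (λ f → shiftIdx D A (H f) j ℓ) ≈ shiftIdx D A (λ j ℓ → SumOver ps (λ f → H f j ℓ)) j ℓ
    SumOver-shiftIdx ps false false H j ℓ = refl
    SumOver-shiftIdx ps false true H j zero = SumOver-zero ps
    SumOver-shiftIdx ps false true H j (suc ℓ) = refl
    SumOver-shiftIdx ps true false H zero ℓ = SumOver-zero ps
    SumOver-shiftIdx ps true false H (suc j) ℓ = refl
    SumOver-shiftIdx ps true true H zero ℓ = SumOver-zero ps
    SumOver-shiftIdx ps true true H (suc j) zero = SumOver-zero ps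
    SumOver-shiftIdx ps true true H (suc j) (suc ℓ) = refl

    SumOver-linear : ∀ ps (o D A : Bool) w (H : (ℕ → Label) → ℕ → ℕ → Carrier) j ℓ →
       SumOver ps (λ f → if o then w * shiftIdx D A (H f) j ℓ else 0#) ≈ (if o then w * shiftIdx D A (λ j ℓ → SumOver ps (λ f → H f j ℓ)) j ℓ else 0#)
    SumOver-linear ps false D A w H j ℓ = SumOver-zero ps
    SumOver-linear ps true D A w H j ℓ = trans (SumOver-scale ps w _) (*-cong refl (SumOver-shiftIdx ps D A H j ℓ))

    -- Summing the automaton's term over all fillings of (distinct) cell
    -- positions is the generating function `cellsGF` of the kinds: peel off the
    -- lowest cell and sum over its label first.
    SumOver-cellsTerm : ∀ cs → Distinct cs → ∀ x j ℓ → SumOver (map proj₁ cs) (λ f → cellsTerm x cs f j ℓ) ≈ cellsGF x (map proj₂ cs) j ℓ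
    SumOver-cellsTerm [] tt x zero zero = refl
    SumOver-cellsTerm [] tt x zero (suc ℓ) = refl
    SumOver-cellsTerm [] tt x (suc j) zero = refl
    SumOver-cellsTerm [] tt x (suc j) (suc ℓ) = refl
    SumOver-cellsTerm ((p , k) ∷ cs) (ni , ds) x j ℓ = Σℓ-cong piece
      where
      ps = map proj₁ cs
      piece : ∀ l → SumOver ps (λ f → cellsTerm x ((p , k) ∷ cs) (update p l f) j ℓ)
                  ≈ (if cellOK k x l then cellWeight k x l * shiftIdx (δStrip k l) (agStrip k l) (cellsGF (latest x l) (map proj₂ cs)) j ℓ else 0#)
      piece l = begin
        SumOver ps (λ f → cellsTerm x ((p , k) ∷ cs) (update p l f) j ℓ) ≈⟨ SumOver-cong ps (λ f → ≡⇒≈ (term-update f)) ⟩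
        SumOver ps (λ f → cellTerm k x l (cellsOK (latest x l) cs f) (cellsδ cs f) (cellsAG cs f) (cellsWeight (latest x l) cs f) j ℓ) ≈⟨ SumOver-cong ps (λ f → cellTerm-shift (cellOK k x l) (δStrip k l) (agStrip k l) (cellWeight k x l) _ _ _ _ j ℓ) ⟩
        SumOver ps (λ f → if cellOK k x l then cellWeight k x l * shiftIdx (δStrip k l) (agStrip k l) (λ j ℓ → cellsTerm (latest x l) cs f j ℓ) j ℓ else 0#) ≈⟨ SumOver-linear ps (cellOK k x l) (δStrip k l) (agStrip k l) (cellWeight k x l) (λ f j ℓ → cellsTerm (latest x l) cs f j ℓ) j ℓ ⟩
        (if cellOK k x l then cellWeight k x l * shiftIdx (δStrip k l) (agStrip k l) (λ j ℓ → SumOver ps (λ f → cellsTerm (latest x l) cs f j ℓ)) j ℓ else 0#) ≈⟨ ifc (cellOK k x l) (*-cong refl (shiftIdx-cong (δStrip k l) (agStrip k l) (λ j ℓ → SumOver-cellsTerm cs ds (latest x l) j ℓ) j ℓ)) ⟩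
        (if cellOK k x l then cellWeight k x l * shiftIdx (δStrip k l) (agStrip k l) (cellsGF (latest x l) (map proj₂ cs)) j ℓ else 0#) ∎
        where
        ifc : ∀ o {Y Z} → Y ≈ Z → (if o then Y else 0#) ≈ (if o then Z else 0#)
        ifc true e = e
        ifc false e = refl

        term-update : ∀ f → cellsTerm x ((p , k) ∷ cs) (update p l f) j ℓ ≡ cellTerm k x l (cellsOK (latest x l) cs f) (cellsδ cs f) (cellsAG cs f) (cellsWeight (latest x l) cs f) j ℓ
        term-update f = P.trans (P.cong (λ u → cellTerm k x u (cellsOK (latest x u) cs f') (cellsδ cs f') (cellsAG cs f') (cellsWeight (latest x u) cs f') j ℓ) hd)
               (P.trans (P.cong₂ (λ B W → cellTerm k x l B (cellsδ cs f') (cellsAG cs f') W j ℓ) (cellsOK-update p l f cs ni _) (cellsWeight-update p l f cs ni _))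
                 (P.cong₂ (λ c c' → cellTerm k x l (cellsOK (latest x l) cs f) c c' (cellsWeight (latest x l) cs f) j ℓ) (cellsδ-update p l f cs ni) (cellsAG-update p l f cs ni)))
          where
          f' = update p l f
          hd : f' p ≡ l
          hd = P.cong (λ c → if c then l else f p) (≡ᵇ-refl p)

    cellsOK-ext : ∀ {f h} → (∀ z → f z ≡ h z) → ∀ x cs → cellsOK x cs f ≡ cellsOK x cs h
    cellsOK-ext e x [] = P.refl
    cellsOK-ext {f} {h} e x ((p , k) ∷ cs) rewrite e p = P.cong (cellOK k x (h p) ∧_) (cellsOK-ext e _ cs)
    cellsδ-ext : ∀ {f h} → (∀ z → f z ≡ h z) → ∀ cs → cellsδ cs f ≡ cellsδ cs h
    cellsδ-ext e [] = P.refl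
    cellsδ-ext {f} {h} e ((p , k) ∷ cs) rewrite e p = P.cong (bit (δStrip k (h p)) +ℕ_) (cellsδ-ext e cs)
    cellsAG-ext : ∀ {f h} → (∀ z → f z ≡ h z) → ∀ cs → cellsAG cs f ≡ cellsAG cs h
    cellsAG-ext e [] = P.refl
    cellsAG-ext {f} {h} e ((p , k) ∷ cs) rewrite e p = P.cong (bit (agStrip k (h p)) +ℕ_) (cellsAG-ext e cs)
    cellsWeight-ext : ∀ {f h} → (∀ z → f z ≡ h z) → ∀ x cs → cellsWeight x cs f ≡ cellsWeight x cs h
    cellsWeight-ext e x [] = P.refl
    cellsWeight-ext {f} {h} e x ((p , k) ∷ cs) rewrite e p = P.cong (cellWeight k x (h p) *_) (cellsWeight-ext e _ cs)

    cellsTerm-ext : ∀ x cs j ℓ → Extensional (λ f → cellsTerm x cs f j ℓ)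
    cellsTerm-ext x cs j ℓ f h e rewrite cellsOK-ext e x cs | cellsδ-ext e cs | cellsAG-ext e cs | cellsWeight-ext e x cs = refl

module Positions where

  open CellAutomaton
  open ListFacts

  length-snoc : ∀ (σ : List Ty) c → length (σ ∷ʳ c) ≡ suc (length σ)
  length-snoc [] c = P.refl
  length-snoc (x ∷ σ) c = P.cong suc (length-snoc σ c)

  ty-snoc : ∀ (σ : List Ty) c p → 1 ≤ p → p ≤ length σ → ty (σ ∷ʳ c) p ≡ ty σ p
  ty-snoc (x ∷ σ) c (suc zero) _ _ = P.refl
  ty-snoc (x ∷ σ) c (suc (suc p)) _ (s≤s le) = ty-snoc σ c (suc p) (s≤s z≤n) le

  ty-last : ∀ (σ : List Ty) c → ty (σ ∷ʳ c) (suc (length σ)) ≡ c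
  ty-last [] c = P.refl
  ty-last (x ∷ σ) c = ty-last σ c

  -- Positions of the type σ c obtained by adding a column of type c to the
  -- left of σ (of length n); N = n + 1 is the new column.
  module NewColumn (σ : List Ty) (c : Ty) where
    n = length σ
    σ' = σ ∷ʳ c
    N = suc n

    inRange-old : ∀ p → InRange n p → inRange σ p ≡ true
    inRange-old p (a , b) rewrite ≤ᵇ-true a | ≤ᵇ-true b = P.refl
    inRange-new : ∀ p → InRange n p → inRange σ' p ≡ true
    inRange-new p (a , b) rewrite length-snoc σ c | ≤ᵇ-true a | ≤ᵇ-true (m≤n⇒m≤1+n b) = P.refl
    inRange-N : inRange σ' N ≡ true
    inRange-N rewrite length-snoc σ c | ≤ᵇ-true (≤-refl {N}) = P.refl

    is02-old : ∀ p → InRange n p → is02 σ' p ≡ is02 σ p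
    is02-old p r rewrite inRange-old p r | inRange-new p r | ty-snoc σ c p (proj₁ r) (proj₂ r) = P.refl
    is1-old : ∀ p → InRange n p → is1 σ' p ≡ is1 σ p
    is1-old p r rewrite inRange-old p r | inRange-new p r | ty-snoc σ c p (proj₁ r) (proj₂ r) = P.refl
    is02N : is02 σ' N ≡ not (isOne c)
    is02N rewrite inRange-N | ty-last σ c = P.refl
    is1N : is1 σ' N ≡ isOne c
    is1N rewrite inRange-N | ty-last σ c = P.refl
    is1≡not-is02 : ∀ p → InRange n p → is1 σ p ≡ not (is02 σ p)
    is1≡not-is02 p r rewrite inRange-old p r with isOne (ty σ p)
    ... | true = P.refl
    ... | false = P.refl

    up-new : up (length σ') ≡ up n ∷ʳ N
    up-new rewrite length-snoc σ c = P.refl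

    -- The rows of the new column from bottom to top: the corner N, the 02-rows
    -- p < N (larger p lower), then the 1-rows.  This is its vertical strip.
    squareRows shortRows cellRows : List ℕ
    squareRows = filterᵇ (is02 σ) (down n)
    shortRows = filterᵇ (is1 σ) (down n)
    cellRows = N ∷ (squareRows ++ shortRows)

    vstrip-new : vstrip σ' N ≡ cellRows
    vstrip-new = P.cong (N ∷_) (P.cong₂ _++_ (filterᵇ-congA (All.map (λ {p} r → is02-old p r) (down-inRange n)))
                                          (filterᵇ-congA (All.map (λ {p} r → is1-old p r) (down-inRange n))))

    hstrip-old : ∀ p → InRange n p → hstrip σ' p ≡ hstrip σ p ∷ʳ N
    hstrip-old p (a , b) rewrite up-new | filterᵇ-++ (λ j → p ≤ᵇ j) (up n) (N ∷ []) | ≤ᵇ-true (m≤n⇒m≤1+n b) = P.refl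

    hstrip-N : hstrip σ' N ≡ N ∷ []
    hstrip-N rewrite up-new | filterᵇ-++ (λ j → N ≤ᵇ j) (up n) (N ∷ []) | ≤ᵇ-true (≤-refl {N})
      | filter-none (λ j → N ≤ᵇ j) (up n) (All.map (λ { (_ , b) → ≤ᵇ-false (s≤s b) }) (up-inRange n)) = P.refl

    hstrip-bounded : ∀ p → All (λ j → j ≤ n) (hstrip σ p)
    hstrip-bounded p = All-filterᵇ (λ j → p ≤ᵇ j) (All.map proj₂ (up-inRange n))

    cellRows↭down : cellRows ↭ down N
    cellRows↭down = ↭prep N
       (filter-partition (is02 σ) (is1 σ) (down n) (All.map (λ {p} r → is1≡not-is02 p r) (down-inRange n)))

module Translation where

  open CellAutomaton
  open ListFacts
  open Positions
  open Recurrences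
  open Summation

  -- The kinds of the tiles of a new column of type c: for c = 1 the tiles
  -- in the rows of 02-positions are tall rhombi and the other rows are empty.
  cornerKind : Ty → (Label → Bool) → Kind
  cornerKind t1 _ = noTile
  cornerKind t0 bot = corner bot
  cornerKind t2 bot = corner bot
  squareKind : Ty → Label → Kind
  squareKind t1 s = tallRh s
  squareKind t0 s = square s
  squareKind t2 s = square s
  shortKind : Ty → Kind
  shortKind t1 = noTile
  shortKind t0 = shortRh
  shortKind t2 = shortRh

  squareKind-δ : ∀ c s l → δStrip (squareKind c s) l ≡ isδ (latest s l)
  squareKind-δ t0 s l = P.refl
  squareKind-δ t1 s l = P.refl
  squareKind-δ t2 s l = P.refl

  squareKind-AG : ∀ c s l → agStrip (squareKind c s) l ≡ isAG (latest s l)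
  squareKind-AG t0 s l = P.refl
  squareKind-AG t1 s l = P.refl
  squareKind-AG t2 s l = P.refl

  shortKind-δ : ∀ c l → δStrip (shortKind c) l ≡ false
  shortKind-δ t0 l = P.refl
  shortKind-δ t1 l = P.refl
  shortKind-δ t2 l = P.refl

  shortKind-AG : ∀ c l → agStrip (shortKind c) l ≡ false
  shortKind-AG t0 l = P.refl
  shortKind-AG t1 l = P.refl
  shortKind-AG t2 l = P.refl

  isOne-02 : ∀ c → c ≢ t1 → isOne c ≡ false
  isOne-02 t0 _ = P.refl
  isOne-02 t1 c≢1 = ⊥-elim (c≢1 P.refl)
  isOne-02 t2 _ = P.refl

  cornerKind-02 : ∀ c → c ≢ t1 → ∀ bot → cornerKind c bot ≡ corner bot
  cornerKind-02 t0 _ bot = P.refl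
  cornerKind-02 t1 c≢1 bot = ⊥-elim (c≢1 P.refl)
  cornerKind-02 t2 _ bot = P.refl

  squareKind-02 : ∀ c → c ≢ t1 → ∀ s → squareKind c s ≡ square s
  squareKind-02 t0 _ s = P.refl
  squareKind-02 t1 c≢1 s = ⊥-elim (c≢1 P.refl)
  squareKind-02 t2 _ s = P.refl

  shortKind-02 : ∀ c → c ≢ t1 → shortKind c ≡ shortRh
  shortKind-02 t0 _ = P.refl
  shortKind-02 t1 c≢1 = ⊥-elim (c≢1 P.refl)
  shortKind-02 t2 _ = P.refl

  module ColumnAsCells (R : CommutativeSemiring 0ℓ 0ℓ) (q a b g d : CommutativeSemiring.Carrier R)
               (σ : List Ty) (T : Tab) (c : Ty) (bot : Label → Bool) where
    open CommutativeSemiring R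
    open Weights R q a b g d
    open Generating R q a b g d
    open Sums R q a b g d
    open NewColumn σ c
    import Relation.Binary.Reasoning.Setoid setoid as SR

    extendWith : (ℕ → Label) → Tab
    extendWith f p j = if j ≡ᵇ N then f p else T p j

    stripLabel : ℕ → Label
    stripLabel p = lastNonEmpty (hlabels σ T p)

    kindOf : ℕ → Kind
    kindOf p = if p ≡ᵇ N then cornerKind c bot else if is02 σ p then squareKind c (stripLabel p) else shortKind c

    cells : List Cell
    cells = map (λ p → (p , kindOf p)) cellRows

    extend-new : ∀ f p → extendWith f p N ≡ f p
    extend-new f p = P.cong (λ b → if b then f p else T p N) (≡ᵇ-refl N)
    extend-old : ∀ f p j → j ≤ n → extendWith f p j ≡ T p j
    extend-old f p j le = P.cong (λ b → if b then f p else T p j) (≤⇒≢ᵇ le)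

    hlabels-old : ∀ f p → InRange n p → hlabels σ' (extendWith f) p ≡ hlabels σ T p ∷ʳ f p
    hlabels-old f p r rewrite hstrip-old p r | map-++ (λ j → extendWith f p j) (hstrip σ p) (N ∷ []) | extend-new f p =
      P.cong (_∷ʳ f p) (map-cong-local (All.map (λ {j} le → extend-old f p j le) (hstrip-bounded p)))

    hlabels-new : ∀ f → hlabels σ' (extendWith f) N ≡ f N ∷ []
    hlabels-new f rewrite hstrip-N | extend-new f N = P.refl

    seesRight-old : ∀ f p → InRange n p → seesRight σ' (extendWith f) p N ≡ stripLabel p
    seesRight-old f p r rewrite hstrip-old p r | before-snoc N (hstrip σ p) (All.map ≤⇒≢ᵇ (hstrip-bounded p)) =
      P.cong lastNonEmpty (map-cong-local (All.map (λ {j} le → extend-old f p j le) (hstrip-bounded p)))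

    seesRight-corner : ∀ f → seesRight σ' (extendWith f) N N ≡ empty
    seesRight-corner f rewrite hstrip-N | before-head N [] = P.refl

    seesBelow-new : ∀ f p → seesBelow σ' (extendWith f) p N ≡ lastNonEmpty (map f (before p cellRows))
    seesBelow-new f p = P.trans (P.cong (λ L → lastNonEmpty (map (λ p' → extendWith f p' N) (before p L))) vstrip-new)
                     (P.cong lastNonEmpty (map-cong-local {xs = before p cellRows} (All.tabulate (λ {p'} _ → extend-new f p'))))

    tileWeight≡tileWeightOf : ∀ σ T p j → tileWeight σ T p j ≡ tileWeightOf (isSquare σ p j) (isTall σ p j) (T p j) (seesRight σ T p j) (seesBelow σ T p j)
    tileWeight≡tileWeightOf σ T p j with isSquare σ p j | isTall σ p j | T p j
    ... | true | _ | empty with seesRight σ T p j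
    ...   | β = P.refl
    ...   | δ = P.refl
    ...   | α = P.refl
    ...   | γ = P.refl
    ...   | empty = P.refl
    tileWeight≡tileWeightOf σ T p j | true | _ | α = P.refl
    tileWeight≡tileWeightOf σ T p j | true | _ | β = P.refl
    tileWeight≡tileWeightOf σ T p j | true | _ | γ = P.refl
    tileWeight≡tileWeightOf σ T p j | true | _ | δ = P.refl
    tileWeight≡tileWeightOf σ T p j | false | true | empty with seesRight σ T p j
    ...   | β = P.refl
    ...   | δ = P.refl
    ...   | α = P.refl
    ...   | γ = P.refl
    ...   | empty = P.refl
    tileWeight≡tileWeightOf σ T p j | false | true | β = P.refl
    tileWeight≡tileWeightOf σ T p j | false | true | δ = P.refl
    tileWeight≡tileWeightOf σ T p j | false | true | α = P.refl
    tileWeight≡tileWeightOf σ T p j | false | true | γ = P.refl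
    tileWeight≡tileWeightOf σ T p j | false | false | empty with seesBelow σ T p j
    ...   | α = P.refl
    ...   | γ = P.refl
    ...   | β = P.refl
    ...   | δ = P.refl
    ...   | empty = P.refl
    tileWeight≡tileWeightOf σ T p j | false | false | α = P.refl
    tileWeight≡tileWeightOf σ T p j | false | false | γ = P.refl
    tileWeight≡tileWeightOf σ T p j | false | false | β = P.refl
    tileWeight≡tileWeightOf σ T p j | false | false | δ = P.refl

    module _ (p : ℕ) (r : InRange n p) where
      isSquare-old : isSquare σ' p N ≡ is02 σ p ∧ (not (isOne c) ∧ true)
      isSquare-old rewrite is02-old p r | is02N | ≤ᵇ-true (m≤n⇒m≤1+n (proj₂ r)) = P.refl
      isShort-old : isShort σ' p N ≡ not (is02 σ p) ∧ (not (isOne c) ∧ true)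
      isShort-old rewrite is1-old p r | is02N | <ᵇ-true (s≤s (proj₂ r)) | is1≡not-is02 p r = P.refl
      isTall-old : isTall σ' p N ≡ is02 σ p ∧ (isOne c ∧ true)
      isTall-old rewrite is02-old p r | is1N | <ᵇ-true (s≤s (proj₂ r)) = P.refl
      isTile-old : isTile σ' p N ≡ (is02 σ p ∧ (not (isOne c) ∧ true)) ∨ ((not (is02 σ p) ∧ (not (isOne c) ∧ true)) ∨ (is02 σ p ∧ (isOne c ∧ true)))
      isTile-old rewrite isSquare-old | isShort-old | isTall-old = P.refl
      kind-old : kindOf p ≡ (if is02 σ p then squareKind c (stripLabel p) else shortKind c)
      kind-old = P.cong (λ z → if z then cornerKind c bot else if is02 σ p then squareKind c (stripLabel p) else shortKind c) (≤⇒≢ᵇ (proj₂ r))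

    short-ignoresRight : ∀ l r r' x → tileWeightOf false false l r x ≡ tileWeightOf false false l r' x
    short-ignoresRight empty r r' x = P.refl
    short-ignoresRight α r r' x = P.refl
    short-ignoresRight β r r' x = P.refl
    short-ignoresRight γ r r' x = P.refl
    short-ignoresRight δ r r' x = P.refl

    tileWeight-old : ∀ f p → InRange n p → (if isTile σ' p N then tileWeight σ' (extendWith f) p N else 1#) ≡ cellWeight (kindOf p) (seesBelow σ' (extendWith f) p N) (f p)
    tileWeight-old f p r rewrite tileWeight≡tileWeightOf σ' (extendWith f) p N | extend-new f p | seesRight-old f p r | isTile-old p r | isSquare-old p r | isTall-old p r | kind-old p r
      = go (is02 σ p) c (seesBelow σ' (extendWith f) p N)
      where
      go : ∀ e c x → (if (e ∧ (not (isOne c) ∧ true)) ∨ ((not e ∧ (not (isOne c) ∧ true)) ∨ (e ∧ (isOne c ∧ true)))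
                      then tileWeightOf (e ∧ (not (isOne c) ∧ true)) (e ∧ (isOne c ∧ true)) (f p) (stripLabel p) x else 1#)
                     ≡ cellWeight (if e then squareKind c (stripLabel p) else shortKind c) x (f p)
      go true t0 x = P.refl
      go true t1 x = P.refl
      go true t2 x = P.refl
      go false t0 x = short-ignoresRight (f p) (stripLabel p) empty x
      go false t1 x = P.refl
      go false t2 x = short-ignoresRight (f p) (stripLabel p) empty x

    seesBelow-corner : ∀ f → seesBelow σ' (extendWith f) N N ≡ empty
    seesBelow-corner f = P.trans (seesBelow-new f N) (P.cong (λ L → lastNonEmpty (map f L)) (before-head N (squareRows ++ shortRows)))

    N≮N : (N <ᵇ N) ≡ false
    N≮N = ltf n
      where ltf : ∀ m → (suc m <ᵇ suc m) ≡ false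
            ltf zero = P.refl
            ltf (suc m) = ltf m

    isSquare-N : isSquare σ' N N ≡ not (isOne c) ∧ (not (isOne c) ∧ true)
    isSquare-N rewrite is02N | ≤ᵇ-true (≤-refl {N}) = P.refl
    isTall-N : isTall σ' N N ≡ false
    isTall-N rewrite N≮N | ∧-zeroʳ (is1 σ' N) = ∧-zeroʳ (is02 σ' N)
    isShort-N : isShort σ' N N ≡ false
    isShort-N rewrite N≮N | ∧-zeroʳ (is02 σ' N) = ∧-zeroʳ (is1 σ' N)
    isTile-N : isTile σ' N N ≡ (not (isOne c) ∧ (not (isOne c) ∧ true)) ∨ (false ∨ false)
    isTile-N rewrite isSquare-N | isShort-N | isTall-N = P.refl
    kind-corner : kindOf N ≡ cornerKind c bot
    kind-corner = P.cong (λ z → if z then cornerKind c bot else if is02 σ N then squareKind c (stripLabel N) else shortKind c) (≡ᵇ-refl N)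

    tileWeight-corner : ∀ f → (if isTile σ' N N then tileWeight σ' (extendWith f) N N else 1#) ≡ cellWeight (kindOf N) (seesBelow σ' (extendWith f) N N) (f N)
    tileWeight-corner f rewrite tileWeight≡tileWeightOf σ' (extendWith f) N N | extend-new f N | seesRight-corner f | seesBelow-corner f | isTile-N | isSquare-N | isTall-N | kind-corner = go c
      where
      go : ∀ c → (if (not (isOne c) ∧ (not (isOne c) ∧ true)) ∨ (false ∨ false) then tileWeightOf (not (isOne c) ∧ (not (isOne c) ∧ true)) false (f N) empty empty else 1#) ≡ cellWeight (cornerKind c bot) empty (f N)
      go t0 = P.refl
      go t1 = P.refl
      go t2 = P.refl

    prod-filter : ∀ (Q : ℕ → Bool) (w : ℕ → Carrier) xs → prod (map w (filterᵇ Q xs)) ≈ prod (map (λ p → if Q p then w p else 1#) xs)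
    prod-filter Q w [] = refl
    prod-filter Q w (x ∷ xs) with Q x
    ... | true = *-cong refl (prod-filter Q w xs)
    ... | false = trans (prod-filter Q w xs) (sym (*-identityˡ _))

    prod-↭ : ∀ (h : ℕ → Carrier) {xs ys} → xs ↭ ys → prod (map h xs) ≈ prod (map h ys)
    prod-↭ h ↭refl = refl
    prod-↭ h (↭prep x p) = *-cong refl (prod-↭ h p)
    prod-↭ h (↭swap x y p) = trans (*-cong refl (*-cong refl (prod-↭ h p)))
       (trans (sym (*-assoc _ _ _)) (trans (*-cong (*-comm _ _) refl) (*-assoc _ _ _)))
    prod-↭ h (↭trans p p') = trans (prod-↭ h p) (prod-↭ h p')

    up↭cellRows : up n ∷ʳ N ↭ cellRows
    up↭cellRows = ↭trans (↭-sym (∷↭∷ʳ N (up n))) (↭trans (↭prep N (↭-sym (down↭up n))) (↭-sym cellRows↭down))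

    distinct-cellRows : DistinctN cellRows
    distinct-cellRows = distinct-↭ (↭-sym cellRows↭down) (distinct-down N)

    rows-inRange : All (InRange n) (squareRows ++ shortRows)
    rows-inRange = AllP.++⁺ (All-filterᵇ (is02 σ) (down-inRange n)) (All-filterᵇ (is1 σ) (down-inRange n))

    prod≡cellsWeight : ∀ (f : ℕ → Label) (K : ℕ → Kind) ps → DistinctN ps → ∀ x →
           prod (map (λ p → cellWeight (K p) (lastSeen x (map f (before p ps))) (f p)) ps) ≡ cellsWeight x (map (λ p → (p , K p)) ps) f
    prod≡cellsWeight f K [] tt x = P.refl
    prod≡cellsWeight f K (p ∷ ps) (ni , dn) x = P.cong₂ _*_ (P.cong (λ L → cellWeight (K p) (lastSeen x (map f L)) (f p)) (before-head p ps))
       (P.trans (P.cong prod (map-cong-local (All.map (λ {p'} e → P.cong (λ L → cellWeight (K p') (lastSeen x (map f L)) (f p')) (before-cons p' p ps e)) ni)))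
                (prod≡cellsWeight f K ps dn (latest x (f p))))

    colWeight≈cellsWeight : ∀ f → colWeight σ' (extendWith f) N ≈ cellsWeight empty cells f
    colWeight≈cellsWeight f = begin
      colWeight σ' (extendWith f) N ≡⟨⟩
      prod (map tw (filterᵇ isT (up n ∷ʳ N))) ≈⟨ prod-filter isT tw (up n ∷ʳ N) ⟩
      prod (map h (up n ∷ʳ N)) ≈⟨ prod-↭ h up↭cellRows ⟩
      prod (map h cellRows) ≡⟨ P.cong prod (map-cong-local {xs = cellRows} (tileWeight-corner f ∷ All.map (λ {p} r → tileWeight-old f p r) rows-inRange)) ⟩
      prod (map (λ p → cellWeight (kindOf p) (seesBelow σ' (extendWith f) p N) (f p)) cellRows) ≡⟨ P.cong prod (map-cong-local {xs = cellRows} (All.tabulate (λ {p} _ → P.cong (λ x → cellWeight (kindOf p) x (f p)) (P.trans (seesBelow-new f p) (lastNonEmpty≡lastSeen (map f (before p cellRows))))))) ⟩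
      prod (map (λ p → cellWeight (kindOf p) (lastSeen empty (map f (before p cellRows))) (f p)) cellRows) ≡⟨ prod≡cellsWeight f kindOf cellRows distinct-cellRows empty ⟩
      cellsWeight empty cells f ∎
      where
      open SR
      tw = λ p → tileWeight σ' (extendWith f) p N
      isT = λ p → isTile σ' p N
      h = λ p → if isT p then tw p else 1#

    newRow : List ℕ
    newRow = filterᵇ (is02 σ') (N ∷ [])
    oldRows : List ℕ
    oldRows = filterᵇ (is02 σ) (up n)

    rows02-split : filterᵇ (is02 σ') (up (length σ')) ≡ oldRows ++ newRow
    rows02-split rewrite up-new | filterᵇ-++ (is02 σ') (up n) (N ∷ []) = P.cong (_++ newRow) (filterᵇ-congA (All.map (λ {p} r → is02-old p r) (up-inRange n)))

    oldRows↭squareRows : oldRows ↭ squareRows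
    oldRows↭squareRows = filterᵇ-↭ (is02 σ) (↭-sym (down↭up n))

    oldRows-inRange : All (λ p → InRange n p) oldRows
    oldRows-inRange = All-filterᵇ (is02 σ) (up-inRange n)

    cellsδ-map : ∀ (K : ℕ → Kind) f ps → cellsδ (map (λ p → (p , K p)) ps) f ≡ sum (map (λ p → bit (δStrip (K p) (f p))) ps)
    cellsδ-map K f [] = P.refl
    cellsδ-map K f (p ∷ ps) = P.cong (bit (δStrip (K p) (f p)) +ℕ_) (cellsδ-map K f ps)
    cellsAG-map : ∀ (K : ℕ → Kind) f ps → cellsAG (map (λ p → (p , K p)) ps) f ≡ sum (map (λ p → bit (agStrip (K p) (f p))) ps)
    cellsAG-map K f [] = P.refl
    cellsAG-map K f (p ∷ ps) = P.cong (bit (agStrip (K p) (f p)) +ℕ_) (cellsAG-map K f ps)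

    strips≈cellCounts : ∀ (Q : Label → Bool) (dQ : Kind → Label → Bool) →
      (∀ s l → dQ (squareKind c s) l ≡ Q (latest s l)) → (∀ l → dQ (shortKind c) l ≡ false) → ∀ f →
      sum (map (λ p → bit (Q (lastNonEmpty (hlabels σ' (extendWith f) p)))) newRow) ≡ bit (dQ (cornerKind c bot) (f N)) →
      countᵇ (λ p → Q (lastNonEmpty (hlabels σ' (extendWith f) p))) (filterᵇ (is02 σ') (up (length σ'))) ≡ sum (map (λ p → bit (dQ (kindOf p) (f p))) cellRows)
    strips≈cellCounts Q dQ hs hr f hN = begin≡
      where
      open P.≡-Reasoning
      hq = λ p → bit (Q (lastNonEmpty (hlabels σ' (extendWith f) p)))
      hk = λ p → bit (dQ (kindOf p) (f p))
      ho = λ p → bit (Q (latest (stripLabel p) (f p)))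
      squareRows-sat : All (λ p → InRange n p × is02 σ p ≡ true) squareRows
      squareRows-sat = All.zip (All-filterᵇ (is02 σ) (down-inRange n) , filterᵇ-sat (is02 σ) (down n))
      shortRows-sat : All (λ p → InRange n p × is1 σ p ≡ true) shortRows
      shortRows-sat = All.zip (All-filterᵇ (is1 σ) (down-inRange n) , filterᵇ-sat (is1 σ) (down n))
      begin≡ : countᵇ (λ p → Q (lastNonEmpty (hlabels σ' (extendWith f) p))) (filterᵇ (is02 σ') (up (length σ'))) ≡ sum (map hk cellRows)
      begin≡ = begin
        countᵇ _ (filterᵇ (is02 σ') (up (length σ'))) ≡⟨ P.cong (countᵇ _) rows02-split ⟩
        countᵇ _ (oldRows ++ newRow) ≡⟨ count≡sum _ (oldRows ++ newRow) ⟩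
        sum (map hq (oldRows ++ newRow)) ≡⟨ P.cong sum (map-++ hq oldRows newRow) ⟩
        sum (map hq oldRows ++ map hq newRow) ≡⟨ sum-++ (map hq oldRows) (map hq newRow) ⟩
        sum (map hq oldRows) +ℕ sum (map hq newRow) ≡⟨ P.cong₂ _+ℕ_ (P.cong sum (map-cong-local (All.map (λ {p} r → P.cong (λ L → bit (Q L)) (P.trans (P.cong lastNonEmpty (hlabels-old f p r)) (lastNonEmpty-snoc (hlabels σ T p) (f p)))) oldRows-inRange))) hN ⟩
        sum (map ho oldRows) +ℕ bit (dQ (cornerKind c bot) (f N)) ≡⟨ P.cong₂ _+ℕ_ (sum-↭ (map⁺ ho oldRows↭squareRows)) (P.cong (λ K → bit (dQ K (f N))) (P.sym kind-corner)) ⟩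
        sum (map ho squareRows) +ℕ hk N ≡⟨ ℕₚ.+-comm (sum (map ho squareRows)) _ ⟩
        hk N +ℕ sum (map ho squareRows) ≡⟨ P.cong (hk N +ℕ_) (P.sym (ℕₚ.+-identityʳ _)) ⟩
        hk N +ℕ (sum (map ho squareRows) +ℕ 0) ≡⟨ P.cong (λ z → hk N +ℕ (z +ℕ 0)) (P.cong sum (map-cong-local (All.map (λ {p} (r , e) → P.sym (P.trans (P.cong (λ K → bit (dQ K (f p))) (P.trans (kind-old p r) (P.cong (λ z → if z then squareKind c (stripLabel p) else shortKind c) e))) (P.cong bit (hs (stripLabel p) (f p))))) squareRows-sat))) ⟩
        hk N +ℕ (sum (map hk squareRows) +ℕ 0) ≡⟨ P.cong (λ z → hk N +ℕ (sum (map hk squareRows) +ℕ z)) (P.sym (sum-zeros hk shortRows (All.map (λ {p} (r , e) → P.trans (P.cong (λ K → bit (dQ K (f p))) (P.trans (kind-old p r) (P.cong (λ z → if z then squareKind c (stripLabel p) else shortKind c) (P.trans (P.sym (not-involutive _)) (P.trans (P.cong not (P.sym (is1≡not-is02 p r))) (P.cong not e)))))) (P.cong bit (hr (f p)))) shortRows-sat))) ⟩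
        hk N +ℕ (sum (map hk squareRows) +ℕ sum (map hk shortRows)) ≡⟨ P.cong (hk N +ℕ_) (P.sym (P.trans (P.cong sum (map-++ hk squareRows shortRows)) (sum-++ (map hk squareRows) (map hk shortRows)))) ⟩
        sum (map hk cellRows) ∎

    allowedBy : Bool → Bool → Bool → Label → Bool
    allowedBy sq ta shiftIdx l = if sq then true else if ta then (isEmpty l ∨ isBD l) else if shiftIdx then (isEmpty l ∨ isAG l) else isEmpty l

    inRange-≤ : ∀ {j p} → j ≤ n → InRange j p → InRange n p
    inRange-≤ le (a , b) = a , ≤-trans b le

    allowed-old : ∀ p j → InRange n p → InRange n j → ∀ l → allowed σ' p j l ≡ allowed σ p j l
    allowed-old p j rp rj l = cong3 (λ x y z → allowedBy x y z l)
        (P.cong₂ (λ x y → x ∧ y ∧ (p ≤ᵇ j)) (is02-old p rp) (is02-old j rj))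
        (P.cong₂ (λ x y → x ∧ y ∧ (p <ᵇ j)) (is02-old p rp) (is1-old j rj))
        (P.cong₂ (λ x y → x ∧ y ∧ (p <ᵇ j)) (is1-old p rp) (is02-old j rj))

    valid₁-old valid₂-old valid₃-old valid₄-old : Bool
    valid₁-old = allᵇ (λ j → allᵇ (λ p → allowed σ p j (T p j)) (up j)) (up (length σ))
    valid₂-old = allᵇ (λ j → not (isEmpty (T j j))) (filterᵇ (is02 σ) (up (length σ)))
    valid₃-old = allᵇ (λ j → afterEmpty isAG (vlabels σ T j)) (filterᵇ (is02 σ) (up (length σ)))
    valid₄-old = allᵇ (λ p → afterEmpty isBD (hlabels σ T p)) (filterᵇ (is02 σ) (up (length σ)))

    allowedNew : (ℕ → Label) → Bool
    allowedNew f = allᵇ (λ p → allowed σ' p N (f p)) (up N)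

    valid₁-new : ∀ f → allᵇ (λ j → allᵇ (λ p → allowed σ' p j (extendWith f p j)) (up j)) (up (length σ')) ≡ valid₁-old ∧ (allowedNew f ∧ true)
    valid₁-new f rewrite up-new | allᵇ-snoc (λ j → allᵇ (λ p → allowed σ' p j (extendWith f p j)) (up j)) (up n) N =
      P.cong₂ (λ x y → x ∧ (y ∧ true))
        (allᵇ-congA (All.map (λ {j} rj → allᵇ-congA (All.map (λ {p} rp → P.trans (P.cong (allowed σ' p j) (extend-old f p j (proj₂ rj))) (allowed-old p j (inRange-≤ (proj₂ rj) rp) rj (T p j))) (up-inRange j))) (up-inRange n)))
        (allᵇ-congA {xs = up N} (All.tabulate (λ {p} _ → P.cong (allowed σ' p N) (extend-new f p))))

    newRow≡ : newRow ≡ (if not (isOne c) then N ∷ [] else [])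
    newRow≡ = P.cong (λ z → if z then N ∷ [] else []) is02N

    cornerNonempty cornerVertical : (ℕ → Label) → Bool
    cornerNonempty f = allᵇ (λ j → not (isEmpty (extendWith f j j))) newRow
    cornerVertical f = allᵇ (λ j → afterEmpty isAG (vlabels σ' (extendWith f) j)) newRow

    valid₂-new : ∀ f → allᵇ (λ j → not (isEmpty (extendWith f j j))) (filterᵇ (is02 σ') (up (length σ'))) ≡ valid₂-old ∧ cornerNonempty f
    valid₂-new f rewrite rows02-split | allᵇ-++ (λ j → not (isEmpty (extendWith f j j))) oldRows newRow =
      P.cong (_∧ cornerNonempty f) (allᵇ-congA (All.map (λ {j} rj → P.cong (λ l → not (isEmpty l)) (extend-old f j j (proj₂ rj))) oldRows-inRange))

    vstrip-old : ∀ j → InRange n j → vstrip σ' j ≡ vstrip σ j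
    vstrip-old j rj = P.cong (j ∷_) (P.cong₂ _++_ (filterᵇ-congA (All.map (λ {p} r → is02-old p (inRange-≤ le r)) (down-inRange (j ∸ 1))))
                                                    (filterᵇ-congA (All.map (λ {p} r → is1-old p (inRange-≤ le r)) (down-inRange (j ∸ 1)))))
      where le : j ∸ 1 ≤ n
            le = ≤-trans (ℕₚ.m∸n≤m j 1) (proj₂ rj)

    valid₃-new : ∀ f → allᵇ (λ j → afterEmpty isAG (vlabels σ' (extendWith f) j)) (filterᵇ (is02 σ') (up (length σ'))) ≡ valid₃-old ∧ cornerVertical f
    valid₃-new f rewrite rows02-split | allᵇ-++ (λ j → afterEmpty isAG (vlabels σ' (extendWith f) j)) oldRows newRow =
      P.cong (_∧ cornerVertical f) (allᵇ-congA (All.map (λ {j} rj → P.cong (afterEmpty isAG)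
         (P.trans (P.cong (map (λ p → extendWith f p j)) (vstrip-old j rj)) (map-cong-local {xs = vstrip σ j} (All.tabulate (λ {p} _ → extend-old f p j (proj₂ rj)))))) oldRows-inRange))

    hOKAll : (ℕ → Label) → Bool
    hOKAll f = allᵇ (λ p → not (isBD (stripLabel p)) ∨ isEmpty (f p)) oldRows

    valid₄-new : ∀ f → valid₄-old ≡ true → allᵇ (λ p → afterEmpty isBD (hlabels σ' (extendWith f) p)) (filterᵇ (is02 σ') (up (length σ'))) ≡ hOKAll f ∧ true
    valid₄-new f v4 rewrite rows02-split | allᵇ-++ (λ p → afterEmpty isBD (hlabels σ' (extendWith f) p)) oldRows newRow =
      P.cong₂ _∧_ (allᵇ-congA (All.map (λ {p} (r , e) → P.trans (P.cong (afterEmpty isBD) (hlabels-old f p r))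
                     (P.trans (afterEmpty-BD-snoc empty (hlabels σ T p) P.refl e (f p)) (P.cong (λ z → not (isBD z) ∨ isEmpty (f p)) (P.sym (lastNonEmpty≡lastSeen (hlabels σ T p))))))
                   (All.zip (oldRows-inRange , allᵇ→All _ oldRows v4))))
                  (P.trans (P.cong (allᵇ (λ p → afterEmpty isBD (hlabels σ' (extendWith f) p))) newRow≡) (fn c))
      where
      fn : ∀ c' → allᵇ (λ p → afterEmpty isBD (hlabels σ' (extendWith f) p)) (if not (isOne c') then N ∷ [] else []) ≡ true
      fn t1 = P.refl
      fn t0 rewrite hlabels-new f with isBD (f N)
      ... | true = P.refl
      ... | false = P.refl
      fn t2 rewrite hlabels-new f with isBD (f N)
      ... | true = P.refl
      ... | false = P.refl

    verticalCells : Label → List Cell → (ℕ → Label) → Bool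
    verticalCells x [] f = true
    verticalCells x ((p , k) ∷ cs) f = verticalOK k x (f p) ∧ verticalCells (latest x (f p)) cs f

    cellsOK-split : ∀ x cs f → cellsOK x cs f ≡ allᵇ (λ cl → labelOK (proj₂ cl) (f (proj₁ cl))) cs ∧ verticalCells x cs f
    cellsOK-split x [] f = P.refl
    cellsOK-split x ((p , k) ∷ cs) f = P.trans (P.cong (cellOK k x (f p) ∧_) (cellsOK-split (latest x (f p)) cs f)) (∧-interchange (labelOK k (f p)) (verticalOK k x (f p)) (allᵇ (λ cl → labelOK (proj₂ cl) (f (proj₁ cl))) cs) (verticalCells (latest x (f p)) cs f))

    verticalCells≡fold : ∀ f → (∀ p x l → verticalOK (kindOf p) x l ≡ (not (isAG x) ∨ isEmpty l)) → ∀ x ps →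
              verticalCells x (map (λ p → (p , kindOf p)) ps) f ≡ verticalFold x (map f ps)
    verticalCells≡fold f h x [] = P.refl
    verticalCells≡fold f h x (p ∷ ps) = P.cong₂ _∧_ (h p x (f p)) (verticalCells≡fold f h (latest x (f p)) ps)

    verticalCells-true : ∀ f → (∀ p x l → verticalOK (kindOf p) x l ≡ true) → ∀ x ps → verticalCells x (map (λ p → (p , kindOf p)) ps) f ≡ true
    verticalCells-true f h x [] = P.refl
    verticalCells-true f h x (p ∷ ps) rewrite h p x (f p) = verticalCells-true f h (latest x (f p)) ps

    verticalOK-02 : ∀ c' → isOne c' ≡ false → ∀ (b1 b2 : Bool) s x l → verticalOK (if b1 then cornerKind c' bot else if b2 then squareKind c' s else shortKind c') x l ≡ (not (isAG x) ∨ isEmpty l)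
    verticalOK-02 t0 _ true b2 s x l = P.refl
    verticalOK-02 t0 _ false true s x l = P.refl
    verticalOK-02 t0 _ false false s x l = P.refl
    verticalOK-02 t2 _ true b2 s x l = P.refl
    verticalOK-02 t2 _ false true s x l = P.refl
    verticalOK-02 t2 _ false false s x l = P.refl

    verticalOK-1 : ∀ c' → isOne c' ≡ true → ∀ (b1 b2 : Bool) s x l → verticalOK (if b1 then cornerKind c' bot else if b2 then squareKind c' s else shortKind c') x l ≡ true
    verticalOK-1 t1 _ true b2 s x l = P.refl
    verticalOK-1 t1 _ false true s x l = P.refl
    verticalOK-1 t1 _ false false s x l = P.refl

    allowedAt : (ℕ → Label) → ℕ → Bool
    allowedAt f p = allowed σ' p N (f p)
    hOK : (ℕ → Label) → ℕ → Bool
    hOK f p = not (isBD (stripLabel p)) ∨ isEmpty (f p)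
    cornerOK : (ℕ → Label) → Bool
    cornerOK f = if isOne c then true else (not (isEmpty (f N)) ∧ bot (f N))

    labelOKAt : (ℕ → Label) → ℕ → Bool
    labelOKAt f p = labelOK (kindOf p) (f p)

    labelOK-corner : ∀ f → labelOKAt f N ≡ allowedAt f N ∧ cornerOK f
    labelOK-corner f rewrite kind-corner = P.trans (go c (f N)) (P.cong (λ z → allowedBy z (isTall σ' N N) (isShort σ' N N) (f N) ∧ cornerOK f) (P.sym isSquare-N))
      where
      go : ∀ c' l → labelOK (cornerKind c' bot) l ≡ allowedBy (not (isOne c') ∧ (not (isOne c') ∧ true)) (isTall σ' N N) (isShort σ' N N) l ∧ (if isOne c' then true else (not (isEmpty l) ∧ bot l))
      go t0 l = P.refl
      go t2 l = P.refl
      go t1 l rewrite isTall-N | isShort-N = P.sym (∧-identityʳ (isEmpty l))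

    labelOK-square : ∀ f p → InRange n p → is02 σ p ≡ true → labelOKAt f p ≡ allowedAt f p ∧ hOK f p
    labelOK-square f p r e rewrite kind-old p r | e = P.trans (go c (f p)) (P.cong₂ (λ u v → allowedBy u v (isShort σ' p N) (f p) ∧ hOK f p) (P.sym (isSquare-old p r)) (P.sym (isTall-old p r)))
      where
      go : ∀ c' l → labelOK (squareKind c' (stripLabel p)) l ≡ allowedBy (is02 σ p ∧ (not (isOne c') ∧ true)) (is02 σ p ∧ (isOne c' ∧ true)) (isShort σ' p N) l ∧ (not (isBD (stripLabel p)) ∨ isEmpty l)
      go t0 l rewrite e = P.refl
      go t2 l rewrite e = P.refl
      go t1 l rewrite e = P.refl

    labelOK-short : ∀ f p → InRange n p → is02 σ p ≡ false → labelOKAt f p ≡ allowedAt f p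
    labelOK-short f p r e rewrite kind-old p r | e = P.sym (P.trans (cong3 (λ u v w → allowedBy u v w (f p)) (isSquare-old p r) (isTall-old p r) (isShort-old p r)) (go c (f p)))
      where
      go : ∀ c' l → allowedBy (is02 σ p ∧ (not (isOne c') ∧ true)) (is02 σ p ∧ (isOne c' ∧ true)) (not (is02 σ p) ∧ (not (isOne c') ∧ true)) l ≡ labelOK (shortKind c') l
      go t0 l rewrite e = P.refl
      go t2 l rewrite e = P.refl
      go t1 l rewrite e = P.refl

    -- The two Boolean rearrangements used to match `valid` with `cellsOK`
    -- (for a 02-column, resp. a 1-column): both sides are conjunctions of the
    -- same atoms, so the commutative-monoid solver for (Bool, ∧, true) applies.
    rearrange-02 : ∀ aS aR E V hS b r → ((true ∧ ((true ∧ (aS ∧ aR)) ∧ true)) ∧ ((true ∧ (E ∧ true)) ∧ ((true ∧ (V ∧ true)) ∧ (hS ∧ true)))) ∧ (b ∧ r)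
                                 ≡ (((true ∧ (E ∧ b)) ∧ ((aS ∧ hS) ∧ aR)) ∧ V) ∧ r
    rearrange-02 = ∧-solve 7 (λ aS aR E V hS b r →
      ((id ⊕ ((id ⊕ (aS ⊕ aR)) ⊕ id)) ⊕ ((id ⊕ (E ⊕ id)) ⊕ ((id ⊕ (V ⊕ id)) ⊕ (hS ⊕ id)))) ⊕ (b ⊕ r)
        ⊜ (((id ⊕ (E ⊕ b)) ⊕ ((aS ⊕ hS) ⊕ aR)) ⊕ V) ⊕ r) P.refl

    rearrange-1 : ∀ aN aS aR hS r → ((true ∧ ((aN ∧ (aS ∧ aR)) ∧ true)) ∧ ((true ∧ true) ∧ ((true ∧ true) ∧ (hS ∧ true)))) ∧ (true ∧ r)
                                 ≡ (((aN ∧ true) ∧ ((aS ∧ hS) ∧ aR)) ∧ true) ∧ r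
    rearrange-1 = ∧-solve 5 (λ aN aS aR hS r →
      ((id ⊕ ((aN ⊕ (aS ⊕ aR)) ⊕ id)) ⊕ ((id ⊕ id) ⊕ ((id ⊕ id) ⊕ (hS ⊕ id)))) ⊕ (id ⊕ r)
        ⊜ (((aN ⊕ id) ⊕ ((aS ⊕ hS) ⊕ aR)) ⊕ id) ⊕ r) P.refl

    module _ (f : ℕ → Label) where
      aS aR hS : Bool
      aS = allᵇ (allowedAt f) squareRows
      aR = allᵇ (allowedAt f) shortRows
      hS = allᵇ (hOK f) squareRows

      squareRows-02 : All (λ p → InRange n p × is02 σ p ≡ true) squareRows
      squareRows-02 = All.zip (All-filterᵇ (is02 σ) (down-inRange n) , filterᵇ-sat (is02 σ) (down n))
      shortRows-not02 : All (λ p → InRange n p × is02 σ p ≡ false) shortRows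
      shortRows-not02 = All.map (λ {p} (r , e) → r , P.trans (P.sym (not-involutive _)) (P.trans (P.cong not (P.sym (is1≡not-is02 p r))) (P.cong not e)))
                       (All.zip (All-filterᵇ (is1 σ) (down-inRange n) , filterᵇ-sat (is1 σ) (down n)))

      allowedNew≡ : allowedNew f ≡ allowedAt f N ∧ (aS ∧ aR)
      allowedNew≡ = P.trans (allᵇ-↭ (allowedAt f) up↭cellRows) (P.cong (allowedAt f N ∧_) (allᵇ-++ (allowedAt f) squareRows shortRows))

      hOKAll≡ : hOKAll f ≡ hS
      hOKAll≡ = allᵇ-↭ (hOK f) oldRows↭squareRows

      cellsOK≡ : cellsOK empty cells f ≡ ((allowedAt f N ∧ cornerOK f) ∧ ((aS ∧ hS) ∧ aR)) ∧ verticalCells empty cells f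
      cellsOK≡ = P.trans (cellsOK-split empty cells f) (P.cong (_∧ verticalCells empty cells f)
         (P.trans (allᵇ-map (λ cl → labelOK (proj₂ cl) (f (proj₁ cl))) (λ p → (p , kindOf p)) cellRows)
         (P.cong₂ _∧_ (labelOK-corner f) (P.trans (allᵇ-++ (labelOKAt f) squareRows shortRows)
            (P.cong₂ _∧_ (P.trans (allᵇ-congA (All.map (λ {p} (r , e) → labelOK-square f p r e) squareRows-02)) (allᵇ-∧ (allowedAt f) (hOK f) squareRows))
                         (allᵇ-congA (All.map (λ {p} (r , e) → labelOK-short f p r e) shortRows-not02)))))))

      valid-split : valid σ T ≡ true → valid₁-old ≡ true × valid₂-old ≡ true × valid₃-old ≡ true × valid₄-old ≡ true
      valid-split v = let (x1 , y1) = ∧-split v ; (x2 , y2) = ∧-split y1 ; (x3 , x4) = ∧-split y2 in x1 , x2 , x3 , x4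

      assembleValidity : ∀ {x1 x2 x3 x4 v1 v2 v3 a1 c2 c3 h b r o aN aS aR hS cz VF : Bool} (P' : Bool → Bool → Bool → Bool → Bool → Bool → Bool → Bool → Bool → Bool → Set) →
        x1 ≡ v1 ∧ (a1 ∧ true) → x2 ≡ v2 ∧ c2 → x3 ≡ v3 ∧ c3 → x4 ≡ h ∧ true → v1 ≡ true → v2 ≡ true → v3 ≡ true →
        a1 ≡ aN ∧ (aS ∧ aR) → h ≡ hS → o ≡ ((aN ∧ cz) ∧ ((aS ∧ hS) ∧ aR)) ∧ VF →
        P' aN aS aR hS c2 c3 cz VF b r → (∀ aN aS aR hS c2 c3 cz VF b r → P' aN aS aR hS c2 c3 cz VF b r →
          ((true ∧ ((aN ∧ (aS ∧ aR)) ∧ true)) ∧ ((true ∧ c2) ∧ ((true ∧ c3) ∧ (hS ∧ true)))) ∧ (b ∧ r) ≡ (((aN ∧ cz) ∧ ((aS ∧ hS) ∧ aR)) ∧ VF) ∧ r) →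
        (x1 ∧ (x2 ∧ (x3 ∧ x4))) ∧ (b ∧ r) ≡ o ∧ r
      assembleValidity P' P.refl P.refl P.refl P.refl P.refl P.refl P.refl P.refl P.refl P.refl pp rearrange = rearrange _ _ _ _ _ _ _ _ _ _ pp

      cornerLetter columnAG : Bool
      cornerLetter = not (isEmpty (f N))
      columnAG = afterEmpty isAG (map f cellRows)

      vlabels-new : vlabels σ' (extendWith f) N ≡ map f cellRows
      vlabels-new = P.trans (P.cong (map (λ p → extendWith f p N)) vstrip-new) (map-cong-local {xs = cellRows} (All.tabulate (λ {p} _ → extend-new f p)))

      validity-02 : isOne c ≡ false → valid σ T ≡ true → ∀ r → valid σ' (extendWith f) ∧ (bot (extendWith f N N) ∧ r) ≡ cellsOK empty cells f ∧ r
      validity-02 e v r = let (v1 , v2 , v3 , v4) = valid-split v in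
        assembleValidity {aN = allowedAt f N} {aS = aS} {aR = aR} {hS = hS} {cz = cornerOK f} {VF = verticalCells empty cells f} (λ aN aS aR hS c2 c3 cz VF b r → (aN ≡ true) × (c2 ≡ cornerLetter ∧ true) × (c3 ≡ columnAG ∧ true) × (cz ≡ cornerLetter ∧ b) × (VF ≡ columnAG))
          (valid₁-new f) (valid₂-new f) (valid₃-new f) (valid₄-new f v4) v1 v2 v3 allowedNew≡ hOKAll≡ cellsOK≡ (aN≡ , c2≡ , c3≡ , cz≡ , VF≡) rearrange
        where
        aN≡ : allowedAt f N ≡ true
        aN≡ = P.trans (P.cong (λ z → allowedBy z (isTall σ' N N) (isShort σ' N N) (f N)) isSquare-N) (P.cong (λ z → allowedBy (not z ∧ (not z ∧ true)) (isTall σ' N N) (isShort σ' N N) (f N)) e)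
        c2≡ : cornerNonempty f ≡ cornerLetter ∧ true
        c2≡ = P.trans (P.cong (allᵇ (λ j → not (isEmpty (extendWith f j j)))) newRow≡)
                (P.trans (P.cong (λ z → allᵇ (λ j → not (isEmpty (extendWith f j j))) (if not z then N ∷ [] else [])) e)
                  (P.cong (λ l → not (isEmpty l) ∧ true) (extend-new f N)))
        c3≡ : cornerVertical f ≡ columnAG ∧ true
        c3≡ = P.trans (P.cong (allᵇ (λ j → afterEmpty isAG (vlabels σ' (extendWith f) j))) newRow≡)
                (P.trans (P.cong (λ z → allᵇ (λ j → afterEmpty isAG (vlabels σ' (extendWith f) j)) (if not z then N ∷ [] else [])) e)
                  (P.cong (λ L → afterEmpty isAG L ∧ true) vlabels-new))
        cz≡ : cornerOK f ≡ cornerLetter ∧ bot (extendWith f N N)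
        cz≡ = P.trans (P.cong (λ z → if z then true else (not (isEmpty (f N)) ∧ bot (f N))) e) (P.cong (λ l → cornerLetter ∧ bot l) (P.sym (extend-new f N)))
        VF≡ : verticalCells empty cells f ≡ columnAG
        VF≡ = P.trans (verticalCells≡fold f (λ p x l → verticalOK-02 c e (p ≡ᵇ N) (is02 σ p) (stripLabel p) x l) empty cellRows) (verticalFold≡afterEmpty empty (map f cellRows) P.refl)
        rearrange : ∀ aN aS aR hS c2 c3 cz VF b r → (aN ≡ true) × (c2 ≡ cornerLetter ∧ true) × (c3 ≡ columnAG ∧ true) × (cz ≡ cornerLetter ∧ b) × (VF ≡ columnAG) →
          ((true ∧ ((aN ∧ (aS ∧ aR)) ∧ true)) ∧ ((true ∧ c2) ∧ ((true ∧ c3) ∧ (hS ∧ true)))) ∧ (b ∧ r) ≡ (((aN ∧ cz) ∧ ((aS ∧ hS) ∧ aR)) ∧ VF) ∧ r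
        rearrange .true aS aR hS ._ ._ ._ ._ b r (P.refl , P.refl , P.refl , P.refl , P.refl) = rearrange-02 aS aR cornerLetter columnAG hS b r

      validity-1 : isOne c ≡ true → (∀ l → bot l ≡ true) → valid σ T ≡ true → ∀ r → valid σ' (extendWith f) ∧ (bot (extendWith f N N) ∧ r) ≡ cellsOK empty cells f ∧ r
      validity-1 e bt v r = let (v1 , v2 , v3 , v4) = valid-split v in
        assembleValidity {aN = allowedAt f N} {aS = aS} {aR = aR} {hS = hS} {cz = cornerOK f} {VF = verticalCells empty cells f} (λ aN aS aR hS c2 c3 cz VF b r → (c2 ≡ true) × (c3 ≡ true) × (cz ≡ true) × (VF ≡ true) × (b ≡ true))
          (valid₁-new f) (valid₂-new f) (valid₃-new f) (valid₄-new f v4) v1 v2 v3 allowedNew≡ hOKAll≡ cellsOK≡ (c2≡ , c3≡ , cz≡ , VF≡ , bt _) rearrange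
        where
        c2≡ : cornerNonempty f ≡ true
        c2≡ = P.trans (P.cong (allᵇ (λ j → not (isEmpty (extendWith f j j)))) newRow≡)
                (P.cong (λ z → allᵇ (λ j → not (isEmpty (extendWith f j j))) (if not z then N ∷ [] else [])) e)
        c3≡ : cornerVertical f ≡ true
        c3≡ = P.trans (P.cong (allᵇ (λ j → afterEmpty isAG (vlabels σ' (extendWith f) j))) newRow≡)
                (P.cong (λ z → allᵇ (λ j → afterEmpty isAG (vlabels σ' (extendWith f) j)) (if not z then N ∷ [] else [])) e)
        cz≡ : cornerOK f ≡ true
        cz≡ = P.cong (λ z → if z then true else (not (isEmpty (f N)) ∧ bot (f N))) e
        VF≡ : verticalCells empty cells f ≡ true
        VF≡ = verticalCells-true f (λ p x l → verticalOK-1 c e (p ≡ᵇ N) (is02 σ p) (stripLabel p) x l) empty cellRows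
        rearrange : ∀ aN aS aR hS c2 c3 cz VF b r → (c2 ≡ true) × (c3 ≡ true) × (cz ≡ true) × (VF ≡ true) × (b ≡ true) →
          ((true ∧ ((aN ∧ (aS ∧ aR)) ∧ true)) ∧ ((true ∧ c2) ∧ ((true ∧ c3) ∧ (hS ∧ true)))) ∧ (b ∧ r) ≡ (((aN ∧ cz) ∧ ((aS ∧ hS) ∧ aR)) ∧ VF) ∧ r
        rearrange aN aS aR hS .true .true .true .true .true r (P.refl , P.refl , P.refl , P.refl , P.refl) = rearrange-1 aN aS aR hS r

module Assembly where

  open CellAutomaton
  open ListFacts
  open Positions
  open Recurrences
  open Summation
  open Translation

  positions≡up : ∀ m → positions m ≡ up m
  positions≡up zero = P.refl
  positions≡up (suc m) = P.trans (P.cong (λ L → 1 ∷ map suc L) (positions≡up m)) (P.sym (up-suc m))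

  lastSeen-member : ∀ {A : Set} (h : A → Label) {x} xs y → x ∈ xs → isEmpty (h x) ≡ false → isEmpty (lastSeen y (map h xs)) ≡ false
  lastSeen-member h (x ∷ xs) y (here P.refl) e = latest-letter-nonempty (h x) y (map h xs) e
    where
    latest-letter-nonempty : ∀ l y ls → isEmpty l ≡ false → isEmpty (lastSeen (latest y l) ls) ≡ false
    latest-letter-nonempty α y ls e = lastSeen-nonempty α ls P.refl
    latest-letter-nonempty β y ls e = lastSeen-nonempty β ls P.refl
    latest-letter-nonempty γ y ls e = lastSeen-nonempty γ ls P.refl
    latest-letter-nonempty δ y ls e = lastSeen-nonempty δ ls P.refl
  lastSeen-member h (x' ∷ xs) y (there m) e = lastSeen-member h xs (latest y (h x')) m e

  is1-cons : ∀ x (σ : List Ty) p → 1 ≤ p → is1 (x ∷ σ) (suc p) ≡ is1 σ p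
  is1-cons x σ (suc p) _ = P.refl

  nOnes≡count : ∀ (σ : List Ty) → length (filterᵇ (is1 σ) (up (length σ))) ≡ nOnes σ
  nOnes≡count [] = P.refl
  nOnes≡count (x ∷ σ) = P.trans (P.cong (λ L → length (filterᵇ (is1 (x ∷ σ)) L)) (up-suc (length σ))) (go (isOne x) P.refl)
    where
    tail-count : length (filterᵇ (is1 (x ∷ σ)) (map suc (up (length σ)))) ≡ nOnes σ
    tail-count = P.trans (P.cong length (filter-map (is1 (x ∷ σ)) suc (up (length σ))))
           (P.trans (length-map suc (filterᵇ (λ p → is1 (x ∷ σ) (suc p)) (up (length σ))))
             (P.trans (P.cong length (filterᵇ-congA {Q = λ p → is1 (x ∷ σ) (suc p)} {Q' = is1 σ} (All.map (λ {p} r → is1-cons x σ p (proj₁ r)) (up-inRange (length σ)))))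
               (nOnes≡count σ)))
    go : ∀ b → isOne x ≡ b → length (filterᵇ (is1 (x ∷ σ)) (1 ∷ map suc (up (length σ)))) ≡ nOnes (x ∷ σ)
    go true e rewrite e = P.cong suc tail-count
    go false e rewrite e = tail-count

  module Assemble (R : CommutativeSemiring 0ℓ 0ℓ) (q a b g d : CommutativeSemiring.Carrier R)
              (σ : List Ty) (T : Tab) (c : Ty) (bot : Label → Bool) where
    open CommutativeSemiring R
    open Weights R q a b g d
    open Generating R q a b g d
    open Sums R q a b g d
    open NewColumn σ c
    open ColumnAsCells R q a b g d σ T c bot

    stripLabels : List Label
    stripLabels = map stripLabel squareRows
    nShorts : ℕ
    nShorts = length shortRows

    rows≡cellRows : map proj₁ cells ≡ cellRows
    rows≡cellRows = P.trans (P.sym (map-∘ cellRows)) (map-id cellRows)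

    kinds≡cellKinds : map proj₂ cells ≡ cornerKind c bot ∷ (map (squareKind c) stripLabels ++ replicate nShorts (shortKind c))
    kinds≡cellKinds = P.trans (P.sym (map-∘ cellRows)) (P.cong₂ _∷_ kind-corner (P.trans (map-++ kindOf squareRows shortRows) (P.cong₂ _++_
        (P.trans (map-cong-local (All.map (λ {p} (r , e) → P.trans (kind-old p r) (P.cong (λ z → if z then squareKind c (stripLabel p) else shortKind c) e)) (squareRows-02 (λ _ → empty)))) (map-∘ squareRows))
        (P.trans (map-cong-local (All.map (λ {p} (r , e) → P.trans (kind-old p r) (P.cong (λ z → if z then squareKind c (stripLabel p) else shortKind c) e)) (shortRows-not02 (λ _ → empty)))) (map-const (shortKind c) shortRows)))))

    distinct-cells : Distinct cells
    distinct-cells = go cellRows distinct-cellRows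
      where
      go : ∀ ps → DistinctN ps → Distinct (map (λ p → (p , kindOf p)) ps)
      go [] tt = tt
      go (p ∷ ps) (ni , dn) = AllP.map⁺ ni , go ps dn

    nDelta≡ : nDelta σ T ≡ countᵇ isδ stripLabels
    nDelta≡ = P.trans (count-↭ (λ p → isδ (stripLabel p)) oldRows↭squareRows) (P.sym (count-map isδ stripLabel squareRows))
    nAG≡ : nAG σ T ≡ countᵇ isAG stripLabels
    nAG≡ = P.trans (count-↭ (λ p → isAG (stripLabel p)) oldRows↭squareRows) (P.sym (count-map isAG stripLabel squareRows))
    nOnes≡ : nOnes σ ≡ nShorts
    nOnes≡ = P.trans (P.sym (nOnes≡count σ)) (↭-length (↭-sym (filterᵇ-↭ (is1 σ) (down↭up n))))

    -- Every horizontal strip of a tableau contains a letter (its lowest square).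
    stripLabels-nonempty : valid σ T ≡ true → All (λ s → isEmpty s ≡ false) stripLabels
    stripLabels-nonempty v = AllP.map⁺ (All-resp-↭ oldRows↭squareRows (All.map (λ {p} (r , e) → ne p r e) (All.zip (oldRows-inRange , allᵇ→All _ oldRows (proj₁ (proj₂ (valid-split (λ _ → empty) v)))))))
      where
      ne : ∀ p → InRange n p → not (isEmpty (T p p)) ≡ true → isEmpty (stripLabel p) ≡ false
      ne p r e = P.trans (P.cong isEmpty (lastNonEmpty≡lastSeen (hlabels σ T p)))
         (lastSeen-member (T p) (hstrip σ p) empty (∈-filter (λ j → p ≤ᵇ j) (up n) (∈-up n p (proj₁ r) (proj₂ r)) (≤ᵇ-true (≤-refl {p}))) (ne' e))
        where ne' : ∀ {b} → not b ≡ true → b ≡ false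
              ne' {false} _ = P.refl

    summand : (ℕ → Label) → ℕ → ℕ → Carrier
    summand f j ℓ = if valid σ' (extendWith f) ∧ (bot (extendWith f N N) ∧ ((nDelta σ' (extendWith f) ≡ᵇ j) ∧ (nAG σ' (extendWith f) ≡ᵇ ℓ))) then colWeight σ' (extendWith f) N else 0#

    guard-cong : ∀ {X Y W W'} → X ≡ Y → W ≈ W' → (if X then W else 0#) ≈ (if Y then W' else 0#)
    guard-cong {true} P.refl e = e
    guard-cong {false} P.refl e = refl

    summand≈cellsTerm : (∀ f r → valid σ' (extendWith f) ∧ (bot (extendWith f N N) ∧ r) ≡ cellsOK empty cells f ∧ r) →
         (∀ f → nDelta σ' (extendWith f) ≡ cellsδ cells f) → (∀ f → nAG σ' (extendWith f) ≡ cellsAG cells f) →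
         ∀ f j ℓ → summand f j ℓ ≈ cellsTerm empty cells f j ℓ
    summand≈cellsTerm cond nD nA f j ℓ = guard-cong (P.trans (P.cong (λ z → valid σ' (extendWith f) ∧ (bot (extendWith f N N) ∧ z)) (P.cong₂ (λ u w → (u ≡ᵇ j) ∧ (w ≡ᵇ ℓ)) (nD f) (nA f))) (cond f _)) (colWeight≈cellsWeight f)

    -- If each summand is the automaton's term, `newColGF` is `cellsGF` of the
    -- kinds: enumerate fillings as `SumOver` and reorder positions to `cellRows`.
    newColGF≈cellsGF : (∀ f j ℓ → summand f j ℓ ≈ cellsTerm empty cells f j ℓ) → ∀ j ℓ → newColGF c bot σ T j ℓ ≈ cellsGF empty (map proj₂ cells) j ℓ
    newColGF≈cellsGF ptf j ℓ = begin
      newColGF c bot σ T j ℓ ≈⟨ sumR-cong (allVec N) (λ v → ptf (vget v) j ℓ) ⟩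
      sumR (map (λ v → cellsTerm empty cells (vget v) j ℓ) (allVec N)) ≈⟨ allVec-SumOver N (λ f → cellsTerm empty cells f j ℓ) (cellsTerm-ext empty cells j ℓ) ⟩
      SumOver (positions N) (λ f → cellsTerm empty cells f j ℓ) ≈⟨ SumOver-↭ (P.subst (_↭ cellRows) (P.sym (positions≡up N)) up↭cellRows) _ (cellsTerm-ext empty cells j ℓ) ⟩
      SumOver cellRows (λ f → cellsTerm empty cells f j ℓ) ≡⟨ P.cong (λ L → SumOver L (λ f → cellsTerm empty cells f j ℓ)) (P.sym rows≡cellRows) ⟩
      SumOver (map proj₁ cells) (λ f → cellsTerm empty cells f j ℓ) ≈⟨ SumOver-cellsTerm cells distinct-cells empty j ℓ ⟩
      cellsGF empty (map proj₂ cells) j ℓ ∎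
      where open import Relation.Binary.Reasoning.Setoid setoid

    newRowCount-02 : isOne c ≡ false → ∀ (Q : Label → Bool) f → sum (map (λ p → bit (Q (lastNonEmpty (hlabels σ' (extendWith f) p)))) newRow) ≡ bit (Q (f N))
    newRowCount-02 e Q f = P.trans (P.cong (λ L → sum (map (λ p → bit (Q (lastNonEmpty (hlabels σ' (extendWith f) p)))) L)) (P.trans newRow≡ (P.cong (λ z → if not z then N ∷ [] else []) e)))
       (P.trans (P.cong (λ L → bit (Q (lastNonEmpty L)) +ℕ 0) (hlabels-new f)) (ℕₚ.+-identityʳ _))

    newRowCount-1 : isOne c ≡ true → ∀ (Q : Label → Bool) f → sum (map (λ p → bit (Q (lastNonEmpty (hlabels σ' (extendWith f) p)))) newRow) ≡ 0
    newRowCount-1 e Q f = P.cong (λ L → sum (map (λ p → bit (Q (lastNonEmpty (hlabels σ' (extendWith f) p)))) L)) (P.trans newRow≡ (P.cong (λ z → if not z then N ∷ [] else []) e))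

    nDelta-cells : (∀ f → sum (map (λ p → bit (isδ (lastNonEmpty (hlabels σ' (extendWith f) p)))) newRow) ≡ bit (δStrip (cornerKind c bot) (f N))) →
                   ∀ f → nDelta σ' (extendWith f) ≡ cellsδ cells f
    nDelta-cells hN f = P.trans (strips≈cellCounts isδ δStrip (squareKind-δ c) (shortKind-δ c) f (hN f)) (P.sym (cellsδ-map kindOf f cellRows))

    nAG-cells : (∀ f → sum (map (λ p → bit (isAG (lastNonEmpty (hlabels σ' (extendWith f) p)))) newRow) ≡ bit (agStrip (cornerKind c bot) (f N))) →
                ∀ f → nAG σ' (extendWith f) ≡ cellsAG cells f
    nAG-cells hN f = P.trans (strips≈cellCounts isAG agStrip (squareKind-AG c) (shortKind-AG c) f (hN f)) (P.sym (cellsAG-map kindOf f cellRows))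

    newColGF-02 : c ≢ t1 → valid σ T ≡ true → ∀ j ℓ →
                  newColGF c bot σ T j ℓ ≈ cellsGF empty (corner bot ∷ squaresThenShorts stripLabels nShorts) j ℓ
    newColGF-02 c≢1 v j ℓ = trans (newColGF≈cellsGF summand≈term j ℓ) (≡⇒≈ (P.cong (λ L → cellsGF empty L j ℓ) kinds))
      where
      nc : isOne c ≡ false
      nc = isOne-02 c c≢1
      corner≡ : ∀ (Q : Kind → Label → Bool) l → Q (corner bot) l ≡ Q (cornerKind c bot) l
      corner≡ Q l = P.cong (λ K → Q K l) (P.sym (cornerKind-02 c c≢1 bot))
      summand≈term : ∀ f j ℓ → summand f j ℓ ≈ cellsTerm empty cells f j ℓ
      summand≈term = summand≈cellsTerm (λ f r → validity-02 f nc v r)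
        (nDelta-cells (λ f → P.trans (newRowCount-02 nc isδ f) (P.cong bit (corner≡ δStrip (f N)))))
        (nAG-cells (λ f → P.trans (newRowCount-02 nc isAG f) (P.cong bit (corner≡ agStrip (f N)))))
      kinds : map proj₂ cells ≡ corner bot ∷ squaresThenShorts stripLabels nShorts
      kinds = P.trans kinds≡cellKinds (P.cong₂ _∷_ (cornerKind-02 c c≢1 bot)
                (P.cong₂ _++_ (map-cong (squareKind-02 c c≢1) stripLabels) (P.cong (replicate nShorts) (shortKind-02 c c≢1))))

    newColGF-1 : c ≡ t1 → (∀ l → bot l ≡ true) → valid σ T ≡ true → ∀ j ℓ →
                 newColGF c bot σ T j ℓ ≈ cellsGF empty (noTile ∷ tallsThenNone stripLabels nShorts) j ℓ
    newColGF-1 P.refl bot-true v j ℓ = trans (newColGF≈cellsGF summand≈term j ℓ) (≡⇒≈ (P.cong (λ L → cellsGF empty L j ℓ) kinds≡cellKinds))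
      where
      summand≈term : ∀ f j ℓ → summand f j ℓ ≈ cellsTerm empty cells f j ℓ
      summand≈term = summand≈cellsTerm (λ f r → validity-1 f P.refl bot-true v r)
        (nDelta-cells (newRowCount-1 P.refl isδ)) (nAG-cells (newRowCount-1 P.refl isAG))

module Proof (R : CommutativeSemiring 0ℓ 0ℓ) (q a b g d : CommutativeSemiring.Carrier R) where

  open CellAutomaton
  open Recurrences
  open Assembly
  open CommutativeSemiring R
  open Weights R q a b g d
  open Generating R q a b g d
  open import Relation.Binary.Reasoning.Setoid setoid

  part-a : ∀ σ T → valid σ T ≡ true → ∀ j ℓ → newColGF t1 (λ _ → true) σ T j ℓ ≈ Am (nDelta σ T) j (nAG σ T) ℓ
  part-a σ T v j ℓ = begin
    newColGF t1 (λ _ → true) σ T j ℓ                   ≈⟨ F.newColGF-1 P.refl (λ _ → P.refl) v j ℓ ⟩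
    cellsGF empty (noTile ∷ tallsThenNone ls t) j ℓ    ≈⟨ GF-noTile empty (tallsThenNone ls t) j ℓ ⟩
    cellsGF empty (tallsThenNone ls t) j ℓ             ≈⟨ A-theorem t ls (F.stripLabels-nonempty v) empty j ℓ ⟩
    Am (countᵇ isδ ls) j (countᵇ isAG ls) ℓ            ≡⟨ P.cong₂ (λ i k → Am i j k ℓ) (P.sym F.nDelta≡) (P.sym F.nAG≡) ⟩
    Am (nDelta σ T) j (nAG σ T) ℓ                      ∎
    where
    module F = Assemble R q a b g d σ T t1 (λ _ → true)
    ls = F.stripLabels
    t = F.nShorts

  part-b : ∀ c → c ≢ t1 → ∀ σ T → valid σ T ≡ true → ∀ j ℓ →
           newColGF c isAD σ T j ℓ ≈ Dm (nOnes σ) (nDelta σ T) j (nAG σ T) ℓ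
  part-b c c≢1 σ T v j ℓ = begin
    newColGF c isAD σ T j ℓ                                    ≈⟨ F.newColGF-02 c≢1 v j ℓ ⟩
    cellsGF empty (corner isAD ∷ squaresThenShorts ls t) j ℓ   ≈⟨ GF-corner-AD (squaresThenShorts ls t) j ℓ ⟩
    Dcol t ls j ℓ                                              ≈⟨ proj₁ (DE-theorem t ls (F.stripLabels-nonempty v) j ℓ) ⟩
    Dm t (countᵇ isδ ls) j (countᵇ isAG ls) ℓ                  ≡⟨ P.cong₂ (λ (t i : ℕ) → Dm t i j (countᵇ isAG ls) ℓ) (P.sym F.nOnes≡) (P.sym F.nDelta≡) ⟩
    Dm (nOnes σ) (nDelta σ T) j (countᵇ isAG ls) ℓ             ≡⟨ P.cong (λ k → Dm (nOnes σ) (nDelta σ T) j k ℓ) (P.sym F.nAG≡) ⟩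
    Dm (nOnes σ) (nDelta σ T) j (nAG σ T) ℓ                    ∎
    where
    module F = Assemble R q a b g d σ T c isAD
    ls = F.stripLabels
    t = F.nShorts

  part-c : ∀ c → c ≢ t1 → ∀ σ T → valid σ T ≡ true → ∀ j ℓ →
           newColGF c isBG σ T j ℓ ≈ Em (nOnes σ) (nDelta σ T) j (nAG σ T) ℓ
  part-c c c≢1 σ T v j ℓ = begin
    newColGF c isBG σ T j ℓ                                    ≈⟨ F.newColGF-02 c≢1 v j ℓ ⟩
    cellsGF empty (corner isBG ∷ squaresThenShorts ls t) j ℓ   ≈⟨ GF-corner-BG (squaresThenShorts ls t) j ℓ ⟩
    Ecol t ls j ℓ                                              ≈⟨ proj₂ (DE-theorem t ls (F.stripLabels-nonempty v) j ℓ) ⟩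
    Em t (countᵇ isδ ls) j (countᵇ isAG ls) ℓ                  ≡⟨ P.cong₂ (λ (t i : ℕ) → Em t i j (countᵇ isAG ls) ℓ) (P.sym F.nOnes≡) (P.sym F.nDelta≡) ⟩
    Em (nOnes σ) (nDelta σ T) j (countᵇ isAG ls) ℓ             ≡⟨ P.cong (λ k → Em (nOnes σ) (nDelta σ T) j k ℓ) (P.sym F.nAG≡) ⟩
    Em (nOnes σ) (nDelta σ T) j (nAG σ T) ℓ                    ∎
    where
    module F = Assemble R q a b g d σ T c isBG
    ls = F.stripLabels
    t = F.nShorts

lemma6p5 : (R : CommutativeSemiring 0ℓ 0ℓ) (q a b g d : CommutativeSemiring.Carrier R) →
    let open CommutativeSemiring R using (_≈_)
        open Weights R q a b g d
    in (∀ (σ : List Ty) (T : Tab) (i j k ℓ : ℕ) →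
          valid σ T ≡ true → nDelta σ T ≡ i → nAG σ T ≡ k →
          newColGF t1 (λ _ → true) σ T j ℓ ≈ Am i j k ℓ)
     × (∀ (c : Ty) → c ≢ t1 → ∀ (σ : List Ty) (T : Tab) (t i j k ℓ : ℕ) →
          valid σ T ≡ true → nOnes σ ≡ t → nDelta σ T ≡ i → nAG σ T ≡ k →
          newColGF c isAD σ T j ℓ ≈ Dm t i j k ℓ)
     × (∀ (c : Ty) → c ≢ t1 → ∀ (σ : List Ty) (T : Tab) (t i j k ℓ : ℕ) →
          valid σ T ≡ true → nOnes σ ≡ t → nDelta σ T ≡ i → nAG σ T ≡ k →
          newColGF c isBG σ T j ℓ ≈ Em t i j k ℓ)
lemma6p5 R q a b g d =
    (λ { σ T i j k ℓ v P.refl P.refl → part-a σ T v j ℓ })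
  , (λ { c c≢1 σ T t i j k ℓ v P.refl P.refl P.refl → part-b c c≢1 σ T v j ℓ })
  , (λ { c c≢1 σ T t i j k ℓ v P.refl P.refl P.refl → part-c c c≢1 σ T v j ℓ })
  where open Proof R q a b g d
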